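{- Let $w$ be a word (with at least two distinct letters) of length $\ell$; let $c_{\mathrm{left}}$ (resp. $c_{\mathrm{right}}$) be the maximum length of a palindromic prefix (resp. suffix) of $w$, and $c_{\mathrm{repeat}}$ the maximum length of a string that is both a proper prefix and a proper suffix of $w$. Suppose $c_{\mathrm{left}}\leq c_{\mathrm{right}}$. Write $w=vs$ where $s$ is the suffix of length $c_{\mathrm{repeat}}$ (which is also a prefix of $w$), and write $w=p_{\mathrm{left}}u_1=u_2p_{\mathrm{right}}$ where $p_{\mathrm{left}}$ is the palindromic prefix of length $c_{\mathrm{left}}$ and $p_{\mathrm{right}}$ the palindromic suffix of length $c_{\mathrm{right}}$. Let $\Gamma_1=\mathrm{Grid}(v)$ and $\Gamma_2=\mathrm{Grid}(u_2u_1^{\mathrm{rev}})$. (a) If $c_{\mathrm{left}}+c_{\mathrm{right}}<2c_{\mathrm{repeat}}$, or if $w$ is a palindrome, then a one-dimensional grid is $w$-extremal if and only if it is equivalent to $\Gamma_1$. (b) If $c_{\mathrm{left}}+c_{\mathrm{right}}>2c_{\mathrm{repeat}}$, then a one-dimensional grid is $w$-extremal if and only if it is equivalent to $\Gamma_2$. (c) If $c_{\mathrm{left}}+c_{\mathrm{right}}=2c_{\mathrm{repeat}}$, then $\Gamma_1$ and $\Gamma_2$ are inequivalent and both $w$-extremal. Let $v'$ be the word formed by the last $\ell-c_{\mathrm{repeat}}$ letters of $u_2u_1^{\mathrm{rev}}$. Then a one-dimensional grid is $w$-extremal if and only if it is equivalent to $\mathrm{Grid}(v_1\cdots v_m)$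 for some positive integer $m$ and some $v_1,\ldots,v_m\in\{v,v'\}$. Moreover, there exist words $x,y,z$ with $v=xyzy^{\mathrm{rev}}$ and $v'=xyz^{\mathrm{rev}}y^{\mathrm{rev}}$.
   Context: A word is a finite string of letters; $u^{\mathrm{rev}}$ is the reverse of $u$; prefixes/suffixes are initial/final strings of consecutive letters, proper meaning not the whole word. For a nonempty word $u=u_0\cdots u_{k-1}$, $\mathrm{Grid}(u)$ is the map $\mathbb Z/k\mathbb Z\to\Sigma$, $i\mapsto u_i$. A one-dimensional grid of size $n$ is a map $\Gamma\colon\mathbb Z/n\mathbb Z\to\Sigma$; an appearance of $w=w_0\cdots w_{\ell-1}$ is a pair $(p,v)\in\mathbb Z/n\mathbb Z\times\{ -1,1\}$ with $\Gamma(p+iv)=w_i$ for $0\le i<\ell$; $c_1(w,\Gamma)$ is the number of appearances divided by $n$; $C_1(w)$ is its supremum over all one-dimensional grids; $\Gamma$ is $w$-extremal if $c_1(w,\Gamma)=C_1(w)$. Two grids are equivalent if their periodic extensions $\mathbb Z\to\Sigma$ (precomposing with $\mathbb Z\to\mathbb Z/n\mathbb Z$) differ by precomposition with an isometry of $\mathbb Z$ (translation, possibly combined with reflection). -}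

module Defs where

open import Data.Nat as ℕ using (ℕ; zero; suc; _∸_; _≤_; _<_)
open import Data.Integer as ℤ using (ℤ; +_; _%ℕ_)
open import Data.Integer.DivMod using (n%ℕd<d)
open import Data.Fin using (Fin; fromℕ<; toℕ)
open import Data.Bool using (Bool; true; false; _∧_; if_then_else_)
open import Data.Maybe using (Maybe; just; nothing)
import Data.Maybe.Properties as MaybeP
open import Data.List using (List; []; _∷_; length; lookup; take; drop; reverse; allFin; concatMap)
import Data.List as List
open import Data.Product using (Σ; ∃; ∃-syntax; _×_; _,_)
open import Relation.Binary.PropositionalEquality using (_≡_)
open import Relation.Binary.Definitions using (DecidableEquality)
open import Relation.Nullary.Decidable using (⌊_⌋)

module _ {A : Set} where

  Palindrome : List A → Set
  Palindrome u = reverse u ≡ u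

  suffix : ℕ → List A → List A
  suffix k w = drop (length w ∸ k) w

  PalPrefixLen : List A → ℕ → Set
  PalPrefixLen w k = k ≤ length w × Palindrome (take k w)

  PalSuffixLen : List A → ℕ → Set
  PalSuffixLen w k = k ≤ length w × Palindrome (suffix k w)

  BorderLen : List A → ℕ → Set
  BorderLen w k = k < length w × take k w ≡ suffix k w

IsMaximum : (ℕ → Set) → ℕ → Set
IsMaximum P k = P k × (∀ j → P j → j ≤ k)

-- One-dimensional grids: a size n and a map ℤ/nℤ ≅ Fin n → A.
record Grid (A : Set) : Set where
  constructor grid
  field
    size : ℕ
    cell : Fin size → A
open Grid public

gridOf : {A : Set} → List A → Grid A
gridOf u = grid (length u) (lookup u)

-- Periodic extension ℤ → A of a grid (precomposition with ℤ → ℤ/nℤ).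
-- For the degenerate size 0 (not a genuine grid) it is undefined (nothing).
ext : {A : Set} → Grid A → ℤ → Maybe A
ext (grid zero c)    z = nothing
ext (grid (suc k) c) z = just (c (fromℕ< (n%ℕd<d z (suc k))))

sgn : Bool → ℤ
sgn true  = ℤ.+ 1
sgn false = ℤ.- (ℤ.+ 1)

Equiv : {A : Set} → Grid A → Grid A → Set
Equiv Γ Γ' = ∃[ ε ] ∃[ t ] (∀ z → ext Γ' z ≡ ext Γ (sgn ε ℤ.* z ℤ.+ t))

module Count {A : Set} (_≟_ : DecidableEquality A) where

  matchFrom : Grid A → ℤ → ℤ → List A → Bool
  matchFrom Γ z d []      = true
  matchFrom Γ z d (a ∷ w) = ⌊ MaybeP.≡-dec _≟_ (ext Γ z) (just a) ⌋ ∧ matchFrom Γ (z ℤ.+ d) d w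

  appearances : List A → Grid A → ℕ
  appearances w Γ =
    List.length (List.filterᵇ (λ pv → matchFrom Γ (+ toℕ (Data.Product.proj₁ pv)) (sgn (Data.Product.proj₂ pv)) w)
      (List.cartesianProduct (allFin (size Γ)) (true ∷ false ∷ [])))

  -- Γ is w-extremal: c₁(w,Γ) = C₁(w) = sup over grids Γ' of c₁(w,Γ'),
  -- i.e. appearances(Γ')/size(Γ') ≤ appearances(Γ)/size(Γ) for every grid Γ'
  -- (cross-multiplied, sizes positive).
  Extremal : List A → Grid A → Set
  Extremal w Γ = 0 < size Γ ×
    (∀ (Γ' : Grid A) → 0 < size Γ' →
       appearances w Γ' ℕ.* size Γ ≤ appearances w Γ ℕ.* size Γ')

-- An appearance of w is an occurrence read left to right (forward) or right to left (backward).
-- Two appearances in the same direction at distance j > 0 make j a period of w, so j ≥ |v| = ℓ - cp;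
-- a forward appearance followed by a backward one at distance j makes the suffix of length ℓ - j a
-- palindrome, so j ≥ |u₂| = ℓ - cr; symmetrically backward then forward gives j ≥ |u₁| = ℓ - cl.
-- Charging Δ = cr - cl to every forward appearance, each step between consecutive appearances costs
-- at least G / 2 with G = min (2|v|, |u₂| + |u₁|), so every grid has at most 2/G appearances per cell
-- (2/|v| if w is a palindrome, when each occurrence is read in both directions).  As
-- |u₂| + |u₁| - 2|v| = 2cp - cl - cr, the grid Γ₁ = Grid(v) or Γ₂ = Grid(u₂u₁ʳᵉᵛ) attains this bound.
-- In an extremal grid every step is tight, and following the tight steps from one appearance
-- rebuilds the grid: as powers of v, as powers of u₂u₁ʳᵉᵛ, or, when cl + cr = 2cp and both kinds of
-- step are tight, as an arbitrary sequence of the blocks v and v′.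

module Submission where

open import Defs
open import Data.Bool as Bool using (Bool; true; false; _∧_; _∨_; not; T)
open import Data.Bool.Properties using (T-≡; T-∨)
open import Data.Empty using (⊥-elim)
open import Data.Fin as Fin using (Fin; fromℕ<; toℕ)
import Data.Fin.Properties as Finₚ
open import Data.Integer as ℤ using (ℤ; +_; -[1+_]; _%ℕ_; _/ℕ_)
import Data.Integer.Properties as ℤₚ
open import Data.Integer.DivMod using (n%ℕd<d; a≡a%ℕn+[a/ℕn]*n)
import Data.Integer.Tactic.RingSolver as ℤ-Ring
open import Data.List using (List; []; _∷_; _++_; length; take; drop; reverse; concat; lookup; filterᵇ; cartesianProduct; tabulate; map; applyUpTo)
import Data.List.Properties as Listₚ
open import Data.List.Membership.Propositional using (_∈_)
open import Data.List.Relation.Unary.All as All using (All; []; _∷_)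
open import Data.Maybe using (Maybe; just; nothing; _>>=_)
import Data.Maybe.Properties as Maybeₚ
open import Data.Nat as ℕ using (ℕ; zero; suc; _+_; _*_; _∸_; _≤_; _<_; z≤n; s≤s; NonZero)
open import Data.Nat.DivMod using (_%_; _/_; m≡m%n+[m/n]*n; m%n<n)
open import Data.Nat.Induction using (<-rec)
open import Data.Nat.Properties
open import Data.Nat.Tactic.RingSolver using (solve-∀)
open import Data.Product using (∃₂; ∃-syntax; _×_; _,_; proj₁; proj₂)
open import Data.Sum using (_⊎_; inj₁; inj₂; [_,_])
open import Function using (_∘_)
open import Function.Bundles using (_⇔_; mk⇔; Equivalence)
open import Relation.Binary.PropositionalEquality using (_≡_; _≢_; refl; sym; trans; cong; cong₂; subst; subst₂; module ≡-Reasoning)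
open import Relation.Binary.Definitions using (DecidableEquality)
open import Relation.Nullary using (¬_; yes; no)
open import Relation.Nullary.Decidable using (⌊_⌋)

∑ : ℕ → (ℕ → ℕ) → ℕ
∑ zero    f = 0
∑ (suc n) f = f 0 + ∑ n (f ∘ suc)

∑-cong : ∀ n {f f′ : ℕ → ℕ} → (∀ i → i < n → f i ≡ f′ i) → ∑ n f ≡ ∑ n f′
∑-cong zero    eq = refl
∑-cong (suc n) eq = cong₂ _+_ (eq 0 (s≤s z≤n)) (∑-cong n (λ i i<n → eq (suc i) (s≤s i<n)))

∑-+ : ∀ m n (f : ℕ → ℕ) → ∑ (m + n) f ≡ ∑ m f + ∑ n (λ i → f (m + i))
∑-+ zero    n f = refl
∑-+ (suc m) n f = trans (cong (_+_ (f 0)) (∑-+ m n (f ∘ suc))) (sym (+-assoc (f 0) _ _))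

∑-snoc : ∀ n (f : ℕ → ℕ) → ∑ (suc n) f ≡ ∑ n f + f n
∑-snoc n f = begin
  ∑ (suc n) f             ≡⟨ cong (λ k → ∑ k f) (+-comm 1 n) ⟩
  ∑ (n + 1) f             ≡⟨ ∑-+ n 1 f ⟩
  ∑ n f + (f (n + 0) + 0) ≡⟨ cong (λ k → ∑ n f + k) (trans (+-identityʳ _) (cong f (+-identityʳ n))) ⟩
  ∑ n f + f n             ∎
  where open ≡-Reasoning

∑-const : ∀ n c → ∑ n (λ _ → c) ≡ n * c
∑-const zero    c = refl
∑-const (suc n) c = cong (_+_ c) (∑-const n c)

∑-+-distrib : ∀ n (f f′ : ℕ → ℕ) → ∑ n (λ i → f i + f′ i) ≡ ∑ n f + ∑ n f′
∑-+-distrib zero    f f′ = refl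
∑-+-distrib (suc n) f f′ = begin
  f 0 + f′ 0 + ∑ n (λ i → f (suc i) + f′ (suc i)) ≡⟨ cong (_+_ (f 0 + f′ 0)) (∑-+-distrib n (f ∘ suc) (f′ ∘ suc)) ⟩
  f 0 + f′ 0 + (∑ n (f ∘ suc) + ∑ n (f′ ∘ suc))   ≡⟨ +-exchange (f 0) (f′ 0) _ _ ⟩
  f 0 + ∑ n (f ∘ suc) + (f′ 0 + ∑ n (f′ ∘ suc))   ∎
  where
  open ≡-Reasoning
  +-exchange : ∀ a b c d → a + b + (c + d) ≡ a + c + (b + d)
  +-exchange = solve-∀

∑-blocks : ∀ k n (f : ℕ → ℕ) → ∑ (k * n) f ≡ ∑ k (λ j → ∑ n (λ i → f (j * n + i)))
∑-blocks zero    n f = refl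
∑-blocks (suc k) n f = trans (∑-+ n (k * n) f) (cong (_+_ (∑ n (λ i → f (0 + i)))) (trans
  (∑-blocks k n (λ i → f (n + i)))
  (∑-cong k (λ j _ → ∑-cong n (λ i _ → cong f (sym (+-assoc n (j * n) i)))))))

∑-of-zeros : ∀ n (f : ℕ → ℕ) → (∀ i → i < n → f i ≡ 0) → ∑ n f ≡ 0
∑-of-zeros n f zeros = trans (∑-cong n zeros) (trans (∑-const n 0) (*-zeroʳ n))

term≤∑ : ∀ n (f : ℕ → ℕ) i → i < n → f i ≤ ∑ n f
term≤∑ (suc n) f zero    _         = m≤m+n (f 0) _
term≤∑ (suc n) f (suc i) (s≤s i<n) = ≤-trans (term≤∑ n (f ∘ suc) i i<n) (m≤n+m _ (f 0))

n≤∑-of-positives : ∀ n (f : ℕ → ℕ) → (∀ i → i < n → 1 ≤ f i) → n ≤ ∑ n f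
n≤∑-of-positives zero    f pos = z≤n
n≤∑-of-positives (suc n) f pos =
  +-mono-≤ (pos 0 (s≤s z≤n)) (n≤∑-of-positives n (f ∘ suc) (λ i i<n → pos (suc i) (s≤s i<n)))

∑-positive⇒term : ∀ n (f : ℕ → ℕ) → 0 < ∑ n f → ∃[ i ] (i < n × 0 < f i)
∑-positive⇒term (suc n) f pos with f 0 in f0
... | suc _ = 0 , s≤s z≤n , subst (0 <_) (sym f0) (s≤s z≤n)
... | zero with ∑-positive⇒term n (f ∘ suc) pos
...   | i , i<n , fi = suc i , s≤s i<n , fi

-- Positions a and b are mirror images in a list of length n exactly when a + suc b ≡ n.
mirror-partner : ∀ {a n} → a < n → ∃[ b ] a + suc b ≡ n
mirror-partner {a} {n} a<n = n ∸ suc a , trans (+-comm a (suc (n ∸ suc a))) (trans (sym (+-suc (n ∸ suc a) a)) (m∸n+n≡m a<n))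

pred-mirror : ∀ a b {n} → a + suc b ≡ n → n ∸ 1 ≡ a + b
pred-mirror a b eq = trans (cong (_∸ 1) (sym eq)) (cong (_∸ 1) (+-suc a b))

mirror-<ˡ : ∀ a b {n} → a + suc b ≡ n → a < n
mirror-<ˡ a b eq = subst (a <_) eq (m<m+n a (s≤s z≤n))

mirror-<ʳ : ∀ a b {n} → a + suc b ≡ n → b < n
mirror-<ʳ a b eq = subst (b <_) eq (m≤n+m (suc b) a)

module _ {A : Set} where

  at : List A → ℕ → Maybe A
  at []       i       = nothing
  at (x ∷ xs) zero    = just x
  at (x ∷ xs) (suc i) = at xs i

  at-beyond : ∀ (xs : List A) i → length xs ≤ i → at xs i ≡ nothing
  at-beyond []       i       _         = refl
  at-beyond (x ∷ xs) (suc i) (s≤s le) = at-beyond xs i le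

  at-injective : ∀ (xs ys : List A) → (∀ i → at xs i ≡ at ys i) → xs ≡ ys
  at-injective []       []       eq = refl
  at-injective []       (y ∷ ys) eq with () ← eq 0
  at-injective (x ∷ xs) []       eq with () ← eq 0
  at-injective (x ∷ xs) (y ∷ ys) eq with refl ← eq 0 = cong (x ∷_) (at-injective xs ys (eq ∘ suc))

  at-injective-< : ∀ (xs ys : List A) → length xs ≡ length ys →
                   (∀ i → i < length xs → at xs i ≡ at ys i) → xs ≡ ys
  at-injective-< xs ys |xs|≡|ys| eq = at-injective xs ys pointwise
    where
    pointwise : ∀ i → at xs i ≡ at ys i
    pointwise i with <-≤-connex i (length xs)
    ... | inj₁ i<|xs| = eq i i<|xs|
    ... | inj₂ |xs|≤i = trans (at-beyond xs i |xs|≤i) (sym (at-beyond ys i (subst (_≤ i) |xs|≡|ys| |xs|≤i)))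

  lookup≡at : ∀ (xs : List A) i (i<|xs| : i < length xs) → just (lookup xs (fromℕ< i<|xs|)) ≡ at xs i
  lookup≡at (x ∷ xs) zero    _         = refl
  lookup≡at (x ∷ xs) (suc i) (s≤s i<n) = lookup≡at xs i i<n

  at-take : ∀ k (xs : List A) i → i < k → at (take k xs) i ≡ at xs i
  at-take (suc k) []       i       _         = refl
  at-take (suc k) (x ∷ xs) zero    _         = refl
  at-take (suc k) (x ∷ xs) (suc i) (s≤s i<k) = at-take k xs i i<k

  at-take-beyond : ∀ k (xs : List A) i → k ≤ i → at (take k xs) i ≡ nothing
  at-take-beyond zero    xs       i       _        = refl
  at-take-beyond (suc k) []       i       _        = refl
  at-take-beyond (suc k) (x ∷ xs) (suc i) (s≤s le) = at-take-beyond k xs i le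

  at-drop : ∀ k (xs : List A) i → at (drop k xs) i ≡ at xs (k + i)
  at-drop zero    xs       i = refl
  at-drop (suc k) []       i = refl
  at-drop (suc k) (x ∷ xs) i = at-drop k xs i

  at-++ˡ : ∀ (xs ys : List A) i → i < length xs → at (xs ++ ys) i ≡ at xs i
  at-++ˡ (x ∷ xs) ys zero    _         = refl
  at-++ˡ (x ∷ xs) ys (suc i) (s≤s i<n) = at-++ˡ xs ys i i<n

  at-++ʳ : ∀ (xs ys : List A) i → at (xs ++ ys) (length xs + i) ≡ at ys i
  at-++ʳ []       ys i = refl
  at-++ʳ (x ∷ xs) ys i = at-++ʳ xs ys i

  at-reverse : ∀ (xs : List A) a b → a + suc b ≡ length xs → at (reverse xs) a ≡ at xs b
  at-reverse []       a b eq = ⊥-elim (1+n≢0 (trans (sym (+-suc a b)) eq))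
  at-reverse (x ∷ xs) a zero eq = begin
    at (reverse (x ∷ xs)) a            ≡⟨ cong (λ ys → at ys a) (Listₚ.unfold-reverse x xs) ⟩
    at (reverse xs ++ x ∷ []) a        ≡⟨ cong (at (reverse xs ++ x ∷ [])) a≡|xs|+0 ⟩
    at (reverse xs ++ x ∷ []) (length (reverse xs) + 0) ≡⟨ at-++ʳ (reverse xs) (x ∷ []) 0 ⟩
    just x                             ∎
    where
    open ≡-Reasoning
    a≡|xs|+0 : a ≡ length (reverse xs) + 0
    a≡|xs|+0 = trans (suc-injective (trans (+-comm 1 a) eq))
                     (trans (sym (Listₚ.length-reverse xs)) (sym (+-identityʳ _)))
  at-reverse (x ∷ xs) a (suc b) eq = begin
    at (reverse (x ∷ xs)) a     ≡⟨ cong (λ ys → at ys a) (Listₚ.unfold-reverse x xs) ⟩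
    at (reverse xs ++ x ∷ []) a ≡⟨ at-++ˡ (reverse xs) (x ∷ []) a a<|xs| ⟩
    at (reverse xs) a           ≡⟨ at-reverse xs a b eq′ ⟩
    at xs b                     ∎
    where
    open ≡-Reasoning
    eq′ : a + suc b ≡ length xs
    eq′ = suc-injective (trans (sym (+-suc a (suc b))) eq)
    a<|xs| : a < length (reverse xs)
    a<|xs| = subst (a <_) (trans eq′ (sym (Listₚ.length-reverse xs))) (m<m+n a (s≤s z≤n))

  Mirrored : List A → Set
  Mirrored xs = ∀ a b → a + suc b ≡ length xs → at xs a ≡ at xs b

  palindrome⇒mirrored : ∀ (xs : List A) → Palindrome xs → Mirrored xs
  palindrome⇒mirrored xs pal a b eq = trans (cong (λ ys → at ys a) (sym pal)) (at-reverse xs a b eq)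

  mirrored⇒palindrome : ∀ (xs : List A) → Mirrored xs → Palindrome xs
  mirrored⇒palindrome xs mirrored = at-injective _ _ pointwise
    where
    pointwise : ∀ i → at (reverse xs) i ≡ at xs i
    pointwise i with <-≤-connex i (length xs)
    ... | inj₁ i<n = let (b , eq) = mirror-partner i<n in trans (at-reverse xs i b eq) (sym (mirrored i b eq))
    ... | inj₂ n≤i = trans (at-beyond (reverse xs) i (subst (_≤ i) (sym (Listₚ.length-reverse xs)) n≤i))
                           (sym (at-beyond xs i n≤i))

module _ {A : Set} where

  length-concat : ∀ g (us : List (List A)) → All (λ u → length u ≡ g) us → length (concat us) ≡ length us * g
  length-concat g []       []             = refl
  length-concat g (u ∷ us) (|u|≡g ∷ all) = trans (Listₚ.length-++ u) (cong₂ _+_ |u|≡g (length-concat g us all))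

  at-concat : ∀ g (us : List (List A)) → All (λ u → length u ≡ g) us → ∀ k r → r < g →
              at (concat us) (k * g + r) ≡ (at us k >>= λ u → at u r)
  at-concat g []       []             k       r r<g = refl
  at-concat g (u ∷ us) (|u|≡g ∷ all) zero    r r<g = at-++ˡ u (concat us) r (subst (r <_) (sym |u|≡g) r<g)
  at-concat g (u ∷ us) (|u|≡g ∷ all) (suc k) r r<g = begin
    at (u ++ concat us) (g + k * g + r)          ≡⟨ cong (at (u ++ concat us)) (trans (+-assoc g (k * g) r) (cong (_+ (k * g + r)) (sym |u|≡g))) ⟩
    at (u ++ concat us) (length u + (k * g + r)) ≡⟨ at-++ʳ u (concat us) (k * g + r) ⟩
    at (concat us) (k * g + r)                   ≡⟨ at-concat g us all k r r<g ⟩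
    (at us k >>= λ u → at u r)                   ∎
    where open ≡-Reasoning

  at-defined : ∀ (us : List A) k → k < length us → ∃[ u ] at us k ≡ just u
  at-defined (u ∷ us) zero    _         = u , refl
  at-defined (u ∷ us) (suc k) (s≤s k<n) = at-defined us k k<n

  All-at : ∀ {P : A → Set} {us : List A} → All P us → ∀ k {u} → at us k ≡ just u → P u
  All-at (pu ∷ _)   zero    refl = pu
  All-at (_  ∷ all) (suc k) eq   = All-at all k eq

  at-applyUpTo : ∀ (f : ℕ → A) m k → k < m → at (applyUpTo f m) k ≡ just (f k)
  at-applyUpTo f (suc m) zero    _         = refl
  at-applyUpTo f (suc m) (suc k) (s≤s k<m) = at-applyUpTo (f ∘ suc) m k k<m

  All-applyUpTo : ∀ {P : A → Set} (f : ℕ → A) m → (∀ k → P (f k)) → All P (applyUpTo f m)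
  All-applyUpTo f zero    all = []
  All-applyUpTo f (suc m) all = all 0 ∷ All-applyUpTo (f ∘ suc) m (all ∘ suc)

module _ {A : Set} (w : List A) where

  private
    ℓ = length w

  PrefixMirrored : ℕ → Set
  PrefixMirrored k = ∀ a b → a + suc b ≡ k → at w a ≡ at w b

  SuffixMirroredFrom : ℕ → Set
  SuffixMirroredFrom j = ∀ a b → a + suc b + j ≡ ℓ → at w (j + a) ≡ at w (j + b)

  Period : ℕ → Set
  Period p = ∀ i → i + p < ℓ → at w i ≡ at w (i + p)

  length-take-≤ : ∀ k → k ≤ ℓ → length (take k w) ≡ k
  length-take-≤ k k≤ℓ = trans (Listₚ.length-take k w) (m≤n⇒m⊓n≡m k≤ℓ)

  prefixMirrored⇒palindrome : ∀ k → k ≤ ℓ → PrefixMirrored k → Palindrome (take k w)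
  prefixMirrored⇒palindrome k k≤ℓ mirrored = mirrored⇒palindrome (take k w) λ a b eq →
    let eq′ = trans eq (length-take-≤ k k≤ℓ) in
    trans (at-take k w a (mirror-<ˡ a b eq′)) (trans (mirrored a b eq′) (sym (at-take k w b (mirror-<ʳ a b eq′))))

  palindrome⇒prefixMirrored : ∀ k → k ≤ ℓ → Palindrome (take k w) → PrefixMirrored k
  palindrome⇒prefixMirrored k k≤ℓ pal a b eq =
    trans (sym (at-take k w a (mirror-<ˡ a b eq)))
          (trans (palindrome⇒mirrored (take k w) pal a b (trans eq (sym (length-take-≤ k k≤ℓ))))
                 (at-take k w b (mirror-<ʳ a b eq)))

  private
    length-drop+ : ∀ j → j ≤ ℓ → length (drop j w) + j ≡ ℓ
    length-drop+ j j≤ℓ = trans (cong (_+ j) (Listₚ.length-drop j w)) (m∸n+n≡m j≤ℓ)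

  suffixMirrored⇒palindrome : ∀ j → j ≤ ℓ → SuffixMirroredFrom j → Palindrome (drop j w)
  suffixMirrored⇒palindrome j j≤ℓ mirrored = mirrored⇒palindrome (drop j w) λ a b eq →
    trans (at-drop j w a) (trans (mirrored a b (trans (cong (_+ j) eq) (length-drop+ j j≤ℓ))) (sym (at-drop j w b)))

  palindrome⇒suffixMirrored : ∀ j → j ≤ ℓ → Palindrome (drop j w) → SuffixMirroredFrom j
  palindrome⇒suffixMirrored j j≤ℓ pal a b eq =
    trans (sym (at-drop j w a)) (trans (palindrome⇒mirrored (drop j w) pal a b eq′) (at-drop j w b))
    where
    eq′ : a + suc b ≡ length (drop j w)
    eq′ = +-cancelʳ-≡ j _ _ (trans eq (sym (length-drop+ j j≤ℓ)))

  period⇒border : ∀ p → p ≤ ℓ → Period p → take (ℓ ∸ p) w ≡ suffix (ℓ ∸ p) w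
  period⇒border p p≤ℓ period = at-injective _ _ pointwise
    where
    k = ℓ ∸ p
    ℓ∸k≡p : ℓ ∸ k ≡ p
    ℓ∸k≡p = m∸[m∸n]≡n p≤ℓ
    pointwise : ∀ i → at (take k w) i ≡ at (suffix k w) i
    pointwise i with <-≤-connex i k
    ... | inj₁ i<k = begin
      at (take k w) i    ≡⟨ at-take k w i i<k ⟩
      at w i             ≡⟨ period i (subst (i + p <_) (m∸n+n≡m p≤ℓ) (+-monoˡ-< p i<k)) ⟩
      at w (i + p)       ≡⟨ cong (at w) (trans (+-comm i p) (cong (_+ i) (sym ℓ∸k≡p))) ⟩
      at w (ℓ ∸ k + i)   ≡⟨ sym (at-drop (ℓ ∸ k) w i) ⟩
      at (suffix k w) i  ∎
      where open ≡-Reasoning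
    ... | inj₂ k≤i = trans (at-take-beyond k w i k≤i) (sym (trans (at-drop (ℓ ∸ k) w i) (at-beyond w _ ℓ≤)))
      where
      ℓ≤ : ℓ ≤ ℓ ∸ k + i
      ℓ≤ = subst (_≤ ℓ ∸ k + i) (trans (+-comm (ℓ ∸ k) k) (m+[n∸m]≡n (m∸n≤m ℓ p)))
                                 (+-monoʳ-≤ (ℓ ∸ k) k≤i)

  border⇒period : ∀ k → k ≤ ℓ → take k w ≡ suffix k w → Period (ℓ ∸ k)
  border⇒period k k≤ℓ border i i+p<ℓ = begin
    at w i               ≡⟨ sym (at-take k w i i<k) ⟩
    at (take k w) i      ≡⟨ cong (λ ys → at ys i) border ⟩
    at (suffix k w) i    ≡⟨ at-drop (ℓ ∸ k) w i ⟩
    at w (ℓ ∸ k + i)     ≡⟨ cong (at w) (+-comm (ℓ ∸ k) i) ⟩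
    at w (i + (ℓ ∸ k))   ∎
    where
    open ≡-Reasoning
    i<k : i < k
    i<k = +-cancelʳ-< (ℓ ∸ k) i k (subst (i + (ℓ ∸ k) <_) (sym (m+[n∸m]≡n k≤ℓ)) i+p<ℓ)

infixl 6 _⊕_
_⊕_ : ℤ → ℕ → ℤ
x ⊕ j = x ℤ.+ + j

⊕-+ : ∀ x a b → x ⊕ (a + b) ≡ x ⊕ a ⊕ b
⊕-+ x a b = trans (cong (ℤ._+_ x) (ℤₚ.pos-+ a b)) (sym (ℤₚ.+-assoc x (+ a) (+ b)))

module _ (d : ℕ) where

  private
    +r+q*d : ∀ r q → + r ℤ.+ + q ℤ.* + d ≡ + (r + q * d)
    +r+q*d r q = sym (trans (ℤₚ.pos-+ r (q * d)) (cong (ℤ._+_ (+ r)) (ℤₚ.pos-* q d)))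

    d≤ : ∀ r r′ j → + r′ ≡ + r ℤ.+ + suc j ℤ.* + d → d ≤ r′
    d≤ r r′ j eq = ≤-trans (≤-trans (m≤m+n d (j * d)) (m≤n+m _ r))
                           (≤-reflexive (sym (ℤₚ.+-injective (trans eq (+r+q*d r (suc j))))))

  remainder-unique : ∀ r r′ q q′ → r < d → r′ < d → + r ℤ.+ q ℤ.* + d ≡ + r′ ℤ.+ q′ ℤ.* + d → r ≡ r′
  remainder-unique r r′ q q′ r<d r′<d eq = by-quotient-difference (q ℤ.- q′) (rearrange (+ r) (+ r′) q q′ (+ d) eq)
    where
    rearrange : ∀ r r′ q q′ d → r ℤ.+ q ℤ.* d ≡ r′ ℤ.+ q′ ℤ.* d → r′ ≡ r ℤ.+ (q ℤ.- q′) ℤ.* d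
    rearrange r r′ q q′ d eq = begin
      r′                                   ≡⟨ cancel r′ q′ d ⟩
      r′ ℤ.+ q′ ℤ.* d ℤ.- q′ ℤ.* d         ≡⟨ cong (ℤ._- q′ ℤ.* d) (sym eq) ⟩
      r ℤ.+ q ℤ.* d ℤ.- q′ ℤ.* d           ≡⟨ collect r q q′ d ⟩
      r ℤ.+ (q ℤ.- q′) ℤ.* d               ∎
      where
      open ≡-Reasoning
      cancel : ∀ r q d → r ≡ r ℤ.+ q ℤ.* d ℤ.- q ℤ.* d
      cancel = ℤ-Ring.solve-∀
      collect : ∀ r q q′ d → r ℤ.+ q ℤ.* d ℤ.- q′ ℤ.* d ≡ r ℤ.+ (q ℤ.- q′) ℤ.* d
      collect = ℤ-Ring.solve-∀
    flip : ∀ r r′ j → r′ ≡ r ℤ.+ -[1+ j ] ℤ.* + d → r ≡ r′ ℤ.+ + suc j ℤ.* + d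
    flip r r′ j eq = trans (flip′ r (+ suc j) (+ d)) (cong (λ t → t ℤ.+ + suc j ℤ.* + d) (sym eq))
      where
      flip′ : ∀ r k d → r ≡ r ℤ.+ ℤ.- k ℤ.* d ℤ.+ k ℤ.* d
      flip′ = ℤ-Ring.solve-∀
    by-quotient-difference : ∀ k → + r′ ≡ + r ℤ.+ k ℤ.* + d → r ≡ r′
    by-quotient-difference (+ zero)   eq′ = sym (ℤₚ.+-injective (trans eq′ (trans (+r+q*d r 0) (cong +_ (+-identityʳ r)))))
    by-quotient-difference (+ suc j)  eq′ = ⊥-elim (<⇒≱ r′<d (d≤ r r′ j eq′))
    by-quotient-difference -[1+ j ]   eq′ = ⊥-elim (<⇒≱ r<d (d≤ r′ r j (flip (+ r) (+ r′) j eq′)))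

%ℕ-unique : ∀ d .{{_ : NonZero d}} r q z → r < d → z ≡ + r ℤ.+ q ℤ.* + d → z %ℕ d ≡ r
%ℕ-unique d r q z r<d z≡ =
  remainder-unique d (z %ℕ d) r (z /ℕ d) q (n%ℕd<d z d) r<d (trans (sym (a≡a%ℕn+[a/ℕn]*n z d)) z≡)

Periodic : {B : Set} → (ℤ → B) → ℕ → Set
Periodic f n = ∀ z → f (z ⊕ n) ≡ f z

module _ {B : Set} (f : ℤ → B) (n : ℕ) (periodic : Periodic f n) where

  periodic-* : ∀ k → Periodic f (k * n)
  periodic-* zero    z = cong f (ℤₚ.+-identityʳ z)
  periodic-* (suc k) z = begin
    f (z ⊕ (n + k * n)) ≡⟨ cong f (⊕-+ z n (k * n)) ⟩
    f (z ⊕ n ⊕ k * n)   ≡⟨ periodic-* k (z ⊕ n) ⟩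
    f (z ⊕ n)           ≡⟨ periodic z ⟩
    f z                 ∎
    where open ≡-Reasoning

  periodic-ℤ* : ∀ q z → f (z ℤ.+ q ℤ.* + n) ≡ f z
  periodic-ℤ* (+ k)    z = trans (cong (λ t → f (z ℤ.+ t)) (sym (ℤₚ.pos-* k n))) (periodic-* k z)
  periodic-ℤ* -[1+ k ] z = trans (sym (periodic-* (suc k) y)) (cong f back′)
    where
    y = z ℤ.+ -[1+ k ] ℤ.* + n
    back : ∀ z k n → z ℤ.+ ℤ.- k ℤ.* n ℤ.+ k ℤ.* n ≡ z
    back = ℤ-Ring.solve-∀
    back′ : y ⊕ (suc k * n) ≡ z
    back′ = trans (cong (ℤ._+_ y) (ℤₚ.pos-* (suc k) n)) (back z (+ suc k) (+ n))

  periodic-%ℕ : .{{_ : NonZero n}} → ∀ z → f z ≡ f (+ (z %ℕ n))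
  periodic-%ℕ z = trans (cong f (a≡a%ℕn+[a/ℕn]*n z n)) (periodic-ℤ* (z /ℕ n) (+ (z %ℕ n)))

periodic-agree : {B : Set} (f f′ : ℤ → B) (n : ℕ) → 0 < n → Periodic f n → Periodic f′ n →
                 (∀ j → f (+ j) ≡ f′ (+ j)) → ∀ z → f z ≡ f′ z
periodic-agree f f′ (suc k) _ periodic periodic′ agree z =
  trans (periodic-%ℕ f (suc k) periodic z) (trans (agree _) (sym (periodic-%ℕ f′ (suc k) periodic′ z)))

module _ {A : Set} where

  ext-eval : ∀ k (c : Fin (suc k) → A) r q z (r<k : r < suc k) →
             z ≡ + r ℤ.+ q ℤ.* + suc k → ext (grid (suc k) c) z ≡ just (c (fromℕ< r<k))
  ext-eval k c r q z r<k z≡ =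
    cong (λ i → just (c i)) (Finₚ.fromℕ<-cong _ _ (%ℕ-unique (suc k) r q z r<k z≡) (n%ℕd<d z (suc k)) r<k)

  ext-periodic : (Γ : Grid A) → 0 < size Γ → Periodic (ext Γ) (size Γ)
  ext-periodic (grid (suc k) c) _ z =
    trans (ext-eval k c r (q ℤ.+ ℤ.+ 1) (z ⊕ suc k) r<k shifted) (sym (ext-eval k c r q z r<k z≡))
    where
    r = z %ℕ suc k
    q = z /ℕ suc k
    r<k = n%ℕd<d z (suc k)
    z≡ : z ≡ + r ℤ.+ q ℤ.* + suc k
    z≡ = a≡a%ℕn+[a/ℕn]*n z (suc k)
    step : ∀ r q k → r ℤ.+ q ℤ.* k ℤ.+ k ≡ r ℤ.+ (q ℤ.+ ℤ.+ 1) ℤ.* k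
    step = ℤ-Ring.solve-∀
    shifted : z ⊕ suc k ≡ + r ℤ.+ (q ℤ.+ ℤ.+ 1) ℤ.* + suc k
    shifted = trans (cong (_⊕ suc k) z≡) (step (+ r) q (+ suc k))

  ext-gridOf : ∀ (u : List A) k r → r < length u → ext (gridOf u) (+ (k * length u + r)) ≡ at u r
  ext-gridOf (a ∷ u) k r r<n = trans (ext-eval (length u) (lookup (a ∷ u)) r (+ k) _ r<n position) (lookup≡at (a ∷ u) r r<n)
    where
    position : + (k * suc (length u) + r) ≡ + r ℤ.+ + k ℤ.* + suc (length u)
    position = trans (cong +_ (+-comm _ r)) (trans (ℤₚ.pos-+ r _) (cong (ℤ._+_ (+ r)) (ℤₚ.pos-* k _)))

*-positive : ∀ {a b} → 0 < a → 0 < b → 0 < a * b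
*-positive {suc a} {suc b} _ _ = s≤s z≤n

quotient-remainder : ∀ j p → 0 < p → ∃₂ λ k r → r < p × j ≡ k * p + r
quotient-remainder j (suc p) _ = j / suc p , j % suc p , m%n<n j (suc p) , trans (m≡m%n+[m/n]*n j (suc p)) (+-comm (j % suc p) _)

module _ {A : Set} (Γ : Grid A) (u : List A) (0<n : 0 < size Γ) (0<|u| : 0 < length u) (y₀ : ℤ) where

  private
    n = size Γ
    p = length u
    0<np = *-positive 0<n 0<|u|
    gridOf-periodic : Periodic (ext (gridOf u)) (n * p)
    gridOf-periodic = periodic-* (ext (gridOf u)) p (ext-periodic (gridOf u) 0<|u|) n
    Γ-periodic : Periodic (ext Γ) (n * p)
    Γ-periodic = subst (Periodic (ext Γ)) (*-comm p n) (periodic-* (ext Γ) n (ext-periodic Γ 0<n) p)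

  equiv-if-reads-forward : (∀ k i → i < p → ext Γ (y₀ ⊕ (k * p + i)) ≡ at u i) → Equiv Γ (gridOf u)
  equiv-if-reads-forward reads = true , y₀ , periodic-agree _ _ (n * p) 0<np gridOf-periodic shifted-periodic on-ℕ
    where
    move : ∀ z y → ℤ.+ 1 ℤ.* z ℤ.+ y ≡ z ℤ.+ y
    move = ℤ-Ring.solve-∀
    shifted-periodic : Periodic (λ z → ext Γ (sgn true ℤ.* z ℤ.+ y₀)) (n * p)
    shifted-periodic z = trans (cong (ext Γ) (trans (move (z ⊕ (n * p)) y₀) (swap z (+ (n * p)) y₀)))
                               (trans (Γ-periodic (z ℤ.+ y₀)) (cong (ext Γ) (sym (move z y₀))))
      where
      swap : ∀ z m y → z ℤ.+ m ℤ.+ y ≡ z ℤ.+ y ℤ.+ m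
      swap = ℤ-Ring.solve-∀
    on-ℕ : ∀ j → ext (gridOf u) (+ j) ≡ ext Γ (sgn true ℤ.* + j ℤ.+ y₀)
    on-ℕ j with quotient-remainder j p 0<|u|
    ... | k , r , r<p , refl = trans (ext-gridOf u k r r<p)
      (trans (sym (reads k r r<p)) (cong (ext Γ) (trans (ℤₚ.+-comm y₀ _) (sym (move (+ (k * p + r)) y₀)))))

  equiv-if-reads-backward : (∀ k i → i < p → ext Γ (y₀ ℤ.- + (k * p + i)) ≡ at u i) → Equiv Γ (gridOf u)
  equiv-if-reads-backward reads = false , y₀ , periodic-agree _ _ (n * p) 0<np gridOf-periodic reflected-periodic on-ℕ
    where
    move : ∀ z y → ℤ.- ℤ.+ 1 ℤ.* z ℤ.+ y ≡ y ℤ.- z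
    move = ℤ-Ring.solve-∀
    reflected-periodic : Periodic (λ z → ext Γ (sgn false ℤ.* z ℤ.+ y₀)) (n * p)
    reflected-periodic z = trans (cong (ext Γ) (trans (move (z ⊕ (n * p)) y₀) (back y₀ z (+ (n * p)))))
                                 (trans (sym (Γ-periodic _)) (cong (ext Γ) (trans (cancel y₀ z (+ (n * p))) (sym (move z y₀)))))
      where
      back : ∀ y z m → y ℤ.- (z ℤ.+ m) ≡ y ℤ.- z ℤ.- m
      back = ℤ-Ring.solve-∀
      cancel : ∀ y z m → y ℤ.- z ℤ.- m ℤ.+ m ≡ y ℤ.- z
      cancel = ℤ-Ring.solve-∀
    on-ℕ : ∀ j → ext (gridOf u) (+ j) ≡ ext Γ (sgn false ℤ.* + j ℤ.+ y₀)
    on-ℕ j with quotient-remainder j p 0<|u|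
    ... | k , r , r<p , refl = trans (ext-gridOf u k r r<p) (trans (sym (reads k r r<p)) (cong (ext Γ) (sym (move (+ (k * p + r)) y₀))))

iterate-shift : ∀ (P : ℤ → Bool) s → (∀ x → T (P x) → T (P (x ⊕ s))) → ∀ k x → T (P x) → T (P (x ⊕ k * s))
iterate-shift P s step zero    x Px = subst (T ∘ P) (sym (ℤₚ.+-identityʳ x)) Px
iterate-shift P s step (suc k) x Px = subst (T ∘ P) (sym (⊕-+ x s (k * s))) (iterate-shift P s step k (x ⊕ s) (step x Px))

shift-back : ∀ (P : ℤ → Bool) n s → Periodic P n → 0 < n → (∀ x → T (P x) → T (P (x ⊕ s))) →
             ∀ x → T (P x) → T (P (x ℤ.- + s))
shift-back P (suc m) s periodic _ step x Px =
  subst T (trans (cong P (around x s m)) (periodic-* P (suc m) periodic s (x ℤ.- + s))) (iterate-shift P s step m x Px)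
  where
  around : ∀ x s m → x ⊕ m * s ≡ x ℤ.- + s ⊕ s * suc m
  ring : ∀ x m s → x ℤ.+ m ℤ.* s ≡ x ℤ.- s ℤ.+ s ℤ.* (ℤ.+ 1 ℤ.+ m)
  ring = ℤ-Ring.solve-∀
  around x s m = begin
    x ℤ.+ + (m * s)                      ≡⟨ cong (ℤ._+_ x) (ℤₚ.pos-* m s) ⟩
    x ℤ.+ + m ℤ.* + s                    ≡⟨ ring x (+ m) (+ s) ⟩
    x ℤ.- + s ℤ.+ + s ℤ.* (ℤ.+ 1 ℤ.+ + m) ≡⟨ cong (ℤ._+_ (x ℤ.- + s)) (sym (trans (ℤₚ.pos-* s (suc m)) (cong (ℤ._*_ (+ s)) (ℤₚ.pos-+ 1 m)))) ⟩
    x ℤ.- + s ⊕ s * suc m                ∎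
    where open ≡-Reasoning

iterate-shift-back : ∀ (P : ℤ → Bool) n s → Periodic P n → 0 < n → (∀ x → T (P x) → T (P (x ⊕ s))) →
                     ∀ k x → T (P x) → T (P (x ℤ.- + (k * s)))
iterate-shift-back P n s periodic 0<n step zero    x Px = subst (T ∘ P) (sym (ℤₚ.+-identityʳ x)) Px
iterate-shift-back P n s periodic 0<n step (suc k) x Px =
  subst (T ∘ P) (trans (regroup x (+ s) (+ (k * s))) (cong (λ t → x ℤ.- t) (sym (ℤₚ.pos-+ s (k * s)))))
    (iterate-shift-back P n s periodic 0<n step k (x ℤ.- + s) (shift-back P n s periodic 0<n step x Px))
  where
  regroup : ∀ x s t → x ℤ.- s ℤ.- t ≡ x ℤ.- (s ℤ.+ t)
  regroup = ℤ-Ring.solve-∀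

-- Counting appearances

boolToℕ : Bool → ℕ
boolToℕ true  = 1
boolToℕ false = 0

module _ {A : Set} (_≟_ : DecidableEquality A) where
  open Count _≟_

  private
    uncons-match : ∀ Γ z d a (u : List A) → T (matchFrom Γ z d (a ∷ u)) →
                   ext Γ z ≡ just a × T (matchFrom Γ (z ℤ.+ d) d u)
    uncons-match Γ z d a u match with Maybeₚ.≡-dec _≟_ (ext Γ z) (just a)
    ... | yes reads = reads , match

    cons-match : ∀ Γ z d a (u : List A) → ext Γ z ≡ just a → T (matchFrom Γ (z ℤ.+ d) d u) →
                 T (matchFrom Γ z d (a ∷ u))
    cons-match Γ z d a u reads match with Maybeₚ.≡-dec _≟_ (ext Γ z) (just a)
    ... | yes _     = match
    ... | no ¬reads = ¬reads reads

  matchFrom-sound : ∀ Γ z d (u : List A) → T (matchFrom Γ z d u) →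
                    ∀ i → i < length u → ext Γ (z ℤ.+ + i ℤ.* d) ≡ at u i
  matchFrom-sound Γ z d (a ∷ u) match zero _ =
    trans (cong (ext Γ) (first z d)) (proj₁ (uncons-match Γ z d a u match))
    where
    first : ∀ z d → z ℤ.+ ℤ.+ 0 ℤ.* d ≡ z
    first = ℤ-Ring.solve-∀
  matchFrom-sound Γ z d (a ∷ u) match (suc i) (s≤s i<n) =
    trans (cong (ext Γ) (next z d (+ i))) (matchFrom-sound Γ (z ℤ.+ d) d u (proj₂ (uncons-match Γ z d a u match)) i i<n)
    where
    next : ∀ z d i → z ℤ.+ (ℤ.+ 1 ℤ.+ i) ℤ.* d ≡ z ℤ.+ d ℤ.+ i ℤ.* d
    next = ℤ-Ring.solve-∀

  matchFrom-complete : ∀ Γ z d (u : List A) → (∀ i → i < length u → ext Γ (z ℤ.+ + i ℤ.* d) ≡ at u i) →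
                       T (matchFrom Γ z d u)
  matchFrom-complete Γ z d []      reads = _
  matchFrom-complete Γ z d (a ∷ u) reads = cons-match Γ z d a u head-read tail-match
    where
    first : ∀ z d → z ≡ z ℤ.+ ℤ.+ 0 ℤ.* d
    first = ℤ-Ring.solve-∀
    next : ∀ z d i → z ℤ.+ d ℤ.+ i ℤ.* d ≡ z ℤ.+ (ℤ.+ 1 ℤ.+ i) ℤ.* d
    next = ℤ-Ring.solve-∀
    head-read : ext Γ z ≡ just a
    head-read = trans (cong (ext Γ) (first z d)) (reads 0 (s≤s z≤n))
    tail-match : T (matchFrom Γ (z ℤ.+ d) d u)
    tail-match = matchFrom-complete Γ (z ℤ.+ d) d u
      (λ i i<n → trans (cong (ext Γ) (next z d (+ i))) (reads (suc i) (s≤s i<n)))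

  matchFrom-periodic : ∀ Γ n d (u : List A) → Periodic (ext Γ) n → Periodic (λ z → matchFrom Γ z d u) n
  matchFrom-periodic Γ n d []      periodic z = refl
  matchFrom-periodic Γ n d (a ∷ u) periodic z =
    cong₂ _∧_ (cong (λ x → ⌊ Maybeₚ.≡-dec _≟_ x (just a) ⌋) (periodic z))
              (trans (cong (λ y → matchFrom Γ y d u) (swap z (+ n) d)) (matchFrom-periodic Γ n d u periodic (z ℤ.+ d)))
    where
    swap : ∀ z n d → z ℤ.+ n ℤ.+ d ≡ z ℤ.+ d ℤ.+ n
    swap = ℤ-Ring.solve-∀

  matchFrom-transport : ∀ Γ Γ′ e t → (∀ z → ext Γ′ z ≡ ext Γ (e ℤ.* z ℤ.+ t)) →
                        ∀ z d (u : List A) → matchFrom Γ′ z d u ≡ matchFrom Γ (e ℤ.* z ℤ.+ t) (e ℤ.* d) u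
  matchFrom-transport Γ Γ′ e t same z d []      = refl
  matchFrom-transport Γ Γ′ e t same z d (a ∷ u) =
    cong₂ _∧_ (cong (λ x → ⌊ Maybeₚ.≡-dec _≟_ x (just a) ⌋) (same z))
              (trans (matchFrom-transport Γ Γ′ e t same (z ℤ.+ d) d u) (cong (λ y → matchFrom Γ y (e ℤ.* d) u) (distrib e z d t)))
    where
    distrib : ∀ e z d t → e ℤ.* (z ℤ.+ d) ℤ.+ t ≡ e ℤ.* z ℤ.+ t ℤ.+ e ℤ.* d
    distrib = ℤ-Ring.solve-∀

window : (ℤ → ℕ) → ℤ → ℕ → ℕ
window c a n = ∑ n (λ i → c (a ⊕ i))

window-+ : ∀ c a m n → window c a (m + n) ≡ window c a m + window c (a ⊕ m) n
window-+ c a m n = trans (∑-+ m n _) (cong (_+_ (window c a m)) (∑-cong n (λ i _ → cong c (⊕-+ a m i))))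

window-suc : ∀ c a n → window c a (suc n) ≡ c a + window c (a ⊕ 1) n
window-suc c a n = trans (window-+ c a 1 n) (cong (_+ window c (a ⊕ 1) n) (trans (+-identityʳ _) (cong c (ℤₚ.+-identityʳ a))))

window-snoc : ∀ c a n → window c a (suc n) ≡ window c a n + c (a ⊕ n)
window-snoc c a n = ∑-snoc n _

window-step : ∀ c n → Periodic c n → ∀ a → window c a n ≡ window c (a ⊕ 1) n
window-step c zero    _        a = refl
window-step c (suc m) periodic a = begin
  window c a (suc m)                 ≡⟨ window-suc c a m ⟩
  c a + window c (a ⊕ 1) m           ≡⟨ +-comm (c a) _ ⟩
  window c (a ⊕ 1) m + c a           ≡⟨ cong (_+_ (window c (a ⊕ 1) m)) (sym (trans (cong c a⊕1⊕m) (periodic a))) ⟩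
  window c (a ⊕ 1) m + c (a ⊕ 1 ⊕ m) ≡⟨ sym (window-snoc c (a ⊕ 1) m) ⟩
  window c (a ⊕ 1) (suc m)           ∎
  where
  open ≡-Reasoning
  a⊕1⊕m : a ⊕ 1 ⊕ m ≡ a ⊕ suc m
  a⊕1⊕m = sym (⊕-+ a 1 m)

module _ (c : ℤ → ℕ) {n} (periodic : Periodic c n) where

  window-shift : ∀ a j → window c a n ≡ window c (a ⊕ j) n
  window-shift a zero    = cong (λ b → window c b n) (sym (ℤₚ.+-identityʳ a))
  window-shift a (suc j) = trans (window-shift a j) (trans (window-step c n periodic (a ⊕ j))
    (cong (λ b → window c b n) (trans (sym (⊕-+ a j 1)) (cong (a ⊕_) (+-comm j 1)))))

  window-periodic : ∀ a b → window c a n ≡ window c b n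
  window-periodic a b with b ℤ.- a in b-a
  ... | + j      = trans (window-shift a j) (cong (λ x → window c x n) (back a b (+ j) b-a))
    where
    cancel : ∀ a b → a ℤ.+ (b ℤ.- a) ≡ b
    cancel = ℤ-Ring.solve-∀
    back : ∀ a b k → b ℤ.- a ≡ k → a ℤ.+ k ≡ b
    back a b k refl = cancel a b
  ... | -[1+ j ] = sym (trans (window-shift b (suc j)) (cong (λ x → window c x n) (forth a b (+ suc j) b-a)))
    where
    cancel : ∀ a b → b ℤ.+ ℤ.- (b ℤ.- a) ≡ a
    cancel = ℤ-Ring.solve-∀
    forth : ∀ a b k → b ℤ.- a ≡ ℤ.- k → b ℤ.+ k ≡ a
    forth a b k eq = trans (cong (ℤ._+_ b) (sym (trans (cong ℤ.-_ eq) (ℤₚ.neg-involutive k)))) (cancel a b)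

  window-* : ∀ a k → window c a (k * n) ≡ k * window c a n
  window-* a zero    = refl
  window-* a (suc k) = trans (window-+ c a n (k * n))
    (cong (_+_ (window c a n)) (trans (window-* (a ⊕ n) k) (cong (k *_) (sym (window-shift a n)))))

window-reflect : ∀ c t n a → window (λ p → c (t ℤ.- p)) a n ≡ window c (t ℤ.- (a ⊕ n) ⊕ 1) n
window-reflect c t zero    a = refl
window-reflect c t (suc n) a = begin
  window (λ p → c (t ℤ.- p)) a (suc n)                 ≡⟨ window-suc (λ p → c (t ℤ.- p)) a n ⟩
  c (t ℤ.- a) + window (λ p → c (t ℤ.- p)) (a ⊕ 1) n   ≡⟨ cong (_+_ (c (t ℤ.- a))) (window-reflect c t n (a ⊕ 1)) ⟩
  c (t ℤ.- a) + window c (t ℤ.- (a ⊕ 1 ⊕ n) ⊕ 1) n     ≡⟨ +-comm (c (t ℤ.- a)) _ ⟩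
  window c (t ℤ.- (a ⊕ 1 ⊕ n) ⊕ 1) n + c (t ℤ.- a)     ≡⟨ cong₂ (λ b x → window c b n + c x) start end ⟩
  window c s n + c (s ⊕ n)                             ≡⟨ sym (window-snoc c s n) ⟩
  window c s (suc n)                                   ∎
  where
  open ≡-Reasoning
  s = t ℤ.- (a ⊕ suc n) ⊕ 1
  start : t ℤ.- (a ⊕ 1 ⊕ n) ⊕ 1 ≡ s
  start = cong (λ y → t ℤ.- y ⊕ 1) (sym (⊕-+ a 1 n))
  unfold : ∀ t a n → t ℤ.- a ≡ t ℤ.- (a ℤ.+ (ℤ.+ 1 ℤ.+ n)) ℤ.+ ℤ.+ 1 ℤ.+ n
  unfold = ℤ-Ring.solve-∀
  end : t ℤ.- a ≡ s ⊕ n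
  end = trans (unfold t a (+ n)) (cong (λ y → t ℤ.- (a ℤ.+ y) ⊕ 1 ⊕ n) (sym (ℤₚ.pos-+ 1 n)))

private
  length-filterᵇ-++ : ∀ {B : Set} (P : B → Bool) xs ys →
                      length (filterᵇ P (xs ++ ys)) ≡ length (filterᵇ P xs) + length (filterᵇ P ys)
  length-filterᵇ-++ P []       ys = refl
  length-filterᵇ-++ P (x ∷ xs) ys with P x
  ... | true  = cong suc (length-filterᵇ-++ P xs ys)
  ... | false = length-filterᵇ-++ P xs ys

  length-filterᵇ-∷ : ∀ {B : Set} (P : B → Bool) x xs →
                     length (filterᵇ P (x ∷ xs)) ≡ boolToℕ (P x) + length (filterᵇ P xs)
  length-filterᵇ-∷ P x xs with P x
  ... | true  = refl
  ... | false = refl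

  length-filterᵇ-pair : ∀ {B : Set} (P : B → Bool) x y →
                        length (filterᵇ P (x ∷ y ∷ [])) ≡ boolToℕ (P x) + boolToℕ (P y)
  length-filterᵇ-pair P x y = trans (length-filterᵇ-∷ P x (y ∷ []))
    (cong (_+_ (boolToℕ (P x))) (trans (length-filterᵇ-∷ P y []) (+-identityʳ _)))

  length-filterᵇ-directions : ∀ {B : Set} n (g : Fin n → B) (P : B × Bool → Bool) (k : ℕ → ℕ) →
    (∀ i → boolToℕ (P (g i , true)) + boolToℕ (P (g i , false)) ≡ k (toℕ i)) →
    length (filterᵇ P (cartesianProduct (tabulate g) (true ∷ false ∷ []))) ≡ ∑ n k
  length-filterᵇ-directions zero    g P k eq = refl
  length-filterᵇ-directions (suc n) g P k eq =
    trans (length-filterᵇ-++ P (map (g Fin.zero ,_) (true ∷ false ∷ [])) _)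
          (cong₂ _+_ (trans (length-filterᵇ-pair P _ _) (eq Fin.zero))
                     (length-filterᵇ-directions n (g ∘ Fin.suc) P (k ∘ suc) (eq ∘ Fin.suc)))

module _ {A : Set} (_≟_ : DecidableEquality A) where
  open Count _≟_

  appearancesAt : Grid A → List A → ℤ → ℕ
  appearancesAt Γ u p = boolToℕ (matchFrom Γ p (+ 1) u) + boolToℕ (matchFrom Γ p -[1+ 0 ] u)

  appearances≡window : ∀ u Γ → appearances u Γ ≡ window (appearancesAt Γ u) (+ 0) (size Γ)
  appearances≡window u Γ = length-filterᵇ-directions (size Γ) (λ i → i) _ _ (λ i → refl)

  appearancesAt-periodic : ∀ Γ u n → Periodic (ext Γ) n → Periodic (appearancesAt Γ u) n
  appearancesAt-periodic Γ u n periodic z =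
    cong₂ _+_ (cong boolToℕ (matchFrom-periodic _≟_ Γ n _ u periodic z))
              (cong boolToℕ (matchFrom-periodic _≟_ Γ n _ u periodic z))

  appearancesAt-transport : ∀ Γ Γ′ ε t → (∀ z → ext Γ′ z ≡ ext Γ (sgn ε ℤ.* z ℤ.+ t)) →
                            ∀ u p → appearancesAt Γ′ u p ≡ appearancesAt Γ u (sgn ε ℤ.* p ℤ.+ t)
  appearancesAt-transport Γ Γ′ true t same u p =
    cong₂ _+_ (cong boolToℕ (matchFrom-transport _≟_ Γ Γ′ (sgn true) t same p (+ 1) u))
              (cong boolToℕ (matchFrom-transport _≟_ Γ Γ′ (sgn true) t same p -[1+ 0 ] u))
  appearancesAt-transport Γ Γ′ false t same u p =
    trans (cong₂ _+_ (cong boolToℕ (matchFrom-transport _≟_ Γ Γ′ (sgn false) t same p (+ 1) u))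
                     (cong boolToℕ (matchFrom-transport _≟_ Γ Γ′ (sgn false) t same p -[1+ 0 ] u)))
          (+-comm (boolToℕ (matchFrom Γ (sgn false ℤ.* p ℤ.+ t) -[1+ 0 ] u)) _)

  -- Both sides count the appearances in a common multiple n n′ of the two sizes.
  appearances-equiv : ∀ u Γ Γ′ → 0 < size Γ → 0 < size Γ′ → Equiv Γ Γ′ →
                      size Γ * appearances u Γ′ ≡ size Γ′ * appearances u Γ
  appearances-equiv u Γ Γ′ 0<n 0<n′ (ε , t , same) = begin
    n * appearances u Γ′                   ≡⟨ cong (n *_) (appearances≡window u Γ′) ⟩
    n * window c′ (+ 0) n′                 ≡⟨ sym (window-* c′ periodic′ (+ 0) n) ⟩
    window c′ (+ 0) (n * n′)               ≡⟨ ∑-cong (n * n′) (λ i _ → appearancesAt-transport Γ Γ′ ε t same u _) ⟩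
    window (λ p → c (sgn ε ℤ.* p ℤ.+ t)) (+ 0) (n * n′) ≡⟨ undo-isometry ε ⟩
    window c (start ε) (n * n′)            ≡⟨ cong (window c (start ε)) (*-comm n n′) ⟩
    window c (start ε) (n′ * n)            ≡⟨ window-* c periodic (start ε) n′ ⟩
    n′ * window c (start ε) n              ≡⟨ cong (n′ *_) (window-periodic c periodic (start ε) (+ 0)) ⟩
    n′ * window c (+ 0) n                  ≡⟨ cong (n′ *_) (sym (appearances≡window u Γ)) ⟩
    n′ * appearances u Γ                   ∎
    where
    open ≡-Reasoning
    n = size Γ
    n′ = size Γ′
    c = appearancesAt Γ u
    c′ = appearancesAt Γ′ u
    periodic = appearancesAt-periodic Γ u n (ext-periodic Γ 0<n)
    periodic′ = appearancesAt-periodic Γ′ u n′ (ext-periodic Γ′ 0<n′)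
    start : Bool → ℤ
    start true  = t
    start false = t ℤ.- (+ 0 ⊕ (n * n′)) ⊕ 1
    negate : ∀ p t → ℤ.- ℤ.+ 1 ℤ.* p ℤ.+ t ≡ t ℤ.- p
    negate = ℤ-Ring.solve-∀
    undo-isometry : ∀ ε → window (λ p → c (sgn ε ℤ.* p ℤ.+ t)) (+ 0) (n * n′) ≡ window c (start ε) (n * n′)
    undo-isometry true  = ∑-cong (n * n′) (λ i _ → cong c (trans (cong (ℤ._+ t) (ℤₚ.*-identityˡ (+ i))) (ℤₚ.+-comm (+ i) t)))
    undo-isometry false = trans (∑-cong (n * n′) (λ i _ → cong c (negate (+ 0 ⊕ i) t))) (window-reflect c t (n * n′) (+ 0))

cancel-*ʳ-≤ : ∀ {a b c} → 0 < c → a * c ≤ b * c → a ≤ b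
cancel-*ʳ-≤ {a} {b} {c} 0<c = *-cancelʳ-≤ a b c {{ℕ.>-nonZero 0<c}}

module Extremality {A : Set} (_≟_ : DecidableEquality A) (u : List A) where
  open Count _≟_

  extremal-if-attains : ∀ G → 0 < G → (∀ Γ′ → 0 < size Γ′ → G * appearances u Γ′ ≤ 2 * size Γ′) →
                        ∀ Γ → 0 < size Γ → 2 * size Γ ≤ G * appearances u Γ → Extremal u Γ
  extremal-if-attains G 0<G bound Γ 0<n attains = 0<n , λ Γ′ 0<n′ → cancel-*ʳ-≤ (*-monoʳ-< 2 0<G) (begin
    appearances u Γ′ * size Γ * (2 * G)     ≡⟨ regroup (appearances u Γ′) (size Γ) G ⟩
    G * appearances u Γ′ * (2 * size Γ)     ≤⟨ *-monoˡ-≤ (2 * size Γ) (bound Γ′ 0<n′) ⟩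
    2 * size Γ′ * (2 * size Γ)              ≡⟨ *-comm (2 * size Γ′) _ ⟩
    2 * size Γ * (2 * size Γ′)              ≤⟨ *-monoˡ-≤ (2 * size Γ′) attains ⟩
    G * appearances u Γ * (2 * size Γ′)     ≡⟨ regroup′ G (appearances u Γ) (size Γ′) ⟩
    appearances u Γ * size Γ′ * (2 * G)     ∎)
    where
    open ≤-Reasoning
    regroup : ∀ m n G → m * n * (2 * G) ≡ G * m * (2 * n)
    regroup = solve-∀
    regroup′ : ∀ G m n → G * m * (2 * n) ≡ m * n * (2 * G)
    regroup′ = solve-∀

  extremal-attains : ∀ G Γ Γ′ → Extremal u Γ → 0 < size Γ′ → 2 * size Γ′ ≤ G * appearances u Γ′ →
                     2 * size Γ ≤ G * appearances u Γ
  extremal-attains G Γ Γ′ (_ , extremal) 0<n′ attains′ = cancel-*ʳ-≤ 0<n′ (begin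
    2 * size Γ * size Γ′                   ≡⟨ regroup (size Γ) (size Γ′) ⟩
    2 * size Γ′ * size Γ                   ≤⟨ *-monoˡ-≤ (size Γ) attains′ ⟩
    G * appearances u Γ′ * size Γ          ≡⟨ *-assoc G _ _ ⟩
    G * (appearances u Γ′ * size Γ)        ≤⟨ *-monoʳ-≤ G (extremal Γ′ 0<n′) ⟩
    G * (appearances u Γ * size Γ′)        ≡⟨ sym (*-assoc G _ _) ⟩
    G * appearances u Γ * size Γ′          ∎)
    where
    open ≤-Reasoning
    regroup : ∀ n n′ → 2 * n * n′ ≡ 2 * n′ * n
    regroup = solve-∀

  extremal-equiv : ∀ Γ Γ′ → Extremal u Γ′ → Equiv Γ Γ′ → 0 < size Γ → Extremal u Γ
  extremal-equiv Γ Γ′ (0<n′ , extremal) equiv 0<n = 0<n , λ Γ″ 0<n″ → cancel-*ʳ-≤ 0<n′ (begin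
    appearances u Γ″ * size Γ * size Γ′      ≡⟨ regroup (appearances u Γ″) (size Γ) (size Γ′) ⟩
    appearances u Γ″ * size Γ′ * size Γ      ≤⟨ *-monoˡ-≤ (size Γ) (extremal Γ″ 0<n″) ⟩
    appearances u Γ′ * size Γ″ * size Γ      ≡⟨ regroup′ (appearances u Γ′) (size Γ″) (size Γ) ⟩
    size Γ″ * (size Γ * appearances u Γ′)    ≡⟨ cong (size Γ″ *_) (appearances-equiv _≟_ u Γ Γ′ 0<n 0<n′ equiv) ⟩
    size Γ″ * (size Γ′ * appearances u Γ)    ≡⟨ regroup″ (size Γ″) (size Γ′) (appearances u Γ) ⟩
    appearances u Γ * size Γ″ * size Γ′      ∎)
    where
    open ≤-Reasoning
    regroup : ∀ a b c → a * b * c ≡ a * c * b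
    regroup = solve-∀
    regroup′ : ∀ a b c → a * b * c ≡ b * (c * a)
    regroup′ = solve-∀
    regroup″ : ∀ a b c → a * (b * c) ≡ c * a * b
    regroup″ = solve-∀

  attains⇒0<appearances : ∀ G Γ → 0 < size Γ → 2 * size Γ ≤ G * appearances u Γ → 0 < appearances u Γ
  attains⇒0<appearances G Γ 0<n attains with appearances u Γ | attains
  ... | zero  | 2n≤0 = ⊥-elim (<⇒≱ (*-monoʳ-< 2 0<n) (≤-trans 2n≤0 (≤-reflexive (*-zeroʳ G))))
  ... | suc _ | _    = s≤s z≤n

-- A discharging argument

least-witness : ∀ (P : ℕ → Bool) j → T (P j) → ∃₂ λ k r → k + r ≡ j × T (P k) × (∀ i → i < k → ¬ T (P i))
least-witness P j Pj with P 0 in P0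
least-witness P j       Pj | true  = 0 , j , refl , subst T (sym P0) _ , λ _ ()
least-witness P zero    Pj | false = ⊥-elim (subst T P0 Pj)
least-witness P (suc j) Pj | false with least-witness (P ∘ suc) j Pj
... | k , r , k+r≡j , Pk , below = suc k , r , cong suc k+r≡j , Pk , earlier
  where
  earlier : ∀ i → i < suc k → ¬ T (P i)
  earlier zero    _         = subst T P0
  earlier (suc i) (s≤s i<k) = below i i<k

-- Summing the gap condition over consecutive events telescopes the potentials ψ, so a period
-- of length n holds at most 2n/G events.
module EventWalk (E : ℤ → Bool → Bool) (G : ℕ) (ψ : Bool → ℕ) (0<G : 0 < G)
  (gap : ∀ x j d d′ → T (E x d) → T (E (x ⊕ j) d′) → 0 < j ⊎ d ≢ d′ → G + ψ d′ ≤ 2 * j + ψ d) where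

  events : ℤ → ℕ
  events x = boolToℕ (E x true) + boolToℕ (E x false)

  private
    same-place : ∀ x d d′ → T (E x d) → T (E (x ⊕ 0) d′) → d ≢ d′ → G + ψ d′ ≤ ψ d
    same-place x d d′ e e′ d≢d′ = gap x 0 d d′ e e′ (inj₂ d≢d′)

    true≢false : true ≢ false
    true≢false ()

  one-direction : ∀ x → T (E x true) → ¬ T (E x false)
  one-direction x forward backward = <-asym
    (≤-trans (+-monoˡ-≤ (ψ false) 0<G) (same-place x true false forward (subst (λ y → T (E y false)) (sym (ℤₚ.+-identityʳ x)) backward) true≢false))
    (≤-trans (+-monoˡ-≤ (ψ true) 0<G) (same-place x false true backward (subst (λ y → T (E y true)) (sym (ℤₚ.+-identityʳ x)) forward) (true≢false ∘ sym)))

  events≡1 : ∀ x d → T (E x d) → events x ≡ 1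
  events≡1 x d e with E x true in f | E x false in b
  ... | true  | true  = ⊥-elim (one-direction x (subst T (sym f) _) (subst T (sym b) _))
  ... | true  | false = refl
  ... | false | true  = refl
  ... | false | false with d
  ...   | true  = ⊥-elim (subst T f e)
  ...   | false = ⊥-elim (subst T b e)

  events≡0 : ∀ x → ¬ T (E x true ∨ E x false) → events x ≡ 0
  events≡0 x none with E x true | E x false
  ... | false | false = refl
  ... | true  | _     = ⊥-elim (none _)
  ... | false | true  = ⊥-elim (none _)

  record NextEvent (x : ℤ) (j : ℕ) : Set where
    field
      k r : ℕ
      dir : Bool
      k+r≡j : k + r ≡ j
      event : T (E (x ⊕ suc k) dir)
      window-split : window events x (suc j) ≡ events x + window events (x ⊕ suc k) r

  next-event : ∀ x j d′ → T (E (x ⊕ suc j) d′) → NextEvent x j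
  next-event x j d′ e′ with least-witness (λ i → E (x ⊕ suc i) true ∨ E (x ⊕ suc i) false) j (some-direction d′ e′)
    where
    some-direction : ∀ d → T (E (x ⊕ suc j) d) → T (E (x ⊕ suc j) true ∨ E (x ⊕ suc j) false)
    some-direction d e = Equivalence.from T-∨ (direction d e)
      where
      direction : ∀ d → T (E (x ⊕ suc j) d) → T (E (x ⊕ suc j) true) ⊎ T (E (x ⊕ suc j) false)
      direction true  e = inj₁ e
      direction false e = inj₂ e
  ... | k , r , k+r≡j , found , below = record
    { k = k ; r = r ; dir = d ; k+r≡j = k+r≡j ; event = event ; window-split = split }
    where
    which : T (E (x ⊕ suc k) true) ⊎ T (E (x ⊕ suc k) false) → ∃[ d ] T (E (x ⊕ suc k) d)
    which (inj₁ e) = true , e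
    which (inj₂ e) = false , e
    d = proj₁ (which (Equivalence.to T-∨ found))
    event = proj₂ (which (Equivalence.to T-∨ found))
    split : window events x (suc j) ≡ events x + window events (x ⊕ suc k) r
    split = cong₂ _+_ (cong events (ℤₚ.+-identityʳ x)) (begin
      ∑ j (λ i → events (x ⊕ suc i))                                   ≡⟨ cong (λ n → ∑ n (λ i → events (x ⊕ suc i))) (sym k+r≡j) ⟩
      ∑ (k + r) (λ i → events (x ⊕ suc i))                             ≡⟨ ∑-+ k r _ ⟩
      ∑ k (λ i → events (x ⊕ suc i)) + ∑ r (λ i → events (x ⊕ suc (k + i))) ≡⟨ cong₂ _+_ (∑-of-zeros k _ (λ i i<k → events≡0 _ (below i i<k))) (∑-cong r (λ i _ → cong events (⊕-+ x (suc k) i))) ⟩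
      window events (x ⊕ suc k) r                                      ∎)
      where open ≡-Reasoning

  private
    combine : ∀ W a b c k r → G * W + a ≤ 2 * r + b → G + b ≤ 2 * suc k + c → G * suc W + a ≤ 2 * (suc k + r) + c
    combine W a b c k r rest first = begin
      G * suc W + a       ≡⟨ regroup G W a ⟩
      G + (G * W + a)     ≤⟨ +-monoʳ-≤ G rest ⟩
      G + (2 * r + b)     ≡⟨ regroup′ G r b ⟩
      G + b + 2 * r       ≤⟨ +-monoˡ-≤ (2 * r) first ⟩
      2 * suc k + c + 2 * r ≡⟨ regroup″ k c r ⟩
      2 * (suc k + r) + c ∎
      where
      open ≤-Reasoning
      regroup : ∀ G W a → G * suc W + a ≡ G + (G * W + a)
      regroup = solve-∀
      regroup′ : ∀ G r b → G + (2 * r + b) ≡ G + b + 2 * r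
      regroup′ = solve-∀
      regroup″ : ∀ k c r → 2 * suc k + c + 2 * r ≡ 2 * (suc k + r) + c
      regroup″ = solve-∀

    combine-< : ∀ W a b k r → G * W + a ≤ 2 * r + b → G + b < 2 * suc k + a → G * suc W < 2 * (suc k + r)
    combine-< W a b k r rest first = +-cancelʳ-< a _ _ (begin-strict
      G * suc W + a       ≡⟨ regroup G W a ⟩
      G + (G * W + a)     ≤⟨ +-monoʳ-≤ G rest ⟩
      G + (2 * r + b)     ≡⟨ regroup′ G r b ⟩
      G + b + 2 * r       <⟨ +-monoˡ-< (2 * r) first ⟩
      2 * suc k + a + 2 * r ≡⟨ regroup″ k a r ⟩
      2 * (suc k + r) + a ∎)
      where
      open ≤-Reasoning
      regroup : ∀ G W a → G * suc W + a ≡ G + (G * W + a)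
      regroup = solve-∀
      regroup′ : ∀ G r b → G + (2 * r + b) ≡ G + b + 2 * r
      regroup′ = solve-∀
      regroup″ : ∀ k c r → 2 * suc k + c + 2 * r ≡ 2 * (suc k + r) + c
      regroup″ = solve-∀

    event-after : ∀ x k r j d → k + r ≡ j → T (E (x ⊕ suc j) d) → T (E (x ⊕ suc k ⊕ r) d)
    event-after x k r j d k+r≡j = subst (λ y → T (E y d)) (trans (cong (λ i → x ⊕ suc i) (sym k+r≡j)) (⊕-+ x (suc k) r))

    window-after-first : ∀ x d j (ne : NextEvent x j) → T (E x d) →
                         window events x (suc j) ≡ suc (window events (x ⊕ suc (NextEvent.k ne)) (NextEvent.r ne))
    window-after-first x d j ne e =
      trans (NextEvent.window-split ne) (cong (_+ window events (x ⊕ suc (NextEvent.k ne)) (NextEvent.r ne)) (events≡1 x d e))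

  walk-bound : ∀ j x d d′ → T (E x d) → T (E (x ⊕ j) d′) → G * window events x j + ψ d′ ≤ 2 * j + ψ d
  walk-bound = <-rec _ step
    where
    step : ∀ j → (∀ {m} → m < j → ∀ x d d′ → T (E x d) → T (E (x ⊕ m) d′) → G * window events x m + ψ d′ ≤ 2 * m + ψ d) →
           ∀ x d d′ → T (E x d) → T (E (x ⊕ j) d′) → G * window events x j + ψ d′ ≤ 2 * j + ψ d
    step zero _ x d d′ e e′ rewrite *-zeroʳ G with d Bool.≟ d′
    ... | yes refl  = ≤-refl
    ... | no  d≢d′  = m+n≤o⇒n≤o G (same-place x d d′ e e′ d≢d′)
    step (suc j) rec x d d′ e e′ =
      let open NextEvent (next-event x j d′ e′)
          r<suc-j = s≤s (≤-trans (m≤n+m r k) (≤-reflexive k+r≡j))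
          rest = rec r<suc-j (x ⊕ suc k) dir d′ event (event-after x k r j d′ k+r≡j e′)
          first = gap x (suc k) d dir e event (inj₁ (s≤s z≤n))
      in subst₂ (λ D m → G * D + ψ d′ ≤ 2 * m + ψ d)
                (sym (window-after-first x d j (next-event x j d′ e′) e)) (cong suc k+r≡j)
                (combine _ (ψ d′) (ψ dir) (ψ d) k r rest first)

  PeriodicEvents : ℕ → Set
  PeriodicEvents n = ∀ x d → E (x ⊕ n) d ≡ E x d

  events-per-period : ∀ n → PeriodicEvents n → ∀ x d → T (E x d) → G * window events x n ≤ 2 * n
  events-per-period n periodic x d e = +-cancelʳ-≤ (ψ d) _ _ (walk-bound n x d d e (subst T (sym (periodic x d)) e))

  tight-gap : ∀ n → PeriodicEvents n → 0 < n → ∀ x d → T (E x d) → 2 * n ≤ G * window events x n →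
              ∃₂ λ j d′ → 0 < j × T (E (x ⊕ j) d′) × 2 * j + ψ d ≡ G + ψ d′
  tight-gap (suc j) periodic _ x d e full = suc k , dir , s≤s z≤n , event , ≤-antisym tight first
    where
    e′ = subst T (sym (periodic x d)) e
    open NextEvent (next-event x j d e′)
    rest = walk-bound r (x ⊕ suc k) dir d event (event-after x k r j d k+r≡j e′)
    first = gap x (suc k) d dir e event (inj₁ (s≤s z≤n))
    tight : 2 * suc k + ψ d ≤ G + ψ dir
    tight with ≤-<-connex (2 * suc k + ψ d) (G + ψ dir)
    ... | inj₁ tight = tight
    ... | inj₂ loose = ⊥-elim (<⇒≱ (combine-< _ (ψ d) (ψ dir) k r rest loose)
      (subst₂ (λ m D → 2 * m ≤ G * D) (sym (cong suc k+r≡j)) (window-after-first x d j (next-event x j d e′) e) full))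

module Maximality {A : Set} (w : List A) (cl cr cp : ℕ)
  (cl-max : IsMaximum (PalPrefixLen w) cl)
  (cr-max : IsMaximum (PalSuffixLen w) cr)
  (cp-max : IsMaximum (BorderLen w) cp) where

  ℓ : ℕ
  ℓ = length w

  |v| |u₂| : ℕ
  |v|  = ℓ ∸ cp
  |u₂| = ℓ ∸ cr

  cp<ℓ : cp < ℓ
  cp<ℓ = proj₁ (proj₁ cp-max)

  cl≤ℓ : cl ≤ ℓ
  cl≤ℓ = proj₁ (proj₁ cl-max)

  cr≤ℓ : cr ≤ ℓ
  cr≤ℓ = proj₁ (proj₁ cr-max)

  |v|+cp≡ℓ : |v| + cp ≡ ℓ
  |v|+cp≡ℓ = m∸n+n≡m (<⇒≤ cp<ℓ)

  |u₂|+cr≡ℓ : |u₂| + cr ≡ ℓ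
  |u₂|+cr≡ℓ = m∸n+n≡m cr≤ℓ

  0<|v| : 0 < |v|
  0<|v| = m<n⇒0<n∸m cp<ℓ

  |v|≤ℓ : |v| ≤ ℓ
  |v|≤ℓ = m∸n≤m ℓ cp

  |u₂|≤ℓ : |u₂| ≤ ℓ
  |u₂|≤ℓ = m∸n≤m ℓ cr

  period-|v| : Period w |v|
  period-|v| = border⇒period w cp (<⇒≤ cp<ℓ) (proj₂ (proj₁ cp-max))

  period-minimal : ∀ j → 0 < j → Period w j → |v| ≤ j
  period-minimal j 0<j period with ≤-total j ℓ
  ... | inj₁ j≤ℓ = m≤n+o⇒m∸n≤o ℓ cp (≤-trans (m≤n+m∸n ℓ j) (≤-trans (+-monoʳ-≤ j ℓ∸j≤cp) (≤-reflexive (+-comm j cp))))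
    where
    ℓ∸j≤cp : ℓ ∸ j ≤ cp
    ℓ∸j≤cp = proj₂ cp-max (ℓ ∸ j) (∸-monoʳ-< {ℓ} {j} {0} 0<j j≤ℓ , period⇒border w j j≤ℓ period)
  ... | inj₂ ℓ≤j = ≤-trans |v|≤ℓ ℓ≤j

  prefix-cl : PrefixMirrored w cl
  prefix-cl = palindrome⇒prefixMirrored w cl cl≤ℓ (proj₂ (proj₁ cl-max))

  prefix-maximal : ∀ k → k ≤ ℓ → PrefixMirrored w k → k ≤ cl
  prefix-maximal k k≤ℓ mirrored = proj₂ cl-max k (k≤ℓ , prefixMirrored⇒palindrome w k k≤ℓ mirrored)

  prefix-maximal∸ : ∀ j → PrefixMirrored w (ℓ ∸ j) → ℓ ≤ cl + j
  prefix-maximal∸ j mirrored = ≤-trans (m≤n+m∸n ℓ j)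
    (≤-trans (+-monoʳ-≤ j (prefix-maximal (ℓ ∸ j) (m∸n≤m ℓ j) mirrored)) (≤-reflexive (+-comm j cl)))

  suffix-|u₂| : SuffixMirroredFrom w |u₂|
  suffix-|u₂| = palindrome⇒suffixMirrored w |u₂| |u₂|≤ℓ (proj₂ (proj₁ cr-max))

  suffix-maximal : ∀ j → SuffixMirroredFrom w j → ℓ ≤ cr + j
  suffix-maximal j mirrored with ≤-total j ℓ
  ... | inj₁ j≤ℓ = ≤-trans (m≤n+m∸n ℓ j) (≤-trans (+-monoʳ-≤ j ℓ∸j≤cr) (≤-reflexive (+-comm j cr)))
    where
    ℓ∸j≤cr : ℓ ∸ j ≤ cr
    ℓ∸j≤cr = proj₂ cr-max (ℓ ∸ j) (m∸n≤m ℓ j ,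
      subst (λ k → Palindrome (drop k w)) (sym (m∸[m∸n]≡n j≤ℓ)) (suffixMirrored⇒palindrome w j j≤ℓ mirrored))
  ... | inj₂ ℓ≤j = ≤-trans ℓ≤j (m≤n+m j cr)

  palindrome⇒cl≡ℓ : Palindrome w → cl ≡ ℓ
  palindrome⇒cl≡ℓ pal = ≤-antisym cl≤ℓ (proj₂ cl-max ℓ (≤-refl , subst Palindrome (sym (Listₚ.take-all ℓ w ≤-refl)) pal))

  palindrome⇒cr≡ℓ : Palindrome w → cr ≡ ℓ
  palindrome⇒cr≡ℓ pal = ≤-antisym cr≤ℓ (proj₂ cr-max ℓ (≤-refl , subst (λ k → Palindrome (drop k w)) (sym (n∸n≡0 ℓ)) pal))

  cr≡ℓ⇒palindrome : cr ≡ ℓ → Palindrome w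
  cr≡ℓ⇒palindrome cr≡ℓ = subst Palindrome (cong (λ k → drop k w) |u₂|≡0) (proj₂ (proj₁ cr-max))
    where
    |u₂|≡0 : |u₂| ≡ 0
    |u₂|≡0 = trans (cong (ℓ ∸_) cr≡ℓ) (n∸n≡0 ℓ)

module Occurrences {A : Set} (_≟_ : DecidableEquality A) (w : List A) where
  open Count _≟_

  private
    ℓ = length w

  ReadsForward ReadsBackward : Grid A → ℤ → Set
  ReadsForward  Γ x = ∀ i → i < ℓ → ext Γ (x ⊕ i) ≡ at w i
  ReadsBackward Γ x = ∀ a b → a + suc b ≡ ℓ → ext Γ (x ⊕ a) ≡ at w b

  occursAt : Grid A → ℤ → Bool → Bool
  occursAt Γ x true  = matchFrom Γ x (+ 1) w
  occursAt Γ x false = matchFrom Γ (x ⊕ (ℓ ∸ 1)) -[1+ 0 ] w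

  private
    backward-position : ∀ x a b → a + suc b ≡ ℓ → x ⊕ (ℓ ∸ 1) ℤ.+ + b ℤ.* -[1+ 0 ] ≡ x ⊕ a
    backward-position x a b eq = begin
      x ⊕ (ℓ ∸ 1) ℤ.+ + b ℤ.* -[1+ 0 ]  ≡⟨ cong (λ k → x ⊕ k ℤ.+ + b ℤ.* -[1+ 0 ]) (pred-mirror a b eq) ⟩
      x ⊕ (a + b) ℤ.+ + b ℤ.* -[1+ 0 ]  ≡⟨ cong (λ y → y ℤ.+ + b ℤ.* -[1+ 0 ]) (⊕-+ x a b) ⟩
      x ⊕ a ⊕ b ℤ.+ + b ℤ.* -[1+ 0 ]    ≡⟨ cancel (x ⊕ a) (+ b) ⟩
      x ⊕ a                             ∎
      where
      open ≡-Reasoning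
      cancel : ∀ y b → y ℤ.+ b ℤ.+ b ℤ.* -[1+ 0 ] ≡ y
      cancel = ℤ-Ring.solve-∀

  occursAt-backward : ∀ Γ p → occursAt Γ (p ℤ.- + (ℓ ∸ 1)) false ≡ matchFrom Γ p -[1+ 0 ] w
  occursAt-backward Γ p = cong (λ y → matchFrom Γ y -[1+ 0 ] w) (cancel p (+ (ℓ ∸ 1)))
    where
    cancel : ∀ p m → p ℤ.- m ℤ.+ m ≡ p
    cancel = ℤ-Ring.solve-∀

  forward-sound : ∀ Γ x → T (occursAt Γ x true) → ReadsForward Γ x
  forward-sound Γ x match i i<ℓ =
    trans (cong (λ k → ext Γ (x ℤ.+ k)) (sym (ℤₚ.*-identityʳ (+ i)))) (matchFrom-sound _≟_ Γ x (+ 1) w match i i<ℓ)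

  forward-complete : ∀ Γ x → ReadsForward Γ x → T (occursAt Γ x true)
  forward-complete Γ x reads = matchFrom-complete _≟_ Γ x (+ 1) w
    (λ i i<ℓ → trans (cong (λ k → ext Γ (x ℤ.+ k)) (ℤₚ.*-identityʳ (+ i))) (reads i i<ℓ))

  backward-sound : ∀ Γ x → T (occursAt Γ x false) → ReadsBackward Γ x
  backward-sound Γ x match a b eq = trans (cong (ext Γ) (sym (backward-position x a b eq)))
    (matchFrom-sound _≟_ Γ (x ⊕ (ℓ ∸ 1)) -[1+ 0 ] w match b (mirror-<ʳ a b eq))

  backward-complete : ∀ Γ x → ReadsBackward Γ x → T (occursAt Γ x false)
  backward-complete Γ x reads = matchFrom-complete _≟_ Γ _ -[1+ 0 ] w λ i i<ℓ →
    trans (cong (ext Γ) (backward-position x (ℓ ∸ suc i) i (m∸n+n≡m i<ℓ))) (reads (ℓ ∸ suc i) i (m∸n+n≡m i<ℓ))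

  module _ (Γ : Grid A) (x : ℤ) (j : ℕ) where

    forward-forward⇒period : ReadsForward Γ x → ReadsForward Γ (x ⊕ j) → Period w j
    forward-forward⇒period first second i i+j<ℓ = begin
      at w i              ≡⟨ sym (second i (≤-trans (s≤s (m≤m+n i j)) i+j<ℓ)) ⟩
      ext Γ (x ⊕ j ⊕ i)   ≡⟨ cong (ext Γ) (trans (sym (⊕-+ x j i)) (cong (x ⊕_) (+-comm j i))) ⟩
      ext Γ (x ⊕ (i + j)) ≡⟨ first (i + j) i+j<ℓ ⟩
      at w (i + j)        ∎
      where open ≡-Reasoning

    backward-backward⇒period : ReadsBackward Γ x → ReadsBackward Γ (x ⊕ j) → Period w j
    backward-backward⇒period first second i i+j<ℓ = begin
      at w i              ≡⟨ sym (first (j + a) i eq₁) ⟩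
      ext Γ (x ⊕ (j + a)) ≡⟨ cong (ext Γ) (⊕-+ x j a) ⟩
      ext Γ (x ⊕ j ⊕ a)   ≡⟨ second a (i + j) eq₂ ⟩
      at w (i + j)        ∎
      where
      open ≡-Reasoning
      a = ℓ ∸ suc (i + j)
      eq₂ : a + suc (i + j) ≡ ℓ
      eq₂ = m∸n+n≡m i+j<ℓ
      rearrange : ∀ j a i → j + a + suc i ≡ a + suc (i + j)
      rearrange = solve-∀
      eq₁ : j + a + suc i ≡ ℓ
      eq₁ = trans (rearrange j a i) eq₂

    forward-backward⇒suffixMirrored : ReadsForward Γ x → ReadsBackward Γ (x ⊕ j) → SuffixMirroredFrom w j
    forward-backward⇒suffixMirrored first second a b eq = begin
      at w (j + a)        ≡⟨ sym (first (j + a) (mirror-<ˡ (j + a) b j+a-mirror)) ⟩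
      ext Γ (x ⊕ (j + a)) ≡⟨ cong (ext Γ) (⊕-+ x j a) ⟩
      ext Γ (x ⊕ j ⊕ a)   ≡⟨ second a (j + b) eq′ ⟩
      at w (j + b)        ∎
      where
      open ≡-Reasoning
      rearrange : ∀ a b j → a + suc (j + b) ≡ a + suc b + j
      rearrange = solve-∀
      eq′ : a + suc (j + b) ≡ ℓ
      eq′ = trans (rearrange a b j) eq
      rearrange′ : ∀ j a b → j + a + suc b ≡ a + suc b + j
      rearrange′ = solve-∀
      j+a-mirror : j + a + suc b ≡ ℓ
      j+a-mirror = trans (rearrange′ j a b) eq

    backward-forward⇒prefixMirrored : ReadsBackward Γ x → ReadsForward Γ (x ⊕ j) → j ≤ ℓ →
                                      PrefixMirrored w (ℓ ∸ j)
    backward-forward⇒prefixMirrored first second j≤ℓ a b eq = begin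
      at w a              ≡⟨ sym (second a a<ℓ) ⟩
      ext Γ (x ⊕ j ⊕ a)   ≡⟨ cong (ext Γ) (sym (⊕-+ x j a)) ⟩
      ext Γ (x ⊕ (j + a)) ≡⟨ first (j + a) b eq′ ⟩
      at w b              ∎
      where
      open ≡-Reasoning
      eq′ : j + a + suc b ≡ ℓ
      eq′ = trans (+-assoc j a (suc b)) (trans (cong (_+_ j) eq) (m+[n∸m]≡n j≤ℓ))
      a<ℓ : a < ℓ
      a<ℓ = ≤-trans (s≤s (m≤n+m a j)) (mirror-<ˡ (j + a) b eq′)

  module _ (Γ : Grid A) (0<n : 0 < size Γ) where

    private
      n = size Γ
      forwardAt backwardAt : ℤ → ℕ
      forwardAt  p = boolToℕ (matchFrom Γ p (+ 1) w)
      backwardAt p = boolToℕ (matchFrom Γ p -[1+ 0 ] w)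
      periodic = ext-periodic Γ 0<n
      forward-periodic : Periodic forwardAt n
      forward-periodic z = cong boolToℕ (matchFrom-periodic _≟_ Γ n (+ 1) w periodic z)
      backward-periodic : Periodic backwardAt n
      backward-periodic z = cong boolToℕ (matchFrom-periodic _≟_ Γ n -[1+ 0 ] w periodic z)

      appearances-split : appearances w Γ ≡ window forwardAt (+ 0) n + window backwardAt (+ 0) n
      appearances-split = trans (appearances≡window _≟_ w Γ) (∑-+-distrib n _ _)

    occursAt-periodic : ∀ x d → occursAt Γ (x ⊕ n) d ≡ occursAt Γ x d
    occursAt-periodic x true  = matchFrom-periodic _≟_ Γ n (+ 1) w periodic x
    occursAt-periodic x false = trans (cong (λ y → matchFrom Γ y -[1+ 0 ] w) (swap x (+ n) (+ (ℓ ∸ 1))))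
                                      (matchFrom-periodic _≟_ Γ n -[1+ 0 ] w periodic (x ⊕ (ℓ ∸ 1)))
      where
      swap : ∀ x n m → x ℤ.+ n ℤ.+ m ≡ x ℤ.+ m ℤ.+ n
      swap = ℤ-Ring.solve-∀

    window-occurrences≡appearances :
      ∀ x → window (λ y → boolToℕ (occursAt Γ y true) + boolToℕ (occursAt Γ y false)) x n ≡ appearances w Γ
    window-occurrences≡appearances x = begin
      window (λ y → boolToℕ (occursAt Γ y true) + boolToℕ (occursAt Γ y false)) x n
        ≡⟨ ∑-+-distrib n _ _ ⟩
      window forwardAt x n + window (λ y → backwardAt (y ⊕ (ℓ ∸ 1))) x n
        ≡⟨ cong (_+_ (window forwardAt x n)) (∑-cong n (λ i _ → cong backwardAt (swap x (+ i) (+ (ℓ ∸ 1))))) ⟩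
      window forwardAt x n + window backwardAt (x ⊕ (ℓ ∸ 1)) n
        ≡⟨ cong₂ _+_ (window-periodic forwardAt forward-periodic x (+ 0))
                     (window-periodic backwardAt backward-periodic (x ⊕ (ℓ ∸ 1)) (+ 0)) ⟩
      window forwardAt (+ 0) n + window backwardAt (+ 0) n
        ≡⟨ sym appearances-split ⟩
      appearances w Γ ∎
      where
      open ≡-Reasoning
      swap : ∀ x i m → x ℤ.+ i ℤ.+ m ≡ x ℤ.+ m ℤ.+ i
      swap = ℤ-Ring.solve-∀

    appearances⇒occurrence : 0 < appearances w Γ → ∃₂ λ x d → T (occursAt Γ x d)
    appearances⇒occurrence 0<app with ∑-positive⇒term n _ (subst (0 <_) (appearances≡window _≟_ w Γ) 0<app)
    ... | i , _ , 0<here with matchFrom Γ (+ i) (+ 1) w in forward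
    ...   | true  = + i , true , subst T (sym forward) _
    ...   | false with matchFrom Γ (+ i) -[1+ 0 ] w in backward
    ...     | true  = + i ℤ.- + (ℓ ∸ 1) , false , subst T (sym (trans (occursAt-backward Γ (+ i)) backward)) _
    ...     | false = ⊥-elim (<-irrefl refl 0<here)

    private
      window-≥1 : ∀ c → Periodic c n → ∀ x → 1 ≤ c x → 1 ≤ window c (+ 0) n
      window-≥1 c c-periodic x 1≤cx = subst (1 ≤_) (window-periodic c c-periodic x (+ 0))
        (≤-trans (≤-trans 1≤cx (≤-reflexive (cong c (sym (ℤₚ.+-identityʳ x))))) (term≤∑ n _ 0 0<n))

      forward-window : ∀ x → T (occursAt Γ x true) → 1 ≤ window forwardAt (+ 0) n
      forward-window x occurs = window-≥1 forwardAt forward-periodic x (≤-reflexive (sym (cong boolToℕ (Equivalence.to T-≡ occurs))))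

      backward-window : ∀ x → T (occursAt Γ x false) → 1 ≤ window backwardAt (+ 0) n
      backward-window x occurs = window-≥1 backwardAt backward-periodic (x ⊕ (ℓ ∸ 1)) (≤-reflexive (sym (cong boolToℕ (Equivalence.to T-≡ occurs))))

    occurrence⇒appearances : ∀ x d → T (occursAt Γ x d) → 1 ≤ appearances w Γ
    occurrence⇒appearances x true  occurs = subst (1 ≤_) (sym appearances-split) (≤-trans (forward-window x occurs) (m≤m+n _ _))
    occurrence⇒appearances x false occurs = subst (1 ≤_) (sym appearances-split) (≤-trans (backward-window x occurs) (m≤n+m _ _))

    occurrences⇒appearances : ∀ x y → T (occursAt Γ x true) → T (occursAt Γ y false) → 2 ≤ appearances w Γ
    occurrences⇒appearances x y forward backward =
      subst (2 ≤_) (sym appearances-split) (+-mono-≤ (forward-window x forward) (backward-window y backward))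

module _ {A : Set} (_≟_ : DecidableEquality A) (w : List A) where
  open Occurrences _≟_ w

  gridOf-reads-forward : ∀ (u : List A) → 0 < length u → Period w (length u) →
                         (∀ i → i < length u → i < length w → at u i ≡ at w i) →
                         ∀ k → ReadsForward (gridOf u) (+ (k * length u))
  gridOf-reads-forward u 0<p period agree k i i<ℓ =
    trans (cong (ext (gridOf u)) (ℤₚ.+-comm (+ (k * p)) (+ i)))
          (trans (periodic-* (ext (gridOf u)) p (ext-periodic (gridOf u) 0<p) k (+ i)) (<-rec _ reads i i<ℓ))
    where
    p = length u
    reads : ∀ i → (∀ {i′} → i′ < i → i′ < length w → ext (gridOf u) (+ i′) ≡ at w i′) →
            i < length w → ext (gridOf u) (+ i) ≡ at w i
    reads i rec i<ℓ with <-≤-connex i p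
    ... | inj₁ i<p = trans (ext-gridOf u 0 i i<p) (agree i i<p i<ℓ)
    ... | inj₂ p≤i with i′ ← i ∸ p | refl ← sym (m+[n∸m]≡n p≤i) = begin
      ext (gridOf u) (+ (p + i′))     ≡⟨ cong (ext (gridOf u)) (trans (ℤₚ.pos-+ p i′) (ℤₚ.+-comm (+ p) (+ i′))) ⟩
      ext (gridOf u) (+ i′ ⊕ p)       ≡⟨ ext-periodic (gridOf u) 0<p (+ i′) ⟩
      ext (gridOf u) (+ i′)           ≡⟨ rec i′<i (<-trans i′<i i<ℓ) ⟩
      at w i′                         ≡⟨ period i′ (subst (_< length w) (+-comm p i′) i<ℓ) ⟩
      at w (i′ + p)                   ≡⟨ cong (at w) (+-comm i′ p) ⟩
      at w (p + i′)                   ∎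
      where
      open ≡-Reasoning
      i′<i : i′ < p + i′
      i′<i = m<n+m i′ 0<p

-- The upper bound

module Bounds {A : Set} (_≟_ : DecidableEquality A) (w : List A) (cl cr cp : ℕ)
  (cl-max : IsMaximum (PalPrefixLen w) cl)
  (cr-max : IsMaximum (PalSuffixLen w) cr)
  (cp-max : IsMaximum (BorderLen w) cp)
  (cl≤cr : cl ≤ cr) where

  open Count _≟_
  open Maximality w cl cr cp cl-max cr-max cp-max public
  open Occurrences _≟_ w public

  |u₁| Δ |Γ₂| : ℕ
  |u₁| = ℓ ∸ cl
  Δ    = cr ∸ cl
  |Γ₂| = |u₂| + |u₁|

  cl+Δ≡cr : cl + Δ ≡ cr
  cl+Δ≡cr = m+[n∸m]≡n cl≤cr

  |u₁|≡|u₂|+Δ : |u₁| ≡ |u₂| + Δ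
  |u₁|≡|u₂|+Δ = begin
    ℓ ∸ cl                     ≡⟨ cong (_∸ cl) (sym |u₂|+cr≡ℓ) ⟩
    |u₂| + cr ∸ cl             ≡⟨ cong (λ c → |u₂| + c ∸ cl) (trans (sym cl+Δ≡cr) (+-comm cl Δ)) ⟩
    |u₂| + (Δ + cl) ∸ cl       ≡⟨ cong (_∸ cl) (sym (+-assoc |u₂| Δ cl)) ⟩
    |u₂| + Δ + cl ∸ cl         ≡⟨ m+n∸n≡m (|u₂| + Δ) cl ⟩
    |u₂| + Δ                   ∎
    where open ≡-Reasoning

  |u₁|+cl≡ℓ : |u₁| + cl ≡ ℓ
  |u₁|+cl≡ℓ = m∸n+n≡m cl≤ℓ

  |Γ₂|≡2|u₂|+Δ : |Γ₂| ≡ 2 * |u₂| + Δ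
  |Γ₂|≡2|u₂|+Δ = trans (cong (_+_ |u₂|) |u₁|≡|u₂|+Δ) (regroup |u₂| Δ)
    where
    regroup : ∀ s d → s + (s + d) ≡ 2 * s + d
    regroup = solve-∀

  |Γ₂|+Δ≡2|u₁| : |Γ₂| + Δ ≡ 2 * |u₁|
  |Γ₂|+Δ≡2|u₁| = trans (cong (λ u → |u₂| + u + Δ) |u₁|≡|u₂|+Δ) (trans (regroup |u₂| Δ) (cong (2 *_) (sym |u₁|≡|u₂|+Δ)))
    where
    regroup : ∀ s d → s + (s + d) + d ≡ 2 * (s + d)
    regroup = solve-∀

  module _ (Γ : Grid A) (x : ℤ) (j : ℕ) where

    forward-forward-gap : ReadsForward Γ x → ReadsForward Γ (x ⊕ j) → 0 < j → |v| ≤ j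
    forward-forward-gap first second 0<j = period-minimal j 0<j (forward-forward⇒period Γ x j first second)

    backward-backward-gap : ReadsBackward Γ x → ReadsBackward Γ (x ⊕ j) → 0 < j → |v| ≤ j
    backward-backward-gap first second 0<j = period-minimal j 0<j (backward-backward⇒period Γ x j first second)

    forward-backward-gap : ReadsForward Γ x → ReadsBackward Γ (x ⊕ j) → |u₂| ≤ j
    forward-backward-gap first second =
      m≤n+o⇒m∸n≤o ℓ cr (suffix-maximal j (forward-backward⇒suffixMirrored Γ x j first second))

    backward-forward-gap : ReadsBackward Γ x → ReadsForward Γ (x ⊕ j) → |u₁| ≤ j
    backward-forward-gap first second with ≤-total j ℓ
    ... | inj₁ j≤ℓ = m≤n+o⇒m∸n≤o ℓ cl (prefix-maximal∸ j (backward-forward⇒prefixMirrored Γ x j first second j≤ℓ))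
    ... | inj₂ ℓ≤j = ≤-trans (m∸n≤m ℓ cl) ℓ≤j

  -- A forward-to-backward gap is at least |u₂| and a backward-to-forward gap at least |u₁| = |u₂| + Δ;
  -- charging Δ to forward occurrences makes both cost at least |Γ₂| / 2.
  ψ : Bool → ℕ
  ψ true  = Δ
  ψ false = 0

  module Discharging (G : ℕ) (G≤2|v| : G ≤ 2 * |v|) (G≤|Γ₂| : G ≤ |Γ₂|) (0<G : 0 < G) where

    gap : ∀ Γ x j d d′ → T (occursAt Γ x d) → T (occursAt Γ (x ⊕ j) d′) → 0 < j ⊎ d ≢ d′ → G + ψ d′ ≤ 2 * j + ψ d
    gap Γ x j true  true  first second (inj₁ 0<j) = +-monoˡ-≤ Δ (≤-trans G≤2|v| (*-monoʳ-≤ 2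
      (forward-forward-gap Γ x j (forward-sound Γ x first) (forward-sound Γ (x ⊕ j) second) 0<j)))
    gap Γ x j false false first second (inj₁ 0<j) = +-monoˡ-≤ 0 (≤-trans G≤2|v| (*-monoʳ-≤ 2
      (backward-backward-gap Γ x j (backward-sound Γ x first) (backward-sound Γ (x ⊕ j) second) 0<j)))
    gap Γ x j true  true  first second (inj₂ d≢d′) = ⊥-elim (d≢d′ refl)
    gap Γ x j false false first second (inj₂ d≢d′) = ⊥-elim (d≢d′ refl)
    gap Γ x j true  false first second _ = begin
      G + 0           ≡⟨ +-identityʳ G ⟩
      G               ≤⟨ G≤|Γ₂| ⟩
      |Γ₂|            ≡⟨ |Γ₂|≡2|u₂|+Δ ⟩
      2 * |u₂| + Δ    ≤⟨ +-monoˡ-≤ Δ (*-monoʳ-≤ 2 (forward-backward-gap Γ x j (forward-sound Γ x first) (backward-sound Γ (x ⊕ j) second))) ⟩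
      2 * j + Δ       ∎
      where open ≤-Reasoning
    gap Γ x j false true  first second _ = begin
      G + Δ           ≤⟨ +-monoˡ-≤ Δ G≤|Γ₂| ⟩
      |Γ₂| + Δ        ≡⟨ |Γ₂|+Δ≡2|u₁| ⟩
      2 * |u₁|        ≤⟨ *-monoʳ-≤ 2 (backward-forward-gap Γ x j (backward-sound Γ x first) (forward-sound Γ (x ⊕ j) second)) ⟩
      2 * j           ≡⟨ sym (+-identityʳ _) ⟩
      2 * j + 0       ∎
      where open ≤-Reasoning

    module Walk (Γ : Grid A) = EventWalk (occursAt Γ) G ψ 0<G (gap Γ)

    appearances-bound : ∀ Γ → 0 < size Γ → G * appearances w Γ ≤ 2 * size Γ
    appearances-bound Γ 0<n with appearances w Γ in app
    ... | zero  = subst (_≤ 2 * size Γ) (sym (*-zeroʳ G)) z≤n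
    ... | suc m with appearances⇒occurrence Γ 0<n (subst (0 <_) (sym app) (s≤s z≤n))
    ...   | x , d , occurs = subst (λ a → G * a ≤ 2 * size Γ) (trans (window-occurrences≡appearances Γ 0<n x) app)
                               (Walk.events-per-period Γ (size Γ) (occursAt-periodic Γ 0<n) x d occurs)

-- The grids Γ₁ and Γ₂

module Grids {A : Set} (_≟_ : DecidableEquality A) (w : List A) (cl cr cp : ℕ)
  (cl-max : IsMaximum (PalPrefixLen w) cl)
  (cr-max : IsMaximum (PalSuffixLen w) cr)
  (cp-max : IsMaximum (BorderLen w) cp)
  (cl≤cr : cl ≤ cr) where

  open Bounds _≟_ w cl cr cp cl-max cr-max cp-max cl≤cr public

  v u₁ u₂ u₂u₁ʳ : List A
  v     = take |v| w
  u₁    = drop cl w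
  u₂    = take |u₂| w
  u₂u₁ʳ = u₂ ++ reverse u₁

  Γ₁ Γ₂ : Grid A
  Γ₁ = gridOf v
  Γ₂ = gridOf u₂u₁ʳ

  length-v : length v ≡ |v|
  length-v = length-take-≤ w |v| |v|≤ℓ

  length-u₂ : length u₂ ≡ |u₂|
  length-u₂ = length-take-≤ w |u₂| |u₂|≤ℓ

  length-u₁ʳ : length (reverse u₁) ≡ |u₁|
  length-u₁ʳ = trans (Listₚ.length-reverse u₁) (Listₚ.length-drop cl w)

  length-u₂u₁ʳ : length u₂u₁ʳ ≡ |Γ₂|
  length-u₂u₁ʳ = trans (Listₚ.length-++ u₂) (cong₂ _+_ length-u₂ length-u₁ʳ)

  at-v : ∀ i → i < |v| → at v i ≡ at w i
  at-v i = at-take |v| w i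

  at-u₂u₁ʳ-u₂ : ∀ i → i < |u₂| → at u₂u₁ʳ i ≡ at w i
  at-u₂u₁ʳ-u₂ i i<|u₂| = trans (at-++ˡ u₂ (reverse u₁) i (subst (i <_) (sym length-u₂) i<|u₂|)) (at-take |u₂| w i i<|u₂|)

  at-u₂u₁ʳ-u₁ʳ : ∀ j b → j + suc b ≡ |u₁| → at u₂u₁ʳ (|u₂| + j) ≡ at w (cl + b)
  at-u₂u₁ʳ-u₁ʳ j b eq = begin
    at u₂u₁ʳ (|u₂| + j)          ≡⟨ cong (λ k → at u₂u₁ʳ (k + j)) (sym length-u₂) ⟩
    at u₂u₁ʳ (length u₂ + j)     ≡⟨ at-++ʳ u₂ (reverse u₁) j ⟩
    at (reverse u₁) j            ≡⟨ at-reverse u₁ j b (trans eq (sym (Listₚ.length-drop cl w))) ⟩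
    at u₁ b                      ≡⟨ at-drop cl w b ⟩
    at w (cl + b)                ∎
    where open ≡-Reasoning

  |Γ₂|+cl+cr≡2|v|+2cp : |Γ₂| + (cl + cr) ≡ 2 * |v| + 2 * cp
  |Γ₂|+cl+cr≡2|v|+2cp = begin
    |u₂| + |u₁| + (cl + cr)         ≡⟨ regroup |u₂| |u₁| cl cr ⟩
    (|u₁| + cl) + (|u₂| + cr)       ≡⟨ cong₂ _+_ |u₁|+cl≡ℓ |u₂|+cr≡ℓ ⟩
    ℓ + ℓ                           ≡⟨ cong₂ _+_ (sym |v|+cp≡ℓ) (sym |v|+cp≡ℓ) ⟩
    (|v| + cp) + (|v| + cp)         ≡⟨ regroup′ |v| cp ⟩
    2 * |v| + 2 * cp                ∎
    where
    open ≡-Reasoning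
    regroup : ∀ s u l r → s + u + (l + r) ≡ (u + l) + (s + r)
    regroup = solve-∀
    regroup′ : ∀ g c → (g + c) + (g + c) ≡ 2 * g + 2 * c
    regroup′ = solve-∀

  -- Reflecting in the palindromic prefix and then in the palindromic suffix shifts by |Γ₂|.
  period-|Γ₂| : Period w |Γ₂|
  period-|Γ₂| i i+|Γ₂|<ℓ = begin
    at w i                     ≡⟨ prefix-cl i (|u₂| + a) prefix-mirror ⟩
    at w (|u₂| + a)            ≡⟨ suffix-|u₂| a (i + |u₁|) suffix-mirror ⟩
    at w (|u₂| + (i + |u₁|))   ≡⟨ cong (at w) (regroup |u₂| i |u₁|) ⟩
    at w (i + |Γ₂|)            ∎
    where
    open ≡-Reasoning
    a = ℓ ∸ suc (i + |Γ₂|)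
    a-mirror : a + suc (i + (|u₂| + |u₁|)) ≡ ℓ
    a-mirror = m∸n+n≡m i+|Γ₂|<ℓ
    regroup : ∀ s i u → s + (i + u) ≡ i + (s + u)
    regroup = solve-∀
    regroup₁ : ∀ i s a u → i + suc (s + a) + u ≡ a + suc (i + (s + u))
    regroup₁ = solve-∀
    regroup₂ : ∀ a i u s → a + suc (i + u) + s ≡ a + suc (i + (s + u))
    regroup₂ = solve-∀
    prefix-mirror : i + suc (|u₂| + a) ≡ cl
    prefix-mirror = +-cancelʳ-≡ |u₁| _ _ (trans (regroup₁ i |u₂| a |u₁|) (trans a-mirror (trans (sym |u₁|+cl≡ℓ) (+-comm |u₁| cl))))
    suffix-mirror : a + suc (i + |u₁|) + |u₂| ≡ ℓ
    suffix-mirror = trans (regroup₂ a i |u₁| |u₂|) a-mirror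

  u₂u₁ʳ-agrees : ∀ i → i < length u₂u₁ʳ → i < ℓ → at u₂u₁ʳ i ≡ at w i
  u₂u₁ʳ-agrees i i<|Γ₂| i<ℓ with <-≤-connex i |u₂|
  ... | inj₁ i<|u₂| = at-u₂u₁ʳ-u₂ i i<|u₂|
  ... | inj₂ |u₂|≤i with j ← i ∸ |u₂| | refl ← sym (m+[n∸m]≡n |u₂|≤i) = begin
    at u₂u₁ʳ (|u₂| + j)  ≡⟨ at-u₂u₁ʳ-u₁ʳ j b j-mirror₁ ⟩
    at w (cl + b)        ≡⟨ cong (at w) same-position ⟩
    at w (|u₂| + b′)     ≡⟨ sym (suffix-|u₂| j b′ j-mirror₂) ⟩
    at w (|u₂| + j)      ∎
    where
    open ≡-Reasoning
    j<|u₁| : j < |u₁|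
    j<|u₁| = +-cancelˡ-< |u₂| j |u₁| (subst (|u₂| + j <_) length-u₂u₁ʳ i<|Γ₂|)
    j<cr : j < cr
    j<cr = +-cancelˡ-< |u₂| j cr (subst (|u₂| + j <_) (sym |u₂|+cr≡ℓ) i<ℓ)
    b = proj₁ (mirror-partner j<|u₁|)
    j-mirror₁ : j + suc b ≡ |u₁|
    j-mirror₁ = proj₂ (mirror-partner j<|u₁|)
    b′ = proj₁ (mirror-partner j<cr)
    j-mirror₂ : j + suc b′ + |u₂| ≡ ℓ
    j-mirror₂ = trans (cong (_+ |u₂|) (proj₂ (mirror-partner j<cr))) (trans (+-comm cr |u₂|) |u₂|+cr≡ℓ)
    regroup : ∀ c b j → c + b + suc j ≡ c + (j + suc b)
    regroup = solve-∀
    same-position : cl + b ≡ |u₂| + b′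
    same-position = +-cancelʳ-≡ (suc j) _ _ (begin
      cl + b + suc j          ≡⟨ regroup cl b j ⟩
      cl + (j + suc b)        ≡⟨ cong (_+_ cl) (trans j-mirror₁ |u₁|≡|u₂|+Δ) ⟩
      cl + (|u₂| + Δ)         ≡⟨ swap cl |u₂| Δ ⟩
      |u₂| + (cl + Δ)         ≡⟨ cong (_+_ |u₂|) (trans cl+Δ≡cr (sym (proj₂ (mirror-partner j<cr)))) ⟩
      |u₂| + (j + suc b′)     ≡⟨ sym (regroup |u₂| b′ j) ⟩
      |u₂| + b′ + suc j       ∎)
      where
      swap : ∀ c s d → c + (s + d) ≡ s + (c + d)
      swap = solve-∀

  0<|Γ₁| : 0 < size Γ₁
  0<|Γ₁| = subst (0 <_) (sym length-v) 0<|v|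

  Γ₁-reads-forward : ∀ k → ReadsForward Γ₁ (+ (k * |v|))
  Γ₁-reads-forward k = subst (λ p → ReadsForward Γ₁ (+ (k * p))) length-v
    (gridOf-reads-forward _≟_ w v 0<|Γ₁| (subst (Period w) (sym length-v) period-|v|)
      (λ i i<|v| _ → at-v i (subst (i <_) length-v i<|v|)) k)

  module _ (0<|Γ₂| : 0 < size Γ₂) where

    Γ₂-reads-forward : ∀ k → ReadsForward Γ₂ (+ (k * |Γ₂|))
    Γ₂-reads-forward k = subst (λ p → ReadsForward Γ₂ (+ (k * p))) length-u₂u₁ʳ
      (gridOf-reads-forward _≟_ w u₂u₁ʳ 0<|Γ₂| (subst (Period w) (sym length-u₂u₁ʳ) period-|Γ₂|) u₂u₁ʳ-agrees k)

    Γ₂-reads-backward : ReadsBackward Γ₂ (+ |u₂|)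
    Γ₂-reads-backward a b a-mirror with <-≤-connex a |u₁|
    ... | inj₁ a<|u₁| = begin
      ext Γ₂ (+ (|u₂| + a))        ≡⟨ ext-gridOf u₂u₁ʳ 0 (|u₂| + a) (subst (|u₂| + a <_) (sym length-u₂u₁ʳ) (+-monoʳ-< |u₂| a<|u₁|)) ⟩
      at u₂u₁ʳ (|u₂| + a)          ≡⟨ at-u₂u₁ʳ-u₁ʳ a b′ (proj₂ (mirror-partner a<|u₁|)) ⟩
      at w (cl + b′)               ≡⟨ cong (at w) cl+b′≡b ⟩
      at w b                       ∎
      where
      open ≡-Reasoning
      b′ = proj₁ (mirror-partner a<|u₁|)
      regroup : ∀ a b c → a + suc b + c ≡ c + b + suc a
      regroup = solve-∀
      regroup′ : ∀ a b → a + suc b ≡ b + suc a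
      regroup′ = solve-∀
      cl+b′≡b : cl + b′ ≡ b
      cl+b′≡b = +-cancelʳ-≡ (suc a) _ _ (trans (sym (regroup a b′ cl))
        (trans (cong (_+ cl) (proj₂ (mirror-partner a<|u₁|))) (trans |u₁|+cl≡ℓ (trans (sym a-mirror) (regroup′ a b)))))
    ... | inj₂ |u₁|≤a with a′ ← a ∸ |u₁| | refl ← sym (m+[n∸m]≡n |u₁|≤a) = begin
      ext Γ₂ (+ |u₂| ⊕ (|u₁| + a′)) ≡⟨ cong (ext Γ₂) position ⟩
      ext Γ₂ (+ a′ ⊕ size Γ₂)      ≡⟨ ext-periodic Γ₂ 0<|Γ₂| (+ a′) ⟩
      ext Γ₂ (+ a′)                ≡⟨ Γ₂-reads-forward 0 a′ a′<ℓ ⟩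
      at w a′                      ≡⟨ prefix-cl a′ b a′-mirror ⟩
      at w b                       ∎
      where
      open ≡-Reasoning
      regroup : ∀ s u a → s + (u + a) ≡ a + (s + u)
      regroup = solve-∀
      position : + |u₂| ⊕ (|u₁| + a′) ≡ + a′ ⊕ size Γ₂
      position = cong +_ (trans (regroup |u₂| |u₁| a′) (cong (_+_ a′) (sym length-u₂u₁ʳ)))
      a′-mirror : a′ + suc b ≡ cl
      a′-mirror = +-cancelˡ-≡ |u₁| _ _ (trans (sym (+-assoc |u₁| a′ (suc b))) (trans a-mirror (sym |u₁|+cl≡ℓ)))
      a′<ℓ : a′ < ℓ
      a′<ℓ = ≤-trans (s≤s (m≤n+m a′ |u₁|)) (mirror-<ˡ (|u₁| + a′) b a-mirror)

    reads-u₂u₁ʳ : ∀ Γ x → ReadsForward Γ x → ReadsBackward Γ (x ⊕ |u₂|) →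
                  ∀ i → i < length u₂u₁ʳ → ext Γ (x ⊕ i) ≡ at u₂u₁ʳ i
    reads-u₂u₁ʳ Γ x forward backward i i<|Γ₂| with <-≤-connex i |u₂|
    ... | inj₁ i<|u₂| = trans (forward i (<-≤-trans i<|u₂| |u₂|≤ℓ)) (sym (at-u₂u₁ʳ-u₂ i i<|u₂|))
    ... | inj₂ |u₂|≤i with j ← i ∸ |u₂| | refl ← sym (m+[n∸m]≡n |u₂|≤i) = begin
      ext Γ (x ⊕ (|u₂| + j))    ≡⟨ cong (ext Γ) (⊕-+ x |u₂| j) ⟩
      ext Γ (x ⊕ |u₂| ⊕ j)      ≡⟨ backward j b j-mirror ⟩
      at w b                    ≡⟨ sym (Γ₂-reads-backward j b j-mirror) ⟩
      ext Γ₂ (+ (|u₂| + j))     ≡⟨ ext-gridOf u₂u₁ʳ 0 (|u₂| + j) i<|Γ₂| ⟩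
      at u₂u₁ʳ (|u₂| + j)       ∎
      where
      open ≡-Reasoning
      j<ℓ : j < ℓ
      j<ℓ = <-≤-trans (+-cancelˡ-< |u₂| j |u₁| (subst (|u₂| + j <_) length-u₂u₁ʳ i<|Γ₂|)) (m∸n≤m ℓ cl)
      b = proj₁ (mirror-partner j<ℓ)
      j-mirror : j + suc b ≡ ℓ
      j-mirror = proj₂ (mirror-partner j<ℓ)

-- Classification of the extremal grids

double-cancel : ∀ {a b} → 2 * a ≡ 2 * b → a ≡ b
double-cancel {a} {b} = *-cancelˡ-≡ a b 2

module Cases {A : Set} (_≟_ : DecidableEquality A) (w : List A) (cl cr cp : ℕ)
  (cl-max : IsMaximum (PalPrefixLen w) cl)
  (cr-max : IsMaximum (PalSuffixLen w) cr)
  (cp-max : IsMaximum (BorderLen w) cp)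
  (cl≤cr : cl ≤ cr) where

  open Count _≟_
  open Grids _≟_ w cl cr cp cl-max cr-max cp-max cl≤cr public
  open Extremality _≟_ w public

  module ExtremalWalk (G : ℕ) (G≤2|v| : G ≤ 2 * |v|) (G≤|Γ₂| : G ≤ |Γ₂|) (0<G : 0 < G)
    (Γ* : Grid A) (0<|Γ*| : 0 < size Γ*) (Γ*-attains : 2 * size Γ* ≤ G * appearances w Γ*) where

    open Discharging G G≤2|v| G≤|Γ₂| 0<G public

    Γ*-extremal : Extremal w Γ*
    Γ*-extremal = extremal-if-attains G 0<G appearances-bound Γ* 0<|Γ*| Γ*-attains

    module OfExtremal (Γ : Grid A) (extremal : Extremal w Γ) where
      open Walk Γ public

      n : ℕ
      n = size Γ

      0<n : 0 < n
      0<n = proj₁ extremal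

      attains : 2 * n ≤ G * appearances w Γ
      attains = extremal-attains G Γ Γ* extremal 0<|Γ*| Γ*-attains

      some-occurrence : ∃₂ λ x d → T (occursAt Γ x d)
      some-occurrence = appearances⇒occurrence Γ 0<n (attains⇒0<appearances G Γ 0<n attains)

      tight : ∀ x d → T (occursAt Γ x d) → ∃₂ λ j d′ → 0 < j × T (occursAt Γ (x ⊕ j) d′) × 2 * j + ψ d ≡ G + ψ d′
      tight x d occurs = tight-gap n (occursAt-periodic Γ 0<n) 0<n x d occurs
        (subst (λ a → 2 * n ≤ G * a) (sym (window-occurrences≡appearances Γ 0<n x)) attains)

  Γ₁-attains-2|v| : 2 * size Γ₁ ≤ 2 * |v| * appearances w Γ₁
  Γ₁-attains-2|v| = subst (λ s → 2 * s ≤ 2 * |v| * appearances w Γ₁) (sym length-v)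
    (subst (_≤ 2 * |v| * appearances w Γ₁) (*-identityʳ (2 * |v|))
      (*-monoʳ-≤ (2 * |v|) (occurrence⇒appearances Γ₁ 0<|Γ₁| (+ 0) true (forward-complete Γ₁ (+ 0) (Γ₁-reads-forward 0)))))

  cr<ℓ⇒0<size-Γ₂ : cr < ℓ → 0 < size Γ₂
  cr<ℓ⇒0<size-Γ₂ cr<ℓ = subst (0 <_) (sym length-u₂u₁ʳ) (<-≤-trans (m<n⇒0<n∸m cr<ℓ) (m≤m+n |u₂| |u₁|))

  Γ₂-attains-|Γ₂| : 0 < size Γ₂ → 2 * size Γ₂ ≤ |Γ₂| * appearances w Γ₂
  Γ₂-attains-|Γ₂| 0<|Γ₂| = subst (λ s → 2 * s ≤ |Γ₂| * appearances w Γ₂) (sym length-u₂u₁ʳ)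
    (subst (_≤ |Γ₂| * appearances w Γ₂) (*-comm |Γ₂| 2) (*-monoʳ-≤ |Γ₂|
      (occurrences⇒appearances Γ₂ 0<|Γ₂| (+ 0) (+ |u₂|)
        (forward-complete Γ₂ (+ 0) (Γ₂-reads-forward 0<|Γ₂| 0))
        (backward-complete Γ₂ (+ |u₂|) (Γ₂-reads-backward 0<|Γ₂|)))))

  Γ₁-equiv-forward : ∀ Γ → 0 < size Γ → ∀ x₀ → (∀ k → T (occursAt Γ (x₀ ⊕ k * |v|) true)) → Equiv Γ Γ₁
  Γ₁-equiv-forward Γ 0<n x₀ occurs = equiv-if-reads-forward Γ v 0<n 0<|Γ₁| x₀ λ k i i<|v| →
    let i<|v|′ = subst (i <_) length-v i<|v| in begin
      ext Γ (x₀ ⊕ (k * length v + i)) ≡⟨ cong (λ p → ext Γ (x₀ ⊕ (k * p + i))) length-v ⟩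
      ext Γ (x₀ ⊕ (k * |v| + i))      ≡⟨ cong (ext Γ) (⊕-+ x₀ (k * |v|) i) ⟩
      ext Γ (x₀ ⊕ k * |v| ⊕ i)        ≡⟨ forward-sound Γ (x₀ ⊕ k * |v|) (occurs k) i (<-≤-trans i<|v|′ |v|≤ℓ) ⟩
      at w i                          ≡⟨ sym (at-v i i<|v|′) ⟩
      at v i                          ∎
    where open ≡-Reasoning

  Γ₁-equiv-backward : ∀ Γ → 0 < size Γ → ∀ x₀ → (∀ k → T (occursAt Γ (x₀ ℤ.- + (k * |v|)) false)) → Equiv Γ Γ₁
  Γ₁-equiv-backward Γ 0<n x₀ occurs = equiv-if-reads-backward Γ v 0<n 0<|Γ₁| (x₀ ⊕ (ℓ ∸ 1)) λ k i i<|v| →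
    let i<|v|′ = subst (i <_) length-v i<|v|
        a = ℓ ∸ suc i
        a-mirror : a + suc i ≡ ℓ
        a-mirror = m∸n+n≡m (<-≤-trans i<|v|′ |v|≤ℓ)
    in begin
      ext Γ (x₀ ⊕ (ℓ ∸ 1) ℤ.- + (k * length v + i)) ≡⟨ cong (λ p → ext Γ (x₀ ⊕ (ℓ ∸ 1) ℤ.- + (k * p + i))) length-v ⟩
      ext Γ (x₀ ⊕ (ℓ ∸ 1) ℤ.- + (k * |v| + i))      ≡⟨ cong (ext Γ) (position a i (k * |v|) a-mirror) ⟩
      ext Γ (x₀ ℤ.- + (k * |v|) ⊕ a)                ≡⟨ backward-sound Γ (x₀ ℤ.- + (k * |v|)) (occurs k) a i a-mirror ⟩
      at w i                                         ≡⟨ sym (at-v i i<|v|′) ⟩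
      at v i                                         ∎
    where
    open ≡-Reasoning
    ring : ∀ x a i K → x ℤ.+ (a ℤ.+ i) ℤ.- (K ℤ.+ i) ≡ x ℤ.- K ℤ.+ a
    ring = ℤ-Ring.solve-∀
    position : ∀ a i K → a + suc i ≡ ℓ → x₀ ⊕ (ℓ ∸ 1) ℤ.- + (K + i) ≡ x₀ ℤ.- + K ⊕ a
    position a i K a-mirror = begin
      x₀ ⊕ (ℓ ∸ 1) ℤ.- + (K + i)          ≡⟨ cong₂ (λ p q → x₀ ℤ.+ p ℤ.- q) (trans (cong +_ (pred-mirror a i a-mirror)) (ℤₚ.pos-+ a i)) (ℤₚ.pos-+ K i) ⟩
      x₀ ℤ.+ (+ a ℤ.+ + i) ℤ.- (+ K ℤ.+ + i) ≡⟨ ring x₀ (+ a) (+ i) (+ K) ⟩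
      x₀ ℤ.- + K ⊕ a                       ∎

  module ShortPeriod (cl+cr<2cp : cl + cr < 2 * cp) where

    2|v|<|Γ₂| : 2 * |v| < |Γ₂|
    2|v|<|Γ₂| with <-≤-connex (2 * |v|) |Γ₂|
    ... | inj₁ 2|v|<|Γ₂|  = 2|v|<|Γ₂|
    ... | inj₂ |Γ₂|≤2|v| = ⊥-elim (<-irrefl |Γ₂|+cl+cr≡2|v|+2cp (+-mono-≤-< |Γ₂|≤2|v| cl+cr<2cp))

    open ExtremalWalk (2 * |v|) ≤-refl (<⇒≤ 2|v|<|Γ₂|) (*-monoʳ-< 2 0<|v|) Γ₁ 0<|Γ₁| Γ₁-attains-2|v|

    module _ (Γ : Grid A) (extremal : Extremal w Γ) where
      open OfExtremal Γ extremal

      next-occurrence : ∀ x d → T (occursAt Γ x d) → T (occursAt Γ (x ⊕ |v|) d)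
      next-occurrence x d occurs with tight x d occurs
      ... | j , d′ , _ , occurs′ , tight-eq = same-direction d d′ occurs occurs′ tight-eq
        where
        same-direction : ∀ d d′ → T (occursAt Γ x d) → T (occursAt Γ (x ⊕ j) d′) → 2 * j + ψ d ≡ 2 * |v| + ψ d′ →
                         T (occursAt Γ (x ⊕ |v|) d)
        same-direction true  true  _ occurs′ eq = subst (λ k → T (occursAt Γ (x ⊕ k) true)) (double-cancel (+-cancelʳ-≡ Δ _ _ eq)) occurs′
        same-direction false false _ occurs′ eq = subst (λ k → T (occursAt Γ (x ⊕ k) false)) (double-cancel (+-cancelʳ-≡ 0 _ _ eq)) occurs′
        same-direction true  false occurs occurs′ eq = ⊥-elim (<⇒≱ 2|v|<|Γ₂| (begin
          |Γ₂|          ≡⟨ |Γ₂|≡2|u₂|+Δ ⟩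
          2 * |u₂| + Δ  ≤⟨ +-monoˡ-≤ Δ (*-monoʳ-≤ 2 (forward-backward-gap Γ x j (forward-sound Γ x occurs) (backward-sound Γ (x ⊕ j) occurs′))) ⟩
          2 * j + Δ     ≡⟨ eq ⟩
          2 * |v| + 0   ≡⟨ +-identityʳ _ ⟩
          2 * |v|       ∎))
          where open ≤-Reasoning
        same-direction false true  occurs occurs′ eq = ⊥-elim (<⇒≱ 2|v|<|Γ₂| (+-cancelʳ-≤ Δ _ _ (begin
          |Γ₂| + Δ      ≡⟨ |Γ₂|+Δ≡2|u₁| ⟩
          2 * |u₁|      ≤⟨ *-monoʳ-≤ 2 (backward-forward-gap Γ x j (backward-sound Γ x occurs) (forward-sound Γ (x ⊕ j) occurs′)) ⟩
          2 * j         ≡⟨ sym (+-identityʳ _) ⟩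
          2 * j + 0     ≡⟨ eq ⟩
          2 * |v| + Δ   ∎)))
          where open ≤-Reasoning

      equiv-Γ₁ : Equiv Γ Γ₁
      equiv-Γ₁ = from-occurrence some-occurrence
        where
        from-occurrence : (∃₂ λ x d → T (occursAt Γ x d)) → Equiv Γ Γ₁
        from-occurrence (x₀ , true  , occurs) = Γ₁-equiv-forward Γ 0<n x₀ λ k →
          iterate-shift (λ x → occursAt Γ x true) |v| (λ x → next-occurrence x true) k x₀ occurs
        from-occurrence (x₀ , false , occurs) = Γ₁-equiv-backward Γ 0<n x₀ λ k →
          iterate-shift-back (λ x → occursAt Γ x false) n |v| (λ z → occursAt-periodic Γ 0<n z false) 0<n
            (λ x → next-occurrence x false) k x₀ occurs

    characterisation : ∀ Γ → 0 < size Γ → Extremal w Γ ⇔ Equiv Γ Γ₁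
    characterisation Γ 0<n = mk⇔ (equiv-Γ₁ Γ) (λ equiv → extremal-equiv Γ Γ₁ Γ*-extremal equiv 0<n)

  module PalindromeCase (palindrome : Palindrome w) where

    private
      mirrored = palindrome⇒mirrored w palindrome

      T-ext : ∀ {a b} → (T a → T b) → (T b → T a) → a ≡ b
      T-ext {true}  {true}  _ _ = refl
      T-ext {true}  {false} f _ = ⊥-elim (f _)
      T-ext {false} {true}  _ g = ⊥-elim (g _)
      T-ext {false} {false} _ _ = refl

    backward≡forward : ∀ Γ x → occursAt Γ x false ≡ occursAt Γ x true
    backward≡forward Γ x = T-ext
      (λ backward → forward-complete Γ x λ i i<ℓ → let (b , i-mirror) = mirror-partner i<ℓ in
         trans (backward-sound Γ x backward i b i-mirror) (sym (mirrored i b i-mirror)))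
      (λ forward → backward-complete Γ x λ a b a-mirror →
         trans (forward-sound Γ x forward a (mirror-<ˡ a b a-mirror)) (mirrored a b a-mirror))

    forwardOnly : Grid A → ℤ → Bool → Bool
    forwardOnly Γ x true  = occursAt Γ x true
    forwardOnly Γ x false = false

    gap : ∀ Γ x j d d′ → T (forwardOnly Γ x d) → T (forwardOnly Γ (x ⊕ j) d′) → 0 < j ⊎ d ≢ d′ → 2 * |v| + 0 ≤ 2 * j + 0
    gap Γ x j true true first second (inj₁ 0<j) = +-monoˡ-≤ 0 (*-monoʳ-≤ 2
      (period-minimal j 0<j (forward-forward⇒period Γ x j (forward-sound Γ x first) (forward-sound Γ (x ⊕ j) second))))
    gap Γ x j true true first second (inj₂ d≢d′) = ⊥-elim (d≢d′ refl)

    module ForwardWalk (Γ : Grid A) = EventWalk (forwardOnly Γ) (2 * |v|) (λ _ → 0) (*-monoʳ-< 2 0<|v|) (gap Γ)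

    appearances≡2*forward : ∀ Γ → 0 < size Γ → ∀ x → appearances w Γ ≡ 2 * window (ForwardWalk.events Γ) x (size Γ)
    appearances≡2*forward Γ 0<n x = begin
      appearances w Γ                                                   ≡⟨ sym (window-occurrences≡appearances Γ 0<n x) ⟩
      window (λ y → boolToℕ (occursAt Γ y true) + boolToℕ (occursAt Γ y false)) x n
        ≡⟨ ∑-cong n (λ i _ → cong (λ b → boolToℕ (occursAt Γ (x ⊕ i) true) + boolToℕ b) (backward≡forward Γ (x ⊕ i))) ⟩
      window (λ y → boolToℕ (occursAt Γ y true) + boolToℕ (occursAt Γ y true)) x n
        ≡⟨ ∑-+-distrib n _ _ ⟩
      window forward x n + window forward x n                           ≡⟨ twice (window forward x n) ⟩
      2 * window forward x n                                            ≡⟨ cong (2 *_) (∑-cong n (λ i _ → sym (+-identityʳ _))) ⟩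
      2 * window (ForwardWalk.events Γ) x n                             ∎
      where
      open ≡-Reasoning
      n = size Γ
      forward = λ y → boolToℕ (occursAt Γ y true)
      twice : ∀ a → a + a ≡ 2 * a
      twice = solve-∀

    forwardOnly-periodic : ∀ Γ → 0 < size Γ → ForwardWalk.PeriodicEvents Γ (size Γ)
    forwardOnly-periodic Γ 0<n x true  = occursAt-periodic Γ 0<n x true
    forwardOnly-periodic Γ 0<n x false = refl

    forward-occurrence : ∀ Γ x d → T (occursAt Γ x d) → T (forwardOnly Γ x true)
    forward-occurrence Γ x true  occurs = occurs
    forward-occurrence Γ x false occurs = subst T (backward≡forward Γ x) occurs

    appearances-bound : ∀ Γ → 0 < size Γ → |v| * appearances w Γ ≤ 2 * size Γ
    appearances-bound Γ 0<n with appearances w Γ in app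
    ... | zero  = subst (_≤ 2 * size Γ) (sym (*-zeroʳ |v|)) z≤n
    ... | suc m with appearances⇒occurrence Γ 0<n (subst (0 <_) (sym app) (s≤s z≤n))
    ...   | x , d , occurs = begin
      |v| * suc m                                        ≡⟨ cong (|v| *_) (trans (sym app) (appearances≡2*forward Γ 0<n x)) ⟩
      |v| * (2 * window (ForwardWalk.events Γ) x (size Γ)) ≡⟨ regroup |v| _ ⟩
      2 * |v| * window (ForwardWalk.events Γ) x (size Γ)   ≤⟨ ForwardWalk.events-per-period Γ (size Γ) (forwardOnly-periodic Γ 0<n) x true (forward-occurrence Γ x d occurs) ⟩
      2 * size Γ                                         ∎
      where
      open ≤-Reasoning
      regroup : ∀ g W → g * (2 * W) ≡ 2 * g * W
      regroup = solve-∀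

    Γ₁-attains : 2 * size Γ₁ ≤ |v| * appearances w Γ₁
    Γ₁-attains = subst (λ s → 2 * s ≤ |v| * appearances w Γ₁) (sym length-v)
      (subst (_≤ |v| * appearances w Γ₁) (*-comm |v| 2) (*-monoʳ-≤ |v|
        (occurrences⇒appearances Γ₁ 0<|Γ₁| (+ 0) (+ 0) forward (subst T (sym (backward≡forward Γ₁ (+ 0))) forward))))
      where
      forward = forward-complete Γ₁ (+ 0) (Γ₁-reads-forward 0)

    Γ₁-extremal : Extremal w Γ₁
    Γ₁-extremal = extremal-if-attains |v| 0<|v| appearances-bound Γ₁ 0<|Γ₁| Γ₁-attains

    module _ (Γ : Grid A) (extremal : Extremal w Γ) where

      private
        n = size Γ
        0<n = proj₁ extremal
      open ForwardWalk Γ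

      attains : 2 * n ≤ |v| * appearances w Γ
      attains = extremal-attains |v| Γ Γ₁ extremal 0<|Γ₁| Γ₁-attains

      next-occurrence : ∀ x → T (occursAt Γ x true) → T (occursAt Γ (x ⊕ |v|) true)
      next-occurrence x occurs with tight-gap n (forwardOnly-periodic Γ 0<n) 0<n x true occurs full
        where
        regroup : ∀ g W → g * (2 * W) ≡ 2 * g * W
        regroup = solve-∀
        full : 2 * n ≤ 2 * |v| * window events x n
        full = subst (2 * n ≤_) (trans (cong (|v| *_) (appearances≡2*forward Γ 0<n x)) (regroup |v| _)) attains
      ... | j , true , _ , occurs′ , tight-eq =
        subst (λ k → T (occursAt Γ (x ⊕ k) true)) (double-cancel (+-cancelʳ-≡ 0 _ _ tight-eq)) occurs′

      equiv-Γ₁ : Equiv Γ Γ₁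
      equiv-Γ₁ = from-occurrence (appearances⇒occurrence Γ 0<n (attains⇒0<appearances |v| Γ 0<n attains))
        where
        from-occurrence : (∃₂ λ x d → T (occursAt Γ x d)) → Equiv Γ Γ₁
        from-occurrence (x₀ , d , occurs) = Γ₁-equiv-forward Γ 0<n x₀ λ k →
          iterate-shift (λ x → occursAt Γ x true) |v| next-occurrence k x₀ (forward-occurrence Γ x₀ d occurs)

    characterisation : ∀ Γ → 0 < size Γ → Extremal w Γ ⇔ Equiv Γ Γ₁
    characterisation Γ 0<n = mk⇔ (equiv-Γ₁ Γ) (λ equiv → extremal-equiv Γ Γ₁ Γ₁-extremal equiv 0<n)

  module LongPeriod (2cp<cl+cr : 2 * cp < cl + cr) (not-palindrome : ¬ Palindrome w) where

    |Γ₂|<2|v| : |Γ₂| < 2 * |v|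
    |Γ₂|<2|v| with <-≤-connex |Γ₂| (2 * |v|)
    ... | inj₁ |Γ₂|<2|v| = |Γ₂|<2|v|
    ... | inj₂ 2|v|≤|Γ₂| = ⊥-elim (<-irrefl (sym |Γ₂|+cl+cr≡2|v|+2cp) (+-mono-≤-< 2|v|≤|Γ₂| 2cp<cl+cr))

    cr<ℓ : cr < ℓ
    cr<ℓ with <-≤-connex cr ℓ
    ... | inj₁ cr<ℓ = cr<ℓ
    ... | inj₂ ℓ≤cr = ⊥-elim (not-palindrome (cr≡ℓ⇒palindrome (≤-antisym cr≤ℓ ℓ≤cr)))

    0<size-Γ₂ : 0 < size Γ₂
    0<size-Γ₂ = cr<ℓ⇒0<size-Γ₂ cr<ℓ

    0<|Γ₂| : 0 < |Γ₂|
    0<|Γ₂| = subst (0 <_) length-u₂u₁ʳ 0<size-Γ₂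


    open ExtremalWalk |Γ₂| (<⇒≤ |Γ₂|<2|v|) ≤-refl 0<|Γ₂| Γ₂ 0<size-Γ₂ (Γ₂-attains-|Γ₂| 0<size-Γ₂)

    partner : Bool → ℕ
    partner true  = |u₂|
    partner false = |u₁|

    module _ (Γ : Grid A) (extremal : Extremal w Γ) where
      open OfExtremal Γ extremal

      next-occurrence : ∀ x d → T (occursAt Γ x d) → T (occursAt Γ (x ⊕ partner d) (not d))
      next-occurrence x d occurs with tight x d occurs
      ... | j , d′ , 0<j , occurs′ , tight-eq = alternate d d′ occurs occurs′ tight-eq
        where
        alternate : ∀ d d′ → T (occursAt Γ x d) → T (occursAt Γ (x ⊕ j) d′) → 2 * j + ψ d ≡ |Γ₂| + ψ d′ →
                    T (occursAt Γ (x ⊕ partner d) (not d))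
        alternate true  false _ occurs′ eq = subst (λ k → T (occursAt Γ (x ⊕ k) false))
          (double-cancel (+-cancelʳ-≡ Δ _ _ (trans eq (trans (+-identityʳ _) |Γ₂|≡2|u₂|+Δ)))) occurs′
        alternate false true  _ occurs′ eq = subst (λ k → T (occursAt Γ (x ⊕ k) true))
          (double-cancel (trans (sym (+-identityʳ _)) (trans eq |Γ₂|+Δ≡2|u₁|))) occurs′
        alternate true  true  occurs occurs′ eq = ⊥-elim (<⇒≱ |Γ₂|<2|v| (≤-trans
          (*-monoʳ-≤ 2 (forward-forward-gap Γ x j (forward-sound Γ x occurs) (forward-sound Γ (x ⊕ j) occurs′) 0<j))
          (≤-reflexive (+-cancelʳ-≡ Δ _ _ eq))))
        alternate false false occurs occurs′ eq = ⊥-elim (<⇒≱ |Γ₂|<2|v| (≤-trans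
          (*-monoʳ-≤ 2 (backward-backward-gap Γ x j (backward-sound Γ x occurs) (backward-sound Γ (x ⊕ j) occurs′) 0<j))
          (≤-reflexive (+-cancelʳ-≡ 0 _ _ eq))))

      next-forward : ∀ x → T (occursAt Γ x true) → T (occursAt Γ (x ⊕ |Γ₂|) true)
      next-forward x occurs = subst (λ y → T (occursAt Γ y true)) (sym (⊕-+ x |u₂| |u₁|))
        (next-occurrence (x ⊕ |u₂|) false (next-occurrence x true occurs))

      forward-from : (∃₂ λ x d → T (occursAt Γ x d)) → ∃[ x ] T (occursAt Γ x true)
      forward-from (x , true  , occurs) = x , occurs
      forward-from (x , false , occurs) = x ⊕ |u₁| , next-occurrence x false occurs

      equiv-Γ₂ : Equiv Γ Γ₂
      equiv-Γ₂ = from-forward (forward-from some-occurrence)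
        where
        open ≡-Reasoning
        from-forward : ∃[ x ] T (occursAt Γ x true) → Equiv Γ Γ₂
        from-forward (x₀ , occurs) = equiv-if-reads-forward Γ u₂u₁ʳ 0<n 0<size-Γ₂ x₀ λ k i i<|Γ₂| →
          let occurs-k = iterate-shift (λ x → occursAt Γ x true) |Γ₂| next-forward k x₀ occurs in begin
            ext Γ (x₀ ⊕ (k * length u₂u₁ʳ + i)) ≡⟨ cong (λ p → ext Γ (x₀ ⊕ (k * p + i))) length-u₂u₁ʳ ⟩
            ext Γ (x₀ ⊕ (k * |Γ₂| + i))         ≡⟨ cong (ext Γ) (⊕-+ x₀ (k * |Γ₂|) i) ⟩
            ext Γ (x₀ ⊕ k * |Γ₂| ⊕ i)           ≡⟨ reads-u₂u₁ʳ 0<size-Γ₂ Γ (x₀ ⊕ k * |Γ₂|) (forward-sound Γ (x₀ ⊕ k * |Γ₂|) occurs-k)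
                                                     (backward-sound Γ (x₀ ⊕ k * |Γ₂| ⊕ |u₂|) (next-occurrence _ true occurs-k)) i i<|Γ₂| ⟩
            at u₂u₁ʳ i                          ∎

    characterisation : ∀ Γ → 0 < size Γ → Extremal w Γ ⇔ Equiv Γ Γ₂
    characterisation Γ 0<n = mk⇔ (equiv-Γ₂ Γ) (λ equiv → extremal-equiv Γ Γ₂ Γ*-extremal equiv 0<n)

  module Balanced (cl+cr≡2cp : cl + cr ≡ 2 * cp) where

    cp+cp≡cl+cr : cp + cp ≡ cl + cr
    cp+cp≡cl+cr = trans (cong (_+_ cp) (sym (+-identityʳ cp))) (sym cl+cr≡2cp)

    cp≤cr : cp ≤ cr
    cp≤cr with <-≤-connex cr cp
    ... | inj₂ cp≤cr = cp≤cr
    ... | inj₁ cr<cp = ⊥-elim (<-irrefl (sym cp+cp≡cl+cr) (+-mono-≤-< (≤-trans cl≤cr (<⇒≤ cr<cp)) cr<cp))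

    δ : ℕ
    δ = cr ∸ cp

    cp+δ≡cr : cp + δ ≡ cr
    cp+δ≡cr = m+[n∸m]≡n cp≤cr

    cl+δ≡cp : cl + δ ≡ cp
    cl+δ≡cp = +-cancelʳ-≡ cr _ _ (begin
      cl + δ + cr     ≡⟨ regroup cl δ cr ⟩
      cl + cr + δ     ≡⟨ cong (_+ δ) (sym cp+cp≡cl+cr) ⟩
      cp + cp + δ     ≡⟨ +-assoc cp cp δ ⟩
      cp + (cp + δ)   ≡⟨ cong (_+_ cp) cp+δ≡cr ⟩
      cp + cr         ∎)
      where
      open ≡-Reasoning
      regroup : ∀ l d r → l + d + r ≡ l + r + d
      regroup = solve-∀

    cl≤cp : cl ≤ cp
    cl≤cp = subst (cl ≤_) cl+δ≡cp (m≤m+n cl δ)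

    Δ≡δ+δ : Δ ≡ δ + δ
    Δ≡δ+δ = +-cancelˡ-≡ cl _ _ (trans cl+Δ≡cr (trans (sym cp+δ≡cr) (trans (cong (_+ δ) (sym cl+δ≡cp)) (+-assoc cl δ δ))))

    |v|≡|u₂|+δ : |v| ≡ |u₂| + δ
    |v|≡|u₂|+δ = +-cancelʳ-≡ cp _ _ (begin
      |v| + cp          ≡⟨ |v|+cp≡ℓ ⟩
      ℓ                 ≡⟨ sym |u₂|+cr≡ℓ ⟩
      |u₂| + cr         ≡⟨ cong (_+_ |u₂|) (trans (sym cp+δ≡cr) (+-comm cp δ)) ⟩
      |u₂| + (δ + cp)   ≡⟨ sym (+-assoc |u₂| δ cp) ⟩
      |u₂| + δ + cp     ∎)
      where open ≡-Reasoning

    ℓ≡|v|+cl+δ : ℓ ≡ |v| + (cl + δ)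
    ℓ≡|v|+cl+δ = trans (sym |v|+cp≡ℓ) (cong (_+_ |v|) (sym cl+δ≡cp))

    |Γ₂|≡2|v| : |Γ₂| ≡ 2 * |v|
    |Γ₂|≡2|v| = +-cancelʳ-≡ (cl + cr) _ _ (trans |Γ₂|+cl+cr≡2|v|+2cp (cong (_+_ (2 * |v|)) (sym cl+cr≡2cp)))

    cr<ℓ : cr < ℓ
    cr<ℓ with <-≤-connex cr ℓ
    ... | inj₁ cr<ℓ = cr<ℓ
    ... | inj₂ ℓ≤cr = ⊥-elim (<-irrefl (*-cancelˡ-≡ cp ℓ 2 (trans (sym cl+cr≡2cp) ℓ+ℓ)) cp<ℓ)
      where
      palindrome = cr≡ℓ⇒palindrome (≤-antisym cr≤ℓ ℓ≤cr)
      ℓ+ℓ : cl + cr ≡ 2 * ℓ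
      ℓ+ℓ = trans (cong₂ _+_ (palindrome⇒cl≡ℓ palindrome) (palindrome⇒cr≡ℓ palindrome)) (cong (_+_ ℓ) (sym (+-identityʳ ℓ)))

    0<|u₂| : 0 < |u₂|
    0<|u₂| = m<n⇒0<n∸m cr<ℓ

    δ<|v| : δ < |v|
    δ<|v| = subst (δ <_) (trans (+-comm δ |u₂|) (sym |v|≡|u₂|+δ)) (m<m+n δ 0<|u₂|)

    δ≤cr : δ ≤ cr
    δ≤cr = subst (δ ≤_) cp+δ≡cr (m≤n+m δ cp)

    cl+|v|≡cp+|u₂| : cl + |v| ≡ cp + |u₂|
    cl+|v|≡cp+|u₂| = begin
      cl + |v|          ≡⟨ cong (_+_ cl) (trans |v|≡|u₂|+δ (+-comm |u₂| δ)) ⟩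
      cl + (δ + |u₂|)   ≡⟨ sym (+-assoc cl δ |u₂|) ⟩
      cl + δ + |u₂|     ≡⟨ cong (_+ |u₂|) cl+δ≡cp ⟩
      cp + |u₂|         ∎
      where open ≡-Reasoning

    private
      module _ (|v|<cr : |v| < cr) where

        |u₂|<cp : |u₂| < cp
        |u₂|<cp = +-cancelʳ-< δ |u₂| cp (subst₂ _<_ |v|≡|u₂|+δ (sym cp+δ≡cr) |v|<cr)

        mirror-left<cp : ∀ a b → a ≤ b → a + suc b ≡ cl + |v| → a < cp
        mirror-left<cp a b a≤b a-mirror with <-≤-connex a cp
        ... | inj₁ a<cp = a<cp
        ... | inj₂ cp≤a = ⊥-elim (<⇒≱ a+a<cp+cp (+-mono-≤ cp≤a cp≤a))
          where
          open ≤-Reasoning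
          a+a<cp+cp : a + a < cp + cp
          a+a<cp+cp = begin-strict
            a + a        ≤⟨ +-monoʳ-≤ a a≤b ⟩
            a + b        <⟨ +-monoʳ-< a (n<1+n b) ⟩
            a + suc b    ≡⟨ trans a-mirror cl+|v|≡cp+|u₂| ⟩
            cp + |u₂|    <⟨ +-monoʳ-< cp |u₂|<cp ⟩
            cp + cp      ∎

        |u₂|≤mirror-right : ∀ a b → a ≤ b → a + suc b ≡ cl + |v| → |u₂| ≤ b
        |u₂|≤mirror-right a b a≤b a-mirror with <-≤-connex b |u₂|
        ... | inj₂ |u₂|≤b = |u₂|≤b
        ... | inj₁ b<|u₂| = ⊥-elim (<-irrefl (trans a-mirror cl+|v|≡cp+|u₂|)
          (<-≤-trans (+-mono-<-≤ (≤-<-trans a≤b b<|u₂|) b<|u₂|) (+-monoˡ-≤ |u₂| (<⇒≤ |u₂|<cp))))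

        prefix-beyond-cl-≤ : ∀ a b → a ≤ b → a + suc b ≡ cl + |v| → at w a ≡ at w b
        prefix-beyond-cl-≤ a b a≤b a-mirror = begin
          at w a                      ≡⟨ period-|v| a a+|v|<ℓ ⟩
          at w (a + |v|)              ≡⟨ cong (at w) (trans (cong (_+_ a) |v|≡|u₂|+δ) (regroup a |u₂| δ)) ⟩
          at w (|u₂| + (δ + a))       ≡⟨ suffix-|u₂| (δ + a) b₁ suffix-mirror ⟩
          at w (|u₂| + b₁)            ≡⟨ cong (at w) (m+[n∸m]≡n (|u₂|≤mirror-right a b a≤b a-mirror)) ⟩
          at w b                      ∎
          where
          open ≡-Reasoning
          regroup : ∀ a s d → a + (s + d) ≡ s + (d + a)
          regroup = solve-∀
          a+|v|<ℓ : a + |v| < ℓ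
          a+|v|<ℓ = subst (a + |v| <_) (trans (+-comm cp |v|) |v|+cp≡ℓ) (+-monoˡ-< |v| (mirror-left<cp a b a≤b a-mirror))
          b₁ = b ∸ |u₂|
          regroup₁ : ∀ d a b s → d + a + suc b + s ≡ d + (a + suc (s + b))
          regroup₁ = solve-∀
          regroup₂ : ∀ d l g → d + (l + g) ≡ g + (l + d)
          regroup₂ = solve-∀
          suffix-mirror : δ + a + suc b₁ + |u₂| ≡ ℓ
          suffix-mirror = begin
            δ + a + suc b₁ + |u₂|        ≡⟨ regroup₁ δ a b₁ |u₂| ⟩
            δ + (a + suc (|u₂| + b₁))    ≡⟨ cong (λ t → δ + (a + suc t)) (m+[n∸m]≡n (|u₂|≤mirror-right a b a≤b a-mirror)) ⟩
            δ + (a + suc b)              ≡⟨ cong (_+_ δ) a-mirror ⟩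
            δ + (cl + |v|)               ≡⟨ regroup₂ δ cl |v| ⟩
            |v| + (cl + δ)               ≡⟨ sym ℓ≡|v|+cl+δ ⟩
            ℓ                            ∎

        prefix-beyond-cl : PrefixMirrored w (cl + |v|)
        prefix-beyond-cl a b a-mirror with ≤-total a b
        ... | inj₁ a≤b = prefix-beyond-cl-≤ a b a≤b a-mirror
        ... | inj₂ b≤a = sym (prefix-beyond-cl-≤ b a b≤a (trans (+-suc b a) (trans (cong suc (+-comm b a)) (trans (sym (+-suc a b)) a-mirror))))

    -- Otherwise the prefix of length cl + |v| would be a palindrome: reflect through the period |v|
    -- and then through the palindromic suffix.
    cr≤|v| : cr ≤ |v|
    cr≤|v| with <-≤-connex |v| cr
    ... | inj₂ cr≤|v| = cr≤|v|
    ... | inj₁ |v|<cr = ⊥-elim (<-irrefl refl (<-≤-trans (m<m+n cl 0<|v|) (prefix-maximal (cl + |v|) cl+|v|≤ℓ (prefix-beyond-cl |v|<cr))))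
      where
      cl+|v|≤ℓ : cl + |v| ≤ ℓ
      cl+|v|≤ℓ = subst (cl + |v| ≤_) (trans (+-comm cp |v|) |v|+cp≡ℓ) (+-monoˡ-≤ |v| cl≤cp)

    cp≤|v| : cp ≤ |v|
    cp≤|v| = ≤-trans cp≤cr cr≤|v|

    v′ : List A
    v′ = suffix |v| u₂u₁ʳ

    |u₁|≡|v|+δ : |u₁| ≡ |v| + δ
    |u₁|≡|v|+δ = trans |u₁|≡|u₂|+Δ (trans (cong (_+_ |u₂|) Δ≡δ+δ) (trans (sym (+-assoc |u₂| δ δ)) (cong (_+ δ) (sym |v|≡|u₂|+δ))))

    length-u₂u₁ʳ∸|v| : length u₂u₁ʳ ∸ |v| ≡ |v|
    length-u₂u₁ʳ∸|v| = trans (cong (_∸ |v|) (trans length-u₂u₁ʳ (trans |Γ₂|≡2|v| (cong (_+_ |v|) (+-identityʳ |v|))))) (m+n∸n≡m |v| |v|)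

    length-v′ : length v′ ≡ |v|
    length-v′ = trans (Listₚ.length-drop (length u₂u₁ʳ ∸ |v|) u₂u₁ʳ) (trans (cong (length u₂u₁ʳ ∸_) length-u₂u₁ʳ∸|v|) length-u₂u₁ʳ∸|v|)

    -- v′ is the reverse of the first |v| letters of u₁, i.e. of w[cl, cl + |v|).
    at-v′ : ∀ i b → i + suc b ≡ |v| → at v′ i ≡ at w (cl + b)
    at-v′ i b i-mirror = begin
      at v′ i                         ≡⟨ at-drop (length u₂u₁ʳ ∸ |v|) u₂u₁ʳ i ⟩
      at u₂u₁ʳ (length u₂u₁ʳ ∸ |v| + i) ≡⟨ cong (λ k → at u₂u₁ʳ (k + i)) (trans length-u₂u₁ʳ∸|v| |v|≡|u₂|+δ) ⟩
      at u₂u₁ʳ (|u₂| + δ + i)         ≡⟨ cong (at u₂u₁ʳ) (+-assoc |u₂| δ i) ⟩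
      at u₂u₁ʳ (|u₂| + (δ + i))       ≡⟨ at-u₂u₁ʳ-u₁ʳ (δ + i) b mirror ⟩
      at w (cl + b)                   ∎
      where
      open ≡-Reasoning
      mirror : δ + i + suc b ≡ |u₁|
      mirror = trans (+-assoc δ i (suc b)) (trans (cong (_+_ δ) i-mirror) (trans (+-comm δ |v|) (sym |u₁|≡|v|+δ)))

    private
      cp+|v|≡ℓ : cp + |v| ≡ ℓ
      cp+|v|≡ℓ = trans (+-comm cp |v|) |v|+cp≡ℓ

      through-period : ∀ a b′ b → a + suc b′ ≡ δ → a + suc b ≡ ℓ → at w (cl + b′) ≡ at w b
      through-period a b′ b a-mirror′ a-mirror = trans (period-|v| (cl + b′) (subst (cl + b′ + |v| <_) cp+|v|≡ℓ (+-monoˡ-< |v| cl+b′<cp)))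
        (cong (at w) (+-cancelʳ-≡ (suc a) _ _ (begin
          cl + b′ + |v| + suc a      ≡⟨ regroup cl b′ |v| a ⟩
          cl + (a + suc b′) + |v|    ≡⟨ cong (λ t → cl + t + |v|) a-mirror′ ⟩
          cl + δ + |v|               ≡⟨ cong (_+ |v|) cl+δ≡cp ⟩
          cp + |v|                   ≡⟨ trans cp+|v|≡ℓ (sym a-mirror) ⟩
          a + suc b                  ≡⟨ regroup′ a b ⟩
          b + suc a                  ∎)))
        where
        open ≡-Reasoning
        regroup : ∀ c b g a → c + b + g + suc a ≡ c + (a + suc b) + g
        regroup = solve-∀
        regroup′ : ∀ a b → a + suc b ≡ b + suc a
        regroup′ = solve-∀
        cl+b′<cp : cl + b′ < cp
        cl+b′<cp = subst (cl + b′ <_) cl+δ≡cp (+-monoʳ-< cl (mirror-<ʳ a b′ a-mirror′))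

    v′-prefix : ∀ j → j < cp → at v′ j ≡ at w j
    v′-prefix j j<cp = begin
      at v′ j                      ≡⟨ at-v′ j b j-mirror ⟩
      at w (cl + b)                ≡⟨ cong (at w) (sym (m+[n∸m]≡n |u₂|≤cl+b)) ⟩
      at w (|u₂| + a)              ≡⟨ suffix-|u₂| a (δ + j) suffix-mirror ⟩
      at w (|u₂| + (δ + j))        ≡⟨ cong (at w) (trans (sym (+-assoc |u₂| δ j)) (trans (cong (_+ j) (sym |v|≡|u₂|+δ)) (+-comm |v| j))) ⟩
      at w (j + |v|)               ≡⟨ sym (period-|v| j (subst (j + |v| <_) cp+|v|≡ℓ (+-monoˡ-< |v| j<cp))) ⟩
      at w j                       ∎
      where
      open ≡-Reasoning
      j<|v| = <-≤-trans j<cp cp≤|v|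
      b = proj₁ (mirror-partner j<|v|)
      j-mirror : j + suc b ≡ |v|
      j-mirror = proj₂ (mirror-partner j<|v|)
      regroup : ∀ c b j → c + (j + suc b) ≡ suc j + (c + b)
      regroup = solve-∀
      cl+b+suc-j : suc j + (cl + b) ≡ cl + |v|
      cl+b+suc-j = trans (sym (regroup cl b j)) (cong (_+_ cl) j-mirror)
      |u₂|≤cl+b : |u₂| ≤ cl + b
      |u₂|≤cl+b = +-cancelˡ-≤ (suc j) |u₂| (cl + b)
        (≤-trans (+-monoˡ-≤ |u₂| j<cp) (≤-reflexive (trans (sym cl+|v|≡cp+|u₂|) (sym cl+b+suc-j))))
      a = cl + b ∸ |u₂|
      regroup₁ : ∀ a d j s → a + suc (d + j) + s ≡ s + a + d + suc j
      regroup₁ = solve-∀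
      regroup₂ : ∀ c b d j → c + b + d + suc j ≡ c + d + (j + suc b)
      regroup₂ = solve-∀
      suffix-mirror : a + suc (δ + j) + |u₂| ≡ ℓ
      suffix-mirror = begin
        a + suc (δ + j) + |u₂|    ≡⟨ regroup₁ a δ j |u₂| ⟩
        |u₂| + a + δ + suc j      ≡⟨ cong (λ t → t + δ + suc j) (m+[n∸m]≡n |u₂|≤cl+b) ⟩
        cl + b + δ + suc j        ≡⟨ regroup₂ cl b δ j ⟩
        cl + δ + (j + suc b)      ≡⟨ cong₂ _+_ cl+δ≡cp j-mirror ⟩
        cp + |v|                  ≡⟨ cp+|v|≡ℓ ⟩
        ℓ                         ∎

    v-prefix : ∀ j → j < cp → at v j ≡ at w j
    v-prefix j j<cp = at-v j (<-≤-trans j<cp cp≤|v|)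

    v-tail : ∀ a b → a < δ → a + suc b ≡ ℓ → at v (|u₂| + a) ≡ at w b
    v-tail a b a<δ a-mirror = begin
      at v (|u₂| + a)     ≡⟨ at-v (|u₂| + a) (subst (|u₂| + a <_) (sym |v|≡|u₂|+δ) (+-monoʳ-< |u₂| a<δ)) ⟩
      at w (|u₂| + a)     ≡⟨ suffix-|u₂| a b′ suffix-mirror ⟩
      at w (|u₂| + b′)    ≡⟨ cong (at w) (m+[n∸m]≡n |u₂|≤b) ⟩
      at w b              ∎
      where
      open ≡-Reasoning
      |u₂|≤b : |u₂| ≤ b
      |u₂|≤b with <-≤-connex b |u₂|
      ... | inj₂ |u₂|≤b = |u₂|≤b
      ... | inj₁ b<|u₂| = ⊥-elim (<-irrefl a-mirror (<-≤-trans (+-mono-<-≤ (<-≤-trans a<δ δ≤cr) b<|u₂|)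
                                                         (≤-reflexive (trans (+-comm cr |u₂|) |u₂|+cr≡ℓ))))
      b′ = b ∸ |u₂|
      regroup : ∀ a b s → a + suc b + s ≡ a + suc (s + b)
      regroup = solve-∀
      suffix-mirror : a + suc b′ + |u₂| ≡ ℓ
      suffix-mirror = trans (regroup a b′ |u₂|) (trans (cong (λ t → a + suc t) (m+[n∸m]≡n |u₂|≤b)) a-mirror)

    v′-tail : ∀ a b → a < δ → a + suc b ≡ ℓ → at v′ (|u₂| + a) ≡ at w b
    v′-tail a b a<δ a-mirror = trans (at-v′ (|u₂| + a) b′ mirror) (through-period a b′ b (proj₂ (mirror-partner a<δ)) a-mirror)
      where
      b′ = proj₁ (mirror-partner a<δ)
      mirror : |u₂| + a + suc b′ ≡ |v|
      mirror = trans (+-assoc |u₂| a (suc b′)) (trans (cong (_+_ |u₂|) (proj₂ (mirror-partner a<δ))) (sym |v|≡|u₂|+δ))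

    v′-reversed : ∀ i b → i < |v| → δ + i + suc b ≡ ℓ → at v′ i ≡ at w b
    v′-reversed i b i<|v| mirror = trans (at-v′ i b′ (proj₂ (mirror-partner i<|v|))) (cong (at w) cl+b′≡b)
      where
      b′ = proj₁ (mirror-partner i<|v|)
      regroup : ∀ c b i → c + b + suc i ≡ c + (i + suc b)
      regroup = solve-∀
      regroup′ : ∀ d i b → d + i + suc b ≡ b + suc i + d
      regroup′ = solve-∀
      cl+b′≡b : cl + b′ ≡ b
      cl+b′≡b = +-cancelʳ-≡ (suc i) _ _ (+-cancelʳ-≡ δ _ _ (begin
        cl + b′ + suc i + δ        ≡⟨ cong (_+ δ) (regroup cl b′ i) ⟩
        cl + (i + suc b′) + δ      ≡⟨ cong (λ t → cl + t + δ) (proj₂ (mirror-partner i<|v|)) ⟩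
        cl + |v| + δ               ≡⟨ regroup″ cl |v| δ ⟩
        |v| + (cl + δ)             ≡⟨ sym ℓ≡|v|+cl+δ ⟩
        ℓ                          ≡⟨ sym mirror ⟩
        δ + i + suc b              ≡⟨ regroup′ δ i b ⟩
        b + suc i + δ              ∎))
        where
        open ≡-Reasoning
        regroup″ : ∀ c g d → c + g + d ≡ g + (c + d)
        regroup″ = solve-∀

    L : ℕ
    L = |v| ∸ cr

    cp+L≡|u₂| : cp + L ≡ |u₂|
    cp+L≡|u₂| = +-cancelʳ-≡ δ _ _ (begin
      cp + L + δ     ≡⟨ regroup cp L δ ⟩
      cp + δ + L     ≡⟨ cong (_+ L) cp+δ≡cr ⟩
      cr + L         ≡⟨ m+[n∸m]≡n cr≤|v| ⟩
      |v|            ≡⟨ |v|≡|u₂|+δ ⟩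
      |u₂| + δ       ∎)
      where
      open ≡-Reasoning
      regroup : ∀ c l d → c + l + d ≡ c + d + l
      regroup = solve-∀

    x y z : List A
    x = take cl w
    y = take δ (drop cl w)
    z = take L (drop cp w)

    private
      take-+ : ∀ m n (xs : List A) → take (m + n) xs ≡ take m xs ++ take n (drop m xs)
      take-+ zero    n xs       = refl
      take-+ (suc m) n []       = sym (cong (_++_ []) (Listₚ.take-[] n))
      take-+ (suc m) n (a ∷ xs) = cong (a ∷_) (take-+ m n xs)

      three-pieces : ∀ (u : List A) → u ≡ take cp u ++ take L (drop cp u) ++ drop |u₂| u
      three-pieces u = begin
        u                                                      ≡⟨ sym (Listₚ.take++drop≡id cp u) ⟩
        take cp u ++ drop cp u                                 ≡⟨ cong (take cp u ++_) (sym (Listₚ.take++drop≡id L (drop cp u))) ⟩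
        take cp u ++ take L (drop cp u) ++ drop L (drop cp u)  ≡⟨ cong (λ t → take cp u ++ take L (drop cp u) ++ t)
                                                                    (trans (Listₚ.drop-drop cp L u) (cong (λ k → drop k u) cp+L≡|u₂|)) ⟩
        take cp u ++ take L (drop cp u) ++ drop |u₂| u         ∎
        where open ≡-Reasoning

      length-y : length y ≡ δ
      length-y = length-take-≤ (drop cl w) δ (subst (δ ≤_) (sym (Listₚ.length-drop cl w))
        (m+n≤o⇒m≤o∸n δ (subst (_≤ ℓ) (sym (trans (+-comm δ cl) cl+δ≡cp)) (<⇒≤ cp<ℓ))))

      prefix≡x++y : ∀ (u : List A) → cp ≤ length u → (∀ j → j < cp → at u j ≡ at w j) → take cp u ≡ x ++ y
      prefix≡x++y u cp≤|u| agrees = trans (at-injective-< _ _ same-length pointwise) (subst (λ k → take k w ≡ x ++ y) cl+δ≡cp (take-+ cl δ w))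
        where
        same-length : length (take cp u) ≡ length (take cp w)
        same-length = trans (length-take-≤ u cp cp≤|u|) (sym (length-take-≤ w cp (<⇒≤ cp<ℓ)))
        pointwise : ∀ j → j < length (take cp u) → at (take cp u) j ≡ at (take cp w) j
        pointwise j j<cp′ = let j<cp = subst (j <_) (length-take-≤ u cp cp≤|u|) j<cp′ in
          trans (at-take cp u j j<cp) (trans (agrees j j<cp) (sym (at-take cp w j j<cp)))

      length-take-drop : ∀ (u : List A) m n → m + n ≤ length u → length (take n (drop m u)) ≡ n
      length-take-drop u m n m+n≤|u| = length-take-≤ (drop m u) n
        (subst (n ≤_) (sym (Listₚ.length-drop m u)) (m+n≤o⇒m≤o∸n n (subst (_≤ length u) (+-comm m n) m+n≤|u|)))

      cp+L≤|v| : cp + L ≤ |v|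
      cp+L≤|v| = subst (_≤ |v|) (sym cp+L≡|u₂|) (subst (|u₂| ≤_) (sym |v|≡|u₂|+δ) (m≤m+n |u₂| δ))

      length-z : length z ≡ L
      length-z = length-take-drop w cp L (≤-trans cp+L≤|v| |v|≤ℓ)

      length-middle : ∀ (u : List A) → length u ≡ |v| → length (take L (drop cp u)) ≡ length z
      length-middle u |u|≡|v| = trans (length-take-drop u cp L (subst (cp + L ≤_) (sym |u|≡|v|) cp+L≤|v|)) (sym length-z)

      at-middle : ∀ (u : List A) k → k < L → at (take L (drop cp u)) k ≡ at u (cp + k)
      at-middle u k k<L = trans (at-take L (drop cp u) k k<L) (at-drop cp u k)

      tail≡reverse-y : ∀ (u : List A) → length u ≡ |v| → (∀ a b → a < δ → a + suc b ≡ ℓ → at u (|u₂| + a) ≡ at w b) →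
                       drop |u₂| u ≡ reverse y
      tail≡reverse-y u |u|≡|v| tail = at-injective-< _ _ same-length pointwise
        where
        length-tail : length (drop |u₂| u) ≡ δ
        length-tail = trans (Listₚ.length-drop |u₂| u) (trans (cong (_∸ |u₂|) (trans |u|≡|v| |v|≡|u₂|+δ)) (m+n∸m≡n |u₂| δ))
        same-length : length (drop |u₂| u) ≡ length (reverse y)
        same-length = trans length-tail (sym (trans (Listₚ.length-reverse y) length-y))
        pointwise : ∀ a → a < length (drop |u₂| u) → at (drop |u₂| u) a ≡ at (reverse y) a
        pointwise a a<|tail| = begin
          at (drop |u₂| u) a     ≡⟨ at-drop |u₂| u a ⟩
          at u (|u₂| + a)        ≡⟨ tail a b a<δ a-mirror ⟩
          at w b                 ≡⟨ sym (through-period a b′ b a-mirror′ a-mirror) ⟩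
          at w (cl + b′)         ≡⟨ sym (at-drop cl w b′) ⟩
          at (drop cl w) b′      ≡⟨ sym (at-take δ (drop cl w) b′ (mirror-<ʳ a b′ a-mirror′)) ⟩
          at y b′                ≡⟨ sym (at-reverse y a b′ (trans a-mirror′ (sym length-y))) ⟩
          at (reverse y) a       ∎
          where
          open ≡-Reasoning
          a<δ : a < δ
          a<δ = subst (a <_) length-tail a<|tail|
          b′ = proj₁ (mirror-partner a<δ)
          a-mirror′ : a + suc b′ ≡ δ
          a-mirror′ = proj₂ (mirror-partner a<δ)
          a<ℓ : a < ℓ
          a<ℓ = <-≤-trans a<δ (≤-trans δ≤cr cr≤ℓ)
          b = proj₁ (mirror-partner a<ℓ)
          a-mirror : a + suc b ≡ ℓ
          a-mirror = proj₂ (mirror-partner a<ℓ)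

    v-middle : take L (drop cp v) ≡ z
    v-middle = at-injective-< _ _ (length-middle v length-v) λ k k<L′ →
      let k<L = subst (k <_) (length-take-drop v cp L (subst (cp + L ≤_) (sym length-v) cp+L≤|v|)) k<L′ in
      trans (at-middle v k k<L) (trans (at-v (cp + k) (<-≤-trans (+-monoʳ-< cp k<L) cp+L≤|v|)) (sym (at-middle w k k<L)))

    private
      reflected-middle : ∀ k k′ b → k + suc k′ ≡ L → cp + k + suc b ≡ |v| → cl + b ≡ cp + k′
      reflected-middle k k′ b k-mirror b-mirror = +-cancelʳ-≡ (suc k + cp) _ _ (begin
        cl + b + (suc k + cp)        ≡⟨ sym (+-assoc (cl + b) (suc k) cp) ⟩
        cl + b + suc k + cp          ≡⟨ regroup₁ cl b k cp ⟩
        cl + (cp + k + suc b)        ≡⟨ cong (_+_ cl) b-mirror ⟩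
        cl + |v|                     ≡⟨ cl+|v|≡cp+|u₂| ⟩
        cp + |u₂|                    ≡⟨ cong (_+_ cp) (trans (sym cp+L≡|u₂|) (cong (_+_ cp) (sym k-mirror))) ⟩
        cp + (cp + (k + suc k′))     ≡⟨ sym (regroup₂ cp k k′) ⟩
        cp + k′ + suc k + cp         ≡⟨ +-assoc (cp + k′) (suc k) cp ⟩
        cp + k′ + (suc k + cp)       ∎)
        where
        open ≡-Reasoning
        regroup₁ : ∀ c b k p → c + b + suc k + p ≡ c + (p + k + suc b)
        regroup₁ = solve-∀
        regroup₂ : ∀ p k k′ → p + k′ + suc k + p ≡ p + (p + (k + suc k′))
        regroup₂ = solve-∀

    v′-middle : take L (drop cp v′) ≡ reverse z
    v′-middle = at-injective-< _ _ (trans (length-middle v′ length-v′) (sym (Listₚ.length-reverse z))) λ k k<L′ →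
      let k<L = subst (k <_) (length-take-drop v′ cp L (subst (cp + L ≤_) (sym length-v′) cp+L≤|v|)) k<L′
          (k′ , k-mirror) = mirror-partner k<L
          (b , b-mirror) = mirror-partner (<-≤-trans (+-monoʳ-< cp k<L) cp+L≤|v|)
      in begin
        at (take L (drop cp v′)) k  ≡⟨ at-middle v′ k k<L ⟩
        at v′ (cp + k)              ≡⟨ at-v′ (cp + k) b b-mirror ⟩
        at w (cl + b)               ≡⟨ cong (at w) (reflected-middle k k′ b k-mirror b-mirror) ⟩
        at w (cp + k′)              ≡⟨ sym (at-middle w k′ (mirror-<ʳ k k′ k-mirror)) ⟩
        at z k′                     ≡⟨ sym (at-reverse z k k′ (trans k-mirror (sym length-z))) ⟩
        at (reverse z) k            ∎
      where open ≡-Reasoning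

    v≡xyzyʳ : v ≡ x ++ y ++ z ++ reverse y
    v≡xyzyʳ = begin
      v                                               ≡⟨ three-pieces v ⟩
      take cp v ++ take L (drop cp v) ++ drop |u₂| v  ≡⟨ cong₂ _++_ (prefix≡x++y v (subst (cp ≤_) (sym length-v) cp≤|v|) v-prefix)
                                                                    (cong₂ _++_ v-middle (tail≡reverse-y v length-v v-tail)) ⟩
      (x ++ y) ++ z ++ reverse y                      ≡⟨ Listₚ.++-assoc x y (z ++ reverse y) ⟩
      x ++ y ++ z ++ reverse y                        ∎
      where open ≡-Reasoning

    v′≡xyzʳyʳ : v′ ≡ x ++ y ++ reverse z ++ reverse y
    v′≡xyzʳyʳ = begin
      v′                                                 ≡⟨ three-pieces v′ ⟩
      take cp v′ ++ take L (drop cp v′) ++ drop |u₂| v′  ≡⟨ cong₂ _++_ (prefix≡x++y v′ (subst (cp ≤_) (sym length-v′) cp≤|v|) v′-prefix)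
                                                                       (cong₂ _++_ v′-middle (tail≡reverse-y v′ length-v′ v′-tail)) ⟩
      (x ++ y) ++ reverse z ++ reverse y                 ≡⟨ Listₚ.++-assoc x y (reverse z ++ reverse y) ⟩
      x ++ y ++ reverse z ++ reverse y                   ∎
      where open ≡-Reasoning

    IsBlock : List A → Set
    IsBlock u = u ≡ v ⊎ u ≡ v′

    block-length : ∀ {u} → IsBlock u → length u ≡ |v|
    block-length (inj₁ refl) = length-v
    block-length (inj₂ refl) = length-v′

    block-prefix : ∀ {u} → IsBlock u → ∀ j → j < cp → at u j ≡ at w j
    block-prefix (inj₁ refl) = v-prefix
    block-prefix (inj₂ refl) = v′-prefix

    block-tail : ∀ {u} → IsBlock u → ∀ a b → a < δ → a + suc b ≡ ℓ → at u (|u₂| + a) ≡ at w b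
    block-tail (inj₁ refl) = v-tail
    block-tail (inj₂ refl) = v′-tail

    0<2|v| : 0 < 2 * |v|
    0<2|v| = *-monoʳ-< 2 0<|v|

    open ExtremalWalk (2 * |v|) ≤-refl (≤-reflexive (sym |Γ₂|≡2|v|)) 0<2|v| Γ₁ 0<|Γ₁| Γ₁-attains-2|v|

    module Concatenation (vs : List (List A)) (blocks : All IsBlock vs) (0<M : 0 < length vs) where

      private
        M = length vs
        u = concat vs
        Γᵤ = gridOf u
        lengths : All (λ b → length b ≡ |v|) vs
        lengths = All.map block-length blocks
        instance
          M≢0 : NonZero M
          M≢0 = ℕ.>-nonZero 0<M

      length-u : length u ≡ M * |v|
      length-u = length-concat |v| vs lengths

      0<|Γᵤ| : 0 < size Γᵤ
      0<|Γᵤ| = subst (0 <_) (sym length-u) (*-positive 0<M 0<|v|)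

      block : ℕ → List A
      block k = proj₁ (at-defined vs (k % M) (m%n<n k M))

      private
        block-at : ∀ k → at vs (k % M) ≡ just (block k)
        block-at k = proj₂ (at-defined vs (k % M) (m%n<n k M))

      isBlock : ∀ k → IsBlock (block k)
      isBlock k = All-at blocks (k % M) (block-at k)

      Γᵤ-block : ∀ k i → i < |v| → ext Γᵤ (+ (k * |v| + i)) ≡ at (block k) i
      Γᵤ-block k i i<|v| = begin
        ext Γᵤ (+ (k * |v| + i))                           ≡⟨ cong (λ p → ext Γᵤ (+ p)) position ⟩
        ext Γᵤ (+ (k / M * length u + (k % M * |v| + i)))  ≡⟨ ext-gridOf u (k / M) _ inside ⟩
        at u (k % M * |v| + i)                            ≡⟨ at-concat |v| vs lengths (k % M) i i<|v| ⟩
        (at vs (k % M) >>= λ b → at b i)                  ≡⟨ cong (λ m → m >>= λ b → at b i) (block-at k) ⟩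
        at (block k) i                                    ∎
        where
        open ≡-Reasoning
        regroup : ∀ r q M g i → (r + q * M) * g + i ≡ q * (M * g) + (r * g + i)
        regroup = solve-∀
        position : k * |v| + i ≡ k / M * length u + (k % M * |v| + i)
        position = trans (cong (λ k′ → k′ * |v| + i) (m≡m%n+[m/n]*n k M))
                         (trans (regroup (k % M) (k / M) M |v| i) (cong (λ n → k / M * n + (k % M * |v| + i)) (sym length-u)))
        inside : k % M * |v| + i < length u
        inside = subst (k % M * |v| + i <_) (sym length-u)
                   (<-≤-trans (+-monoʳ-< (k % M * |v|) i<|v|) (≤-trans (≤-reflexive (+-comm _ |v|)) (*-monoˡ-≤ |v| (m%n<n k M))))

      forward-at-block : ∀ k → block k ≡ v → ReadsForward Γᵤ (+ (k * |v|))
      forward-at-block k block≡v i i<ℓ with <-≤-connex i |v|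
      ... | inj₁ i<|v| = trans (Γᵤ-block k i i<|v|) (trans (cong (λ b → at b i) block≡v) (at-v i i<|v|))
      ... | inj₂ |v|≤i with j ← i ∸ |v| | refl ← sym (m+[n∸m]≡n |v|≤i) = begin
        ext Γᵤ (+ (k * |v| + (|v| + j)))   ≡⟨ cong (λ p → ext Γᵤ (+ p)) (regroup k |v| j) ⟩
        ext Γᵤ (+ (suc k * |v| + j))       ≡⟨ Γᵤ-block (suc k) j (<-≤-trans j<cp cp≤|v|) ⟩
        at (block (suc k)) j              ≡⟨ block-prefix (isBlock (suc k)) j j<cp ⟩
        at w j                            ≡⟨ period-|v| j (subst (_< ℓ) (+-comm |v| j) i<ℓ) ⟩
        at w (j + |v|)                    ≡⟨ cong (at w) (+-comm j |v|) ⟩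
        at w (|v| + j)                    ∎
        where
        open ≡-Reasoning
        regroup : ∀ k g j → k * g + (g + j) ≡ suc k * g + j
        regroup = solve-∀
        j<cp : j < cp
        j<cp = +-cancelˡ-< |v| j cp (subst (|v| + j <_) (sym |v|+cp≡ℓ) i<ℓ)

      private
        tail-of-block : ∀ k a b → a < δ → a + suc b ≡ ℓ → ext Γᵤ (+ (k * |v| + |u₂| + a)) ≡ at w b
        tail-of-block k a b a<δ a-mirror = begin
          ext Γᵤ (+ (k * |v| + |u₂| + a))     ≡⟨ cong (λ p → ext Γᵤ (+ p)) (+-assoc (k * |v|) |u₂| a) ⟩
          ext Γᵤ (+ (k * |v| + (|u₂| + a)))   ≡⟨ Γᵤ-block k (|u₂| + a) (subst (|u₂| + a <_) (sym |v|≡|u₂|+δ) (+-monoʳ-< |u₂| a<δ)) ⟩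
          at (block k) (|u₂| + a)             ≡⟨ block-tail (isBlock k) a b a<δ a-mirror ⟩
          at w b                              ∎
          where open ≡-Reasoning

        reversed-next-block : ∀ k a b → block (suc k) ≡ v′ → a < |v| → δ + a + suc b ≡ ℓ →
                              ext Γᵤ (+ (k * |v| + |u₂| + (δ + a))) ≡ at w b
        reversed-next-block k a b block≡v′ a<|v| a-mirror = begin
          ext Γᵤ (+ (k * |v| + |u₂| + (δ + a))) ≡⟨ cong (λ p → ext Γᵤ (+ p)) (regroup k |v| |u₂| δ a (sym |v|≡|u₂|+δ)) ⟩
          ext Γᵤ (+ (suc k * |v| + a))          ≡⟨ Γᵤ-block (suc k) a a<|v| ⟩
          at (block (suc k)) a                  ≡⟨ cong (λ b → at b a) block≡v′ ⟩
          at v′ a                               ≡⟨ v′-reversed a b a<|v| a-mirror ⟩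
          at w b                                ∎
          where
          open ≡-Reasoning
          regroup : ∀ k g s d a → s + d ≡ g → k * g + s + (d + a) ≡ suc k * g + a
          regroup k g s d a refl = ring k s d a
            where
            ring : ∀ k s d a → k * (s + d) + s + (d + a) ≡ suc k * (s + d) + a
            ring = solve-∀

        prefix-after-next-block : ∀ k j b → δ + (|v| + j) + suc b ≡ ℓ →
                                  ext Γᵤ (+ (k * |v| + |u₂| + (δ + (|v| + j)))) ≡ at w b
        prefix-after-next-block k j b a-mirror = begin
          ext Γᵤ (+ (k * |v| + |u₂| + (δ + (|v| + j)))) ≡⟨ cong (λ p → ext Γᵤ (+ p)) (regroup k |v| |u₂| δ j (sym |v|≡|u₂|+δ)) ⟩
          ext Γᵤ (+ (suc (suc k) * |v| + j))            ≡⟨ Γᵤ-block (suc (suc k)) j (<-≤-trans j<cl (≤-trans cl≤cp cp≤|v|)) ⟩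
          at (block (suc (suc k))) j                    ≡⟨ block-prefix (isBlock (suc (suc k))) j (<-≤-trans j<cl cl≤cp) ⟩
          at w j                                        ≡⟨ prefix-cl j b j-mirror ⟩
          at w b                                        ∎
          where
          open ≡-Reasoning
          regroup : ∀ k g s d j → s + d ≡ g → k * g + s + (d + (g + j)) ≡ suc (suc k) * g + j
          regroup k g s d j refl = ring k s d j
            where
            ring : ∀ k s d j → k * (s + d) + s + (d + ((s + d) + j)) ≡ suc (suc k) * (s + d) + j
            ring = solve-∀
          regroup′ : ∀ d g j b → d + (g + j) + suc b ≡ g + d + (j + suc b)
          regroup′ = solve-∀
          regroup″ : ∀ g c d → g + (c + d) ≡ g + d + c
          regroup″ = solve-∀
          j-mirror : j + suc b ≡ cl
          j-mirror = +-cancelˡ-≡ (|v| + δ) _ _ (trans (sym (regroup′ δ |v| j b)) (trans a-mirror (trans ℓ≡|v|+cl+δ (regroup″ |v| cl δ))))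
          j<cl : j < cl
          j<cl = mirror-<ˡ j b j-mirror

      -- The cells read backwards run through the tail of block k, all of block k + 1 (which must be v′)
      -- and the head of block k + 2.
      backward-before-block : ∀ k → block (suc k) ≡ v′ → ReadsBackward Γᵤ (+ (k * |v| + |u₂|))
      backward-before-block k block≡v′ a b a-mirror with <-≤-connex a δ
      ... | inj₁ a<δ = tail-of-block k a b a<δ a-mirror
      ... | inj₂ δ≤a with a′ ← a ∸ δ | refl ← sym (m+[n∸m]≡n δ≤a) with <-≤-connex a′ |v|
      ...   | inj₁ a′<|v| = reversed-next-block k a′ b block≡v′ a′<|v| a-mirror
      ...   | inj₂ |v|≤a′ with j ← a′ ∸ |v| | refl ← sym (m+[n∸m]≡n |v|≤a′) = prefix-after-next-block k j b a-mirror

      private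
        module W = Walk Γᵤ

      occurrence-per-block : ∀ k → 1 ≤ window W.events (+ (k * |v| + |u₂|)) |v|
      occurrence-per-block k with isBlock (suc k)
      ... | inj₂ block≡v′ = ≤-trans (≤-reflexive (sym (W.events≡1 _ false occurs))) (term≤∑ |v| _ 0 0<|v|)
        where
        occurs : T (occursAt Γᵤ (+ (k * |v| + |u₂|) ⊕ 0) false)
        occurs = subst (λ p → T (occursAt Γᵤ p false)) (sym (ℤₚ.+-identityʳ (+ (k * |v| + |u₂|))))
                   (backward-complete Γᵤ (+ (k * |v| + |u₂|)) (backward-before-block k block≡v′))
      ... | inj₁ block≡v = ≤-trans (≤-reflexive (sym (W.events≡1 _ true occurs))) (term≤∑ |v| _ δ δ<|v|)
        where
        regroup : ∀ k g s d → s + d ≡ g → suc k * g ≡ k * g + s + d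
        regroup k g s d refl = ring k s d
          where
          ring : ∀ k s d → suc k * (s + d) ≡ k * (s + d) + s + d
          ring = solve-∀
        occurs : T (occursAt Γᵤ (+ (k * |v| + |u₂|) ⊕ δ) true)
        occurs = subst (λ p → T (occursAt Γᵤ (+ p) true)) (regroup k |v| |u₂| δ (sym |v|≡|u₂|+δ))
                   (forward-complete Γᵤ (+ (suc k * |v|)) (forward-at-block (suc k) block≡v))

      M≤appearances : M ≤ appearances w Γᵤ
      M≤appearances = begin
        M                                                          ≤⟨ n≤∑-of-positives M _ (λ k _ → occurrence-per-block k) ⟩
        ∑ M (λ k → window W.events (+ (k * |v| + |u₂|)) |v|)       ≡⟨ ∑-cong M (λ k _ → ∑-cong |v| (λ i _ → cong W.events (cong +_ (regroup k |v| |u₂| i)))) ⟩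
        ∑ M (λ k → ∑ |v| (λ i → W.events (+ |u₂| ⊕ (k * |v| + i)))) ≡⟨ sym (∑-blocks M |v| _) ⟩
        window W.events (+ |u₂|) (M * |v|)                         ≡⟨ cong (window W.events (+ |u₂|)) (sym length-u) ⟩
        window W.events (+ |u₂|) (size Γᵤ)                         ≡⟨ window-occurrences≡appearances Γᵤ 0<|Γᵤ| (+ |u₂|) ⟩
        appearances w Γᵤ                                           ∎
        where
        open ≤-Reasoning
        regroup : ∀ k g s i → k * g + s + i ≡ s + (k * g + i)
        regroup = solve-∀

      concatenation-extremal : Extremal w Γᵤ
      concatenation-extremal = extremal-if-attains (2 * |v|) 0<2|v| appearances-bound Γᵤ 0<|Γᵤ| (begin
        2 * size Γᵤ               ≡⟨ cong (2 *_) length-u ⟩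
        2 * (M * |v|)             ≡⟨ regroup M |v| ⟩
        2 * |v| * M               ≤⟨ *-monoʳ-≤ (2 * |v|) M≤appearances ⟩
        2 * |v| * appearances w Γᵤ ∎)
        where
        open ≤-Reasoning
        regroup : ∀ m g → 2 * (m * g) ≡ 2 * g * m
        regroup = solve-∀

    choose : Bool → List A
    choose true  = v
    choose false = v′

    choose-isBlock : ∀ b → IsBlock (choose b)
    choose-isBlock true  = inj₁ refl
    choose-isBlock false = inj₂ refl

    module _ (Γ : Grid A) (extremal : Extremal w Γ) where
      open OfExtremal Γ extremal

      BlockStart : ℤ → Set
      BlockStart b = T (occursAt Γ b true) ⊎ T (occursAt Γ (b ℤ.- + δ) false)

      private
        block-after-forward : ∀ b j d′ → T (occursAt Γ (b ⊕ j) d′) → 2 * j + Δ ≡ 2 * |v| + ψ d′ → BlockStart (b ⊕ |v|)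
        block-after-forward b j true  occurs′ eq = inj₁ (subst (λ k → T (occursAt Γ (b ⊕ k) true)) (double-cancel (+-cancelʳ-≡ Δ _ _ eq)) occurs′)
        block-after-forward b j false occurs′ eq = inj₂ (subst (λ p → T (occursAt Γ p false)) position occurs′)
          where
          j+δ≡|v| : j + δ ≡ |v|
          j+δ≡|v| = double-cancel (trans (regroup j δ) (trans (cong (_+_ (2 * j)) (sym Δ≡δ+δ)) (trans eq (+-identityʳ _))))
            where
            regroup : ∀ j d → 2 * (j + d) ≡ 2 * j + (d + d)
            regroup = solve-∀
          shift : ∀ b j d → b ℤ.+ j ≡ b ℤ.+ (j ℤ.+ d) ℤ.- d
          shift = ℤ-Ring.solve-∀
          position : b ⊕ j ≡ b ⊕ |v| ℤ.- + δ
          position = trans (shift b (+ j) (+ δ)) (cong (λ t → b ℤ.+ t ℤ.- + δ) (trans (sym (ℤₚ.pos-+ j δ)) (cong +_ j+δ≡|v|)))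

        block-after-backward : ∀ b j d′ → T (occursAt Γ (b ℤ.- + δ ⊕ j) d′) → 2 * j + 0 ≡ 2 * |v| + ψ d′ →
                               BlockStart (b ⊕ |v|)
        block-after-backward b j false occurs′ eq = inj₂ (subst (λ p → T (occursAt Γ p false)) position occurs′)
          where
          j≡|v| : j ≡ |v|
          j≡|v| = double-cancel (+-cancelʳ-≡ 0 _ _ eq)
          swap : ∀ b d g → b ℤ.- d ℤ.+ g ≡ b ℤ.+ g ℤ.- d
          swap = ℤ-Ring.solve-∀
          position : b ℤ.- + δ ⊕ j ≡ b ⊕ |v| ℤ.- + δ
          position = trans (cong (λ k → b ℤ.- + δ ⊕ k) j≡|v|) (swap b (+ δ) (+ |v|))
        block-after-backward b j true  occurs′ eq = inj₁ (subst (λ p → T (occursAt Γ p true)) position occurs′)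
          where
          regroup : ∀ j g d → 2 * j + 0 ≡ 2 * g + (d + d) → 2 * j ≡ 2 * (g + d)
          regroup j g d eq = trans (sym (+-identityʳ _)) (trans eq (distrib g d))
            where
            distrib : ∀ g d → 2 * g + (d + d) ≡ 2 * (g + d)
            distrib = solve-∀
          j≡|v|+δ : j ≡ |v| + δ
          j≡|v|+δ = double-cancel (regroup j |v| δ (trans eq (cong (_+_ (2 * |v|)) Δ≡δ+δ)))
          cancel : ∀ b d g → b ℤ.- d ℤ.+ (g ℤ.+ d) ≡ b ℤ.+ g
          cancel = ℤ-Ring.solve-∀
          position : b ℤ.- + δ ⊕ j ≡ b ⊕ |v|
          position = trans (cong (λ k → b ℤ.- + δ ⊕ k) j≡|v|+δ) (trans (cong (ℤ._+_ (b ℤ.- + δ)) (ℤₚ.pos-+ |v| δ)) (cancel b (+ δ) (+ |v|)))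

      next-block : ∀ b → BlockStart b → BlockStart (b ⊕ |v|)
      next-block b (inj₁ forward) with tight b true forward
      ... | j , d′ , _ , occurs′ , tight-eq = block-after-forward b j d′ occurs′ tight-eq
      next-block b (inj₂ backward) with tight (b ℤ.- + δ) false backward
      ... | j , d′ , _ , occurs′ , tight-eq = block-after-backward b j d′ occurs′ tight-eq

      blocks-from : ∀ b → BlockStart b → ∀ k → BlockStart (b ⊕ k * |v|)
      blocks-from b start zero    = subst BlockStart (sym (ℤₚ.+-identityʳ b)) start
      blocks-from b start (suc k) = subst BlockStart (sym (⊕-+ b |v| (k * |v|))) (blocks-from (b ⊕ |v|) (next-block b start) k)

      block-content : ∀ b → BlockStart b → ∀ i → i < |v| → ext Γ (b ⊕ i) ≡ at (choose (occursAt Γ b true)) i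
      block-content b start i i<|v| with occursAt Γ b true in is-forward | start
      ... | true  | _             = trans (forward-sound Γ b (subst T (sym is-forward) _) i (<-≤-trans i<|v| |v|≤ℓ)) (sym (at-v i i<|v|))
      ... | false | inj₁ forward  = ⊥-elim forward
      ... | false | inj₂ backward = begin
        ext Γ (b ⊕ i)               ≡⟨ cong (ext Γ) (shift b (+ δ) (+ i)) ⟩
        ext Γ (b ℤ.- + δ ℤ.+ (+ δ ℤ.+ + i)) ≡⟨ cong (λ t → ext Γ (b ℤ.- + δ ℤ.+ t)) (sym (ℤₚ.pos-+ δ i)) ⟩
        ext Γ (b ℤ.- + δ ⊕ (δ + i)) ≡⟨ backward-sound Γ (b ℤ.- + δ) backward (δ + i) β mirror ⟩
        at w β                      ≡⟨ sym (v′-reversed i β i<|v| mirror) ⟩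
        at v′ i                     ∎
        where
        open ≡-Reasoning
        shift : ∀ b d i → b ℤ.+ i ≡ b ℤ.- d ℤ.+ (d ℤ.+ i)
        shift = ℤ-Ring.solve-∀
        δ+i<ℓ : δ + i < ℓ
        δ+i<ℓ = <-≤-trans (+-monoʳ-< δ i<|v|) (≤-trans (≤-reflexive (+-comm δ |v|)) (subst (|v| + δ ≤_) (sym ℓ≡|v|+cl+δ) (+-monoʳ-≤ |v| (m≤n+m δ cl))))
        β = proj₁ (mirror-partner δ+i<ℓ)
        mirror : δ + i + suc β ≡ ℓ
        mirror = proj₂ (mirror-partner δ+i<ℓ)

      private
        m = appearances w Γ

      n≡m*|v| : n ≡ m * |v|
      n≡m*|v| = double-cancel (≤-antisym
        (≤-trans attains (≤-reflexive (regroup |v| m)))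
        (≤-trans (≤-reflexive (sym (regroup |v| m))) (appearances-bound Γ 0<n)))
        where
        regroup : ∀ g m → 2 * g * m ≡ 2 * (m * g)
        regroup = solve-∀

      0<m : 0 < m
      0<m = attains⇒0<appearances (2 * |v|) Γ 0<n attains

      module _ (b₀ : ℤ) (start : BlockStart b₀) where

        σ : ℕ → Bool
        σ k = occursAt Γ (b₀ ⊕ k * |v|) true

        σ-periodic : ∀ K k → σ (K * m + k) ≡ σ k
        σ-periodic K k = trans (cong (λ p → occursAt Γ p true) position)
                               (periodic-* (λ p → occursAt Γ p true) n (λ z → occursAt-periodic Γ 0<n z true) K (b₀ ⊕ k * |v|))
          where
          regroup : ∀ K m k g → (K * m + k) * g ≡ k * g + K * (m * g)
          regroup = solve-∀
          position : b₀ ⊕ (K * m + k) * |v| ≡ b₀ ⊕ k * |v| ⊕ K * n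
          position = trans (cong (b₀ ⊕_) (trans (regroup K m k |v|) (cong (λ t → k * |v| + K * t) (sym n≡m*|v|)))) (⊕-+ b₀ (k * |v|) (K * n))

        vs : List (List A)
        vs = applyUpTo (choose ∘ σ) m

        length-concat-vs : length (concat vs) ≡ m * |v|
        length-concat-vs = trans (length-concat |v| vs (All-applyUpTo (choose ∘ σ) m (λ k → block-length (choose-isBlock (σ k)))))
                                 (cong (_* |v|) (Listₚ.length-applyUpTo (choose ∘ σ) m))

        reads-vs : ∀ K i → i < length (concat vs) → ext Γ (b₀ ⊕ (K * length (concat vs) + i)) ≡ at (concat vs) i
        reads-vs K i i<|u| with quotient-remainder i |v| 0<|v|
        ... | k , r , r<|v| , refl = begin
          ext Γ (b₀ ⊕ (K * length (concat vs) + (k * |v| + r)))  ≡⟨ cong (ext Γ) position ⟩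
          ext Γ (b₀ ⊕ (K * m + k) * |v| ⊕ r)                     ≡⟨ block-content _ (blocks-from b₀ start (K * m + k)) r r<|v| ⟩
          at (choose (σ (K * m + k))) r                          ≡⟨ cong (λ s → at (choose s) r) (σ-periodic K k) ⟩
          at (choose (σ k)) r                                    ≡⟨ sym (cong (λ b → b >>= λ u → at u r) (at-applyUpTo (choose ∘ σ) m k k<m)) ⟩
          (at vs k >>= λ u → at u r)                             ≡⟨ sym (at-concat |v| vs lengths k r r<|v|) ⟩
          at (concat vs) (k * |v| + r)                           ∎
          where
          open ≡-Reasoning
          lengths = All-applyUpTo (choose ∘ σ) m (λ k → block-length (choose-isBlock (σ k)))
          regroup : ∀ K m g k r → K * (m * g) + (k * g + r) ≡ (K * m + k) * g + r
          regroup = solve-∀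
          position : b₀ ⊕ (K * length (concat vs) + (k * |v| + r)) ≡ b₀ ⊕ (K * m + k) * |v| ⊕ r
          position = trans (cong (b₀ ⊕_) (trans (cong (λ t → K * t + (k * |v| + r)) length-concat-vs) (regroup K m |v| k r)))
                           (⊕-+ b₀ ((K * m + k) * |v|) r)
          k<m : k < m
          k<m with <-≤-connex k m
          ... | inj₁ k<m = k<m
          ... | inj₂ m≤k = ⊥-elim (<⇒≱ (subst (k * |v| + r <_) length-concat-vs i<|u|) (≤-trans (*-monoˡ-≤ |v| m≤k) (m≤m+n (k * |v|) r)))

      concatenation-of-blocks : ∃[ vs ] (0 < length vs × All IsBlock vs × Equiv Γ (gridOf (concat vs)))
      concatenation-of-blocks = from-start (first-block some-occurrence)
        where
        cancel : ∀ x d → x ℤ.+ d ℤ.- d ≡ x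
        cancel = ℤ-Ring.solve-∀
        first-block : (∃₂ λ x d → T (occursAt Γ x d)) → ∃[ b ] BlockStart b
        first-block (x , true  , occurs) = x , inj₁ occurs
        first-block (x , false , occurs) = x ⊕ δ , inj₂ (subst (λ p → T (occursAt Γ p false)) (sym (cancel x (+ δ))) occurs)
        from-start : ∃[ b ] BlockStart b → ∃[ vs ] (0 < length vs × All IsBlock vs × Equiv Γ (gridOf (concat vs)))
        from-start (b₀ , start) =
          vs b₀ start ,
          subst (0 <_) (sym (Listₚ.length-applyUpTo (choose ∘ σ b₀ start) m)) 0<m ,
          All-applyUpTo (choose ∘ σ b₀ start) m (λ k → choose-isBlock (σ b₀ start k)) ,
          equiv-if-reads-forward Γ (concat (vs b₀ start)) 0<n (subst (0 <_) (sym (length-concat-vs b₀ start)) (*-positive 0<m 0<|v|))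
            b₀ (reads-vs b₀ start)

    Γ₁-extremal : Extremal w Γ₁
    Γ₁-extremal = Γ*-extremal

    Γ₂-extremal : Extremal w Γ₂
    Γ₂-extremal = extremal-if-attains (2 * |v|) 0<2|v| appearances-bound Γ₂ 0<size-Γ₂
      (subst (λ G → 2 * size Γ₂ ≤ G * appearances w Γ₂) |Γ₂|≡2|v| (Γ₂-attains-|Γ₂| 0<size-Γ₂))
      where
      0<size-Γ₂ = cr<ℓ⇒0<size-Γ₂ cr<ℓ

    -- Γ₁ already meets the bound with a single (forward) occurrence per period.
    Γ₁-forward-only : ∀ y → ¬ T (occursAt Γ₁ y false)
    Γ₁-forward-only y backward = <⇒≱ (s≤s (s≤s z≤n)) (*-cancelˡ-≤ (2 * |v|) {{ℕ.>-nonZero 0<2|v|}} (begin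
      2 * |v| * 2                  ≤⟨ *-monoʳ-≤ (2 * |v|) (occurrences⇒appearances Γ₁ 0<|Γ₁| (+ 0) y
                                        (forward-complete Γ₁ (+ 0) (Γ₁-reads-forward 0)) backward) ⟩
      2 * |v| * appearances w Γ₁   ≤⟨ appearances-bound Γ₁ 0<|Γ₁| ⟩
      2 * size Γ₁                  ≡⟨ cong (2 *_) length-v ⟩
      2 * |v|                      ≡⟨ sym (*-identityʳ (2 * |v|)) ⟩
      2 * |v| * 1                  ∎))
      where open ≤-Reasoning

    Γ₁≁Γ₂ : ¬ Equiv Γ₁ Γ₂
    Γ₁≁Γ₂ (true , t , same) = Γ₁-forward-only (q ℤ.- + (ℓ ∸ 1)) (subst T (sym (occursAt-backward Γ₁ q))
      (subst T (matchFrom-transport _≟_ Γ₁ Γ₂ (sgn true) t same (+ |u₂| ⊕ (ℓ ∸ 1)) -[1+ 0 ] w)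
        (backward-complete Γ₂ (+ |u₂|) (Γ₂-reads-backward (cr<ℓ⇒0<size-Γ₂ cr<ℓ)))))
      where q = sgn true ℤ.* (+ |u₂| ⊕ (ℓ ∸ 1)) ℤ.+ t
    Γ₁≁Γ₂ (false , t , same) = Γ₁-forward-only (q ℤ.- + (ℓ ∸ 1)) (subst T (sym (occursAt-backward Γ₁ q))
      (subst T (matchFrom-transport _≟_ Γ₁ Γ₂ (sgn false) t same (+ 0) (+ 1) w)
        (forward-complete Γ₂ (+ 0) (Γ₂-reads-forward (cr<ℓ⇒0<size-Γ₂ cr<ℓ) 0))))
      where q = sgn false ℤ.* + 0 ℤ.+ t

    characterisation : ∀ Γ → 0 < size Γ →
                       Extremal w Γ ⇔ (∃[ vs ] (0 < length vs × All IsBlock vs × Equiv Γ (gridOf (concat vs))))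
    characterisation Γ 0<n = mk⇔ (concatenation-of-blocks Γ) λ where
      (vs , 0<M , blocks , equiv) → extremal-equiv Γ (gridOf (concat vs)) (Concatenation.concatenation-extremal vs blocks 0<M) equiv 0<n

    decomposition : ∃[ x ] ∃[ y ] ∃[ z ] (v ≡ x ++ y ++ z ++ reverse y × v′ ≡ x ++ y ++ reverse z ++ reverse y)
    decomposition = x , y , z , v≡xyzyʳ , v′≡xyzʳyʳ

proposition3p5 : {A : Set} (_≟_ : DecidableEquality A) (w : List A) →
  (∃[ a ] ∃[ b ] (a ∈ w × b ∈ w × a ≢ b)) →
  (cl cr cp : ℕ) →
  IsMaximum (PalPrefixLen w) cl →
  IsMaximum (PalSuffixLen w) cr →
  IsMaximum (BorderLen w) cp →
  cl ≤ cr →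
  let open Count _≟_
      ℓ = length w
      v = take (ℓ ∸ cp) w
      u₁ = drop cl w
      u₂ = take (ℓ ∸ cr) w
      Γ₁ = gridOf v
      Γ₂ = gridOf (u₂ ++ reverse u₁)
      v' = suffix (ℓ ∸ cp) (u₂ ++ reverse u₁)
  in
  ((cl + cr < 2 * cp ⊎ Palindrome w) →
    ∀ (Γ : Grid A) → 0 < size Γ → (Extremal w Γ ⇔ Equiv Γ Γ₁))
  ×
  (2 * cp < cl + cr → ¬ Palindrome w →
    ∀ (Γ : Grid A) → 0 < size Γ → (Extremal w Γ ⇔ Equiv Γ Γ₂))
  ×
  (cl + cr ≡ 2 * cp →
    ¬ Equiv Γ₁ Γ₂ × Extremal w Γ₁ × Extremal w Γ₂
    × (∀ (Γ : Grid A) → 0 < size Γ →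
         (Extremal w Γ ⇔
           (∃[ vs ] (0 < length vs × All (λ x → x ≡ v ⊎ x ≡ v') vs
                     × Equiv Γ (gridOf (concat vs))))))
    × (∃[ x ] ∃[ y ] ∃[ z ] (v ≡ x ++ y ++ z ++ reverse y × v' ≡ x ++ y ++ reverse z ++ reverse y)))
proposition3p5 _≟_ w _ cl cr cp cl-max cr-max cp-max cl≤cr =
    [ ShortPeriod.characterisation , PalindromeCase.characterisation ]
  , LongPeriod.characterisation
  , λ balanced → let open Balanced balanced in Γ₁≁Γ₂ , Γ₁-extremal , Γ₂-extremal , characterisation , decomposition
  where
  open Cases _≟_ w cl cr cp cl-max cr-max cp-max cl≤cr
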